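{- For $i=1,2$ let $\Sigma_i=(S_i,\sigma_i,\mu_i)$ be a signed graph of order $n_i$ with marking $\mu_i$, and let $\Sigma_{i\mu}$ be its $\mu$-signed graph. Let $\lambda'_{11},\dots,\lambda'_{1n_1}$ be the eigenvalues of $A(\Sigma_{1\mu})$. Write the signed adjacency coronal of $\Sigma_{2\mu}$ in reduced form $\chi_{A(\Sigma_{2\mu})}(x)=P'_{d-1}(x)/F'_d(x)$, and let $R'_{n_2-d}(x)$ be the corresponding greatest common divisor, so that $\det(xI_{n_2}-A(\Sigma_{2\mu}))=R'_{n_2-d}(x)F'_d(x)$. Then the characteristic polynomial of the adjacency matrix of the product $\Sigma_1\circledast\Sigma_2$ is $$f(A(\Sigma_1\circledast\Sigma_2),x)=x^{n_1(n_2-1)}\,R'_{n_2-d}(x)^{n_1}\prod_{i=1}^{n_1}\Big[xF'_d(x)-n_2\big(\lambda'_{1i}F'_d(x)+P'_{d-1}(x)\big)\Big].$$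
   Context: A signed graph is a triple $\Sigma=(S,\sigma,\mu)$ where $S=(V,E)$ is a finite simple undirected graph, $\sigma:E\to\{+1,-1\}$ is a signature and $\mu:V\to\{+1,-1\}$ is a marking. Its adjacency matrix $A(\Sigma)$ has $(i,j)$ entry $\sigma(u_iu_j)$ if $u_i\sim u_j$ and $0$ otherwise. The $\mu$-signed graph of $\Sigma$ is $\Sigma_\mu=(S,\sigma_\mu,\mu)$ with $\sigma_\mu(uv)=\mu(u)\mu(v)$ for every edge $uv$. Write $\mu(\Sigma)\in\{\pm1\}^n$ for the column vector of vertex marks. The signed adjacency coronal of $\Sigma_\mu$ (order $n$) is the rational function $\chi_{A(\Sigma_\mu)}(x)=\mu(\Sigma)^T(xI_n-A(\Sigma_\mu))^{ -1}\mu(\Sigma)$. Writing it as $p(x)/f(x)$ with $f(x)=\det(xI_n-A(\Sigma_\mu))$ and $p(x)=\mu(\Sigma)^T\mathrm{adj}(xI_n-A(\Sigma_\mu))\mu(\Sigma)$, let $R'_{n-d}(x)$ be the monic greatest common divisor of $p$ and $f$ (of degree $n-d$), $F'_d=f/R'_{n-d}$ (degree $d$) and $P'_{d-1}=p/R'_{n-d}$ (degree $d-1$). Product $\Sigma_1\circledast\Sigma_2$: if $\Sigma_1$ has vertices $u_1,\dots,u_{n_1}$ and $\Sigma_2$ has vertices $v_1,\dots,v_{n_2}$, then $\Sigma_1\circledast\Sigma_2$ has the $2n_1n_2$ vertices $a_{ij},b_{ij}$ ($1\le i\le n_1$, $1\le j\le n_2$) with marking $\mu(a_{ij})=\mu_1(u_i)$,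 $\mu(b_{ij})=\mu_2(v_j)$. Its edges are: $a_{ik}a_{jl}$ for all $1\le k,l\le n_2$ whenever $u_iu_j\in E(\Sigma_1)$; $b_{ri}b_{rj}$ for all $1\le r\le n_1$ whenever $v_iv_j\in E(\Sigma_2)$; and $a_{ip}b_{iq}$ for all $1\le i\le n_1$, $1\le p,q\le n_2$. Every edge $xy$ of the product gets sign $\mu(x)\mu(y)$. -}

module Defs where

open import Level using (Level)
open import Data.Bool using (Bool; true; false; if_then_else_; _∧_; _∨_)
open import Data.Nat as ℕ using (ℕ; zero; suc)
open import Data.Fin as Fin using (Fin; zero; suc; splitAt; remQuot; punchIn; toℕ)
open import Data.Fin.Properties using (_≟_)
open import Data.Sum using (inj₁; inj₂)
open import Data.Product using (_×_; _,_; ∃)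
open import Data.List using (List; []; _∷_)
open import Data.Sign as Sign using (Sign)
open import Relation.Nullary.Decidable using (⌊_⌋)
open import Relation.Binary.PropositionalEquality using (_≡_)
open import Algebra.Bundles using (CommutativeRing)

-- Signed graphs  Σ = (S, σ, μ)  on the vertex set Fin n.
-- 'adj i j ≡ true' means u_i ~ u_j.  'sig' is the signature (only its
-- values on edges matter), 'mark' the marking μ.

record SignedGraph (n : ℕ) : Set where
  field
    adj  : Fin n → Fin n → Bool
    sig  : Fin n → Fin n → Sign
    mark : Fin n → Sign
open SignedGraph public

record IsSignedGraph {n : ℕ} (Σ : SignedGraph n) : Set where
  field
    adj-sym    : ∀ i j → adj Σ i j ≡ adj Σ j i
    adj-irrefl : ∀ i → adj Σ i i ≡ false
    sig-sym    : ∀ i j → adj Σ i j ≡ true → sig Σ i j ≡ sig Σ j i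

μSigned : ∀ {n} → SignedGraph n → SignedGraph n
μSigned Σ = record
  { adj  = adj Σ
  ; sig  = λ i j → mark Σ i Sign.* mark Σ j
  ; mark = mark Σ }

-- The product Σ₁ ⊛ Σ₂ on 2 n₁ n₂ vertices, indexed by
-- Fin (n₁ * n₂ + n₁ * n₂): the first block is a_{ij}, the second b_{ij},
-- with (i , j) ↦ Fin.combine i j.
module _ {n₁ n₂ : ℕ} (Σ₁ : SignedGraph n₁) (Σ₂ : SignedGraph n₂) where

  private
    eqF : ∀ {m} → Fin m → Fin m → Bool
    eqF i j = ⌊ i ≟ j ⌋

    N : ℕ
    N = n₁ ℕ.* n₂

    prodAdj : Fin (N ℕ.+ N) → Fin (N ℕ.+ N) → Bool
    prodAdj x y with splitAt N x | splitAt N y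
    ... | inj₁ a | inj₁ a' with remQuot {n₁} n₂ a | remQuot {n₁} n₂ a'
    ...   | (i , k) | (j , l) = adj Σ₁ i j
    prodAdj x y | inj₂ b | inj₂ b' with remQuot {n₁} n₂ b | remQuot {n₁} n₂ b'
    ...   | (r , i) | (r' , j) = eqF r r' ∧ adj Σ₂ i j
    prodAdj x y | inj₁ a | inj₂ b with remQuot {n₁} n₂ a | remQuot {n₁} n₂ b
    ...   | (i , p) | (i' , q) = eqF i i'
    prodAdj x y | inj₂ b | inj₁ a with remQuot {n₁} n₂ b | remQuot {n₁} n₂ a
    ...   | (i' , q) | (i , p) = eqF i i'

    prodMark : Fin (N ℕ.+ N) → Sign
    prodMark x with splitAt N x
    ... | inj₁ a with remQuot {n₁} n₂ a
    ...   | (i , k) = mark Σ₁ i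
    prodMark x | inj₂ b with remQuot {n₁} n₂ b
    ...   | (r , j) = mark Σ₂ j

  infixl 7 _⊛_
  _⊛_ : SignedGraph (n₁ ℕ.* n₂ ℕ.+ n₁ ℕ.* n₂)
  _⊛_ = record
    { adj  = prodAdj
    ; sig  = λ x y → prodMark x Sign.* prodMark y
    ; mark = prodMark }

-- Algebra over a commutative ring R: polynomials R[x] (coefficient lists,
-- constant term first, compared coefficientwise), determinants (Laplace
-- expansion along the first row), adjugates, characteristic polynomials.

module Over {c ℓ : Level} (R : CommutativeRing c ℓ) where
  open CommutativeRing R using (_≈_; _+_; _*_; -_; 0#; 1#) renaming (Carrier to A)

  ofℕ : ℕ → A
  ofℕ zero    = 0#
  ofℕ (suc n) = 1# + ofℕ n

  ofSign : Sign → A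
  ofSign Sign.+ = 1#
  ofSign Sign.- = - 1#

  adjMat : ∀ {n} → SignedGraph n → Fin n → Fin n → A
  adjMat Σ i j = if adj Σ i j then ofSign (sig Σ i j) else 0#

  markVec : ∀ {n} → SignedGraph n → Fin n → A
  markVec Σ i = ofSign (mark Σ i)

  Poly : Set c
  Poly = List A

  coeff : Poly → ℕ → A
  coeff []       _       = 0#
  coeff (a ∷ p)  zero    = a
  coeff (a ∷ p)  (suc k) = coeff p k

  infix 4 _≈ₚ_
  _≈ₚ_ : Poly → Poly → Set ℓ
  p ≈ₚ q = ∀ k → coeff p k ≈ coeff q k

  infixl 6 _+ₚ_
  _+ₚ_ : Poly → Poly → Poly
  []      +ₚ q       = q
  (a ∷ p) +ₚ []      = a ∷ p
  (a ∷ p) +ₚ (b ∷ q) = (a + b) ∷ (p +ₚ q)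

  -ₚ_ : Poly → Poly
  -ₚ []      = []
  -ₚ (a ∷ p) = (- a) ∷ (-ₚ p)

  infixl 6 _-ₚ_
  _-ₚ_ : Poly → Poly → Poly
  p -ₚ q = p +ₚ (-ₚ q)

  scale : A → Poly → Poly
  scale a []      = []
  scale a (b ∷ p) = (a * b) ∷ scale a p

  infixl 7 _*ₚ_
  _*ₚ_ : Poly → Poly → Poly
  []      *ₚ q = []
  (a ∷ p) *ₚ q = scale a q +ₚ (0# ∷ (p *ₚ q))

  const : A → Poly
  const a = a ∷ []

  0ₚ 1ₚ X : Poly
  0ₚ = []
  1ₚ = const 1#
  X  = 0# ∷ 1# ∷ []

  infixr 8 _^ₚ_
  _^ₚ_ : Poly → ℕ → Poly
  p ^ₚ zero  = 1ₚ
  p ^ₚ suc n = p *ₚ (p ^ₚ n)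

  ∏ₚ : ∀ n → (Fin n → Poly) → Poly
  ∏ₚ zero    f = 1ₚ
  ∏ₚ (suc n) f = f zero *ₚ ∏ₚ n (λ i → f (suc i))

  ∑ₚ : ∀ n → (Fin n → Poly) → Poly
  ∑ₚ zero    f = 0ₚ
  ∑ₚ (suc n) f = f zero +ₚ ∑ₚ n (λ i → f (suc i))

  infix 4 _∣ₚ_
  _∣ₚ_ : Poly → Poly → Set (c Level.⊔ ℓ)
  d ∣ₚ p = ∃ λ q → p ≈ₚ d *ₚ q

  MonicOfDegree : Poly → ℕ → Set ℓ
  MonicOfDegree p m = coeff p m ≈ 1# × (∀ k → m ℕ.< k → coeff p k ≈ 0#)

  Monic : Poly → Set ℓ
  Monic p = ∃ λ m → MonicOfDegree p m

  Mat : ℕ → Set c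
  Mat n = Fin n → Fin n → Poly

  altSign : ℕ → Poly → Poly
  altSign zero    p = p
  altSign (suc k) p = -ₚ altSign k p

  minor : ∀ {n} → Fin (suc n) → Fin (suc n) → Mat (suc n) → Mat n
  minor i j M r s = M (punchIn i r) (punchIn j s)

  det : ∀ n → Mat n → Poly
  det zero    M = 1ₚ
  det (suc n) M = ∑ₚ (suc n) λ j →
    altSign (toℕ j) (M zero j *ₚ det n (minor zero j M))

  adjugate : ∀ n → Mat n → Mat n
  adjugate zero    M i j = 1ₚ
  adjugate (suc n) M i j = altSign (toℕ i ℕ.+ toℕ j) (det n (minor j i M))

  xI-A : ∀ n → (Fin n → Fin n → A) → Mat n
  xI-A n M i j = (if ⌊ i ≟ j ⌋ then X else 0ₚ) -ₚ const (M i j)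

  charPoly : ∀ n → (Fin n → Fin n → A) → Poly
  charPoly n M = det n (xI-A n M)

  -- numerator p(x) = μᵀ adj(xI − M) μ of the coronal of M with respect to μ
  coronalNum : ∀ n → (Fin n → Fin n → A) → (Fin n → A) → Poly
  coronalNum n M μ = ∑ₚ n λ i → ∑ₚ n λ j →
    const (μ i) *ₚ adjugate n (xI-A n M) i j *ₚ const (μ j)

  record ReducedCoronal (p f R' F' P' : Poly) : Set (c Level.⊔ ℓ) where
    field
      monic      : Monic R'
      f≈R'F'     : f ≈ₚ R' *ₚ F'
      p≈R'P'     : p ≈ₚ R' *ₚ P'
      greatest   : ∀ D → D ∣ₚ p → D ∣ₚ f → D ∣ₚ R'

-- Work over R[x].  Let B = x I − A(Σ₂μ), f = det B, w = μ₂ᵀ adj B and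
-- p = w μ₂, the numerator of the coronal, so that w B = f μ₂ᵀ.  Listing the
-- vertices a_{ik} before the b_{ik}, the matrix x I − A(Σ₁ ⊛ Σ₂) has the block
-- x I − A(Σ₁μ) ⊗ J on the a's (J the all-ones n₂ × n₂ matrix), the block I ⊗ B
-- on the b's, and the entry −μ₁(i) μ₂(l) between a_{ik} and b_{il}.
-- Multiplying every row a_{ik} by f and adding μ₁(i) w applied to the rows
-- b_{i·} clears this coupling and turns the a-block into y I − C ⊗ J, where
-- y = f x and C = f A(Σ₁μ) + p I; hence
--   f^{n₁n₂} · det(x I − A(Σ₁ ⊛ Σ₂)) = det(y I − C ⊗ J) · f^{n₁}.
-- Row and column operations give det(y I − C ⊗ J) = y^{n₁(n₂−1)} det(y I − n₂ C),
-- and y I − n₂ C = u I − v A(Σ₁μ) with u = f x − n₂ p and v = n₂ f.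
-- Homogenising det(x I − A(Σ₁μ)) = ∏ᵢ (x − λ'ᵢ) at x = u / v gives
-- det(u I − v A(Σ₁μ)) = ∏ᵢ (u − v λ'ᵢ), and u − v λ'ᵢ = R' (x F' − n₂ (λ'ᵢ F' + P')).
-- As f is monic, the factor f^{n₁n₂} cancels.

module Submission where

open import Algebra.Bundles using (CommutativeRing; Monoid; Semiring)
open import Algebra.Morphism.Structures using (module RingMorphisms)
open import Data.Bool using (Bool; true; false; if_then_else_; _∧_; not)
open import Data.Bool.Properties using (∧-zeroʳ; ∧-identityʳ; ∧-comm)
open import Data.Empty using (⊥-elim)
open import Data.Fin using (Fin; zero; suc; toℕ; fromℕ<; punchIn; punchOut; inject₁; _↑ˡ_; _↑ʳ_; combine; splitAt; remQuot)
open import Data.Fin.Properties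
  using ( _≟_; suc-injective; punchInᵢ≢i; punchIn-injective; punchIn-punchOut; toℕ-injective; toℕ-inject₁; toℕ-↑ˡ
        ; toℕ-fromℕ<; toℕ<n; splitAt-↑ˡ; splitAt-↑ʳ; ↑ˡ-injective; ↑ʳ-injective; remQuot-combine; combine-remQuot
        ; combine-injective )
open import Data.Fin.Permutation using (Permutation; Permutation′; permutation; _⟨$⟩ʳ_; ↔⇒≡)
import Data.Fin.Permutation.Components as PC
open import Data.Fin.Permutation.Transposition.List using (eval; decompose; eval-decompose)
open import Data.List using ([]; _∷_; length)
open import Data.Nat as ℕ using (ℕ; zero; suc; _<_; _≤_; _<ᵇ_; z≤n; s≤s)
import Data.Nat.Properties as ℕₚ
open import Data.Product using (_×_; _,_; proj₁; proj₂; ∃)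
open import Data.Sign as Sign using (Sign)
open import Data.Sum using ([_,_]′)
open import Data.Vec.Functional using (Vector)
open import Function using (_∘_)
open import Level using (Level)
open import Relation.Binary.Definitions using (tri<; tri≈; tri>)
open import Relation.Binary.PropositionalEquality as ≡ using (_≡_; _≢_)
open import Relation.Nullary using (Dec; yes; no)
open import Relation.Nullary.Decidable using (⌊_⌋; dec-true; dec-false; isYes≗does)
open import Defs

if-true : ∀ {a} {X : Set a} {b} {x y : X} → b ≡ true → (if b then x else y) ≡ x
if-true ≡.refl = ≡.refl

if-false : ∀ {a} {X : Set a} {b} {x y : X} → b ≡ false → (if b then x else y) ≡ y
if-false ≡.refl = ≡.refl

⌊≟⌋-refl : ∀ {n} (i : Fin n) → ⌊ i ≟ i ⌋ ≡ true
⌊≟⌋-refl i = ≡.trans (isYes≗does (i ≟ i)) (dec-true (i ≟ i) ≡.refl)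

⌊≟⌋-≢ : ∀ {n} {i j : Fin n} → i ≢ j → ⌊ i ≟ j ⌋ ≡ false
⌊≟⌋-≢ {i = i} {j} i≢j = ≡.trans (isYes≗does (i ≟ j)) (dec-false (i ≟ j) i≢j)

⌊≟⌋-injective : ∀ {m n} (f : Fin m → Fin n) → (∀ {x y} → f x ≡ f y → x ≡ y) →
                ∀ x y → ⌊ f x ≟ f y ⌋ ≡ ⌊ x ≟ y ⌋
⌊≟⌋-injective f f-injective x y with x ≟ y
... | yes ≡.refl = ⌊≟⌋-refl (f x)
... | no  x≢y    = ⌊≟⌋-≢ (x≢y ∘ f-injective)

⌊≟⌋-combine : ∀ {m n} (i j : Fin m) (k l : Fin n) → ⌊ combine i k ≟ combine j l ⌋ ≡ ⌊ i ≟ j ⌋ ∧ ⌊ k ≟ l ⌋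
⌊≟⌋-combine i j k l with i ≟ j | k ≟ l
... | yes ≡.refl | yes ≡.refl = ⌊≟⌋-refl (combine i k)
... | no  i≢j    | _          = ⌊≟⌋-≢ (i≢j ∘ proj₁ ∘ combine-injective i k j l)
... | yes _      | no  k≢l    = ⌊≟⌋-≢ (k≢l ∘ proj₂ ∘ combine-injective i k j l)

punchIn-inject₁-self : ∀ {m} (c : Fin (suc m)) → punchIn (inject₁ c) c ≡ suc c
punchIn-inject₁-self zero          = ≡.refl
punchIn-inject₁-self {suc m} (suc c) = ≡.cong suc (punchIn-inject₁-self c)

punchIn-suc-self : ∀ {m} (c : Fin (suc m)) → punchIn (suc c) c ≡ inject₁ c
punchIn-suc-self zero          = ≡.refl
punchIn-suc-self {suc m} (suc c) = ≡.cong suc (punchIn-suc-self c)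

punchIn-inject₁≡punchIn-suc : ∀ {m} (c s : Fin (suc m)) → s ≢ c → punchIn (inject₁ c) s ≡ punchIn (suc c) s
punchIn-inject₁≡punchIn-suc zero          zero    s≢c = ⊥-elim (s≢c ≡.refl)
punchIn-inject₁≡punchIn-suc zero          (suc s) s≢c = ≡.refl
punchIn-inject₁≡punchIn-suc {suc m} (suc c) zero    s≢c = ≡.refl
punchIn-inject₁≡punchIn-suc {suc m} (suc c) (suc s) s≢c =
  ≡.cong suc (punchIn-inject₁≡punchIn-suc c s (s≢c ∘ ≡.cong suc))

punchIn-adjacent : ∀ {m} (j : Fin (suc (suc m))) (c : Fin (suc m)) → j ≢ inject₁ c → j ≢ suc c →
  ∃ λ (c′ : Fin m) → punchIn j (inject₁ c′) ≡ inject₁ c × punchIn j (suc c′) ≡ suc c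
punchIn-adjacent zero                zero    j≢c j≢c+1 = ⊥-elim (j≢c ≡.refl)
punchIn-adjacent zero                (suc c) j≢c j≢c+1 = c , ≡.refl , ≡.refl
punchIn-adjacent {zero}  (suc zero)    zero    j≢c j≢c+1 = ⊥-elim (j≢c+1 ≡.refl)
punchIn-adjacent {suc m} (suc zero)    zero    j≢c j≢c+1 = ⊥-elim (j≢c+1 ≡.refl)
punchIn-adjacent {suc m} (suc (suc j)) zero    j≢c j≢c+1 = zero , ≡.refl , ≡.refl
punchIn-adjacent {suc m} (suc j)       (suc c) j≢c j≢c+1
  with c′ , e , e′ ← punchIn-adjacent j c (j≢c ∘ ≡.cong suc) (j≢c+1 ∘ ≡.cong suc)
  = suc c′ , ≡.cong suc e , ≡.cong suc e′

transpose-matchˡ : ∀ {n} (i j : Fin n) → PC.transpose i j i ≡ j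
transpose-matchˡ i j rewrite dec-true (i ≟ i) ≡.refl = ≡.refl

transpose-matchʳ : ∀ {n} (i j : Fin n) → PC.transpose i j j ≡ i
transpose-matchʳ i j with j ≟ i
... | yes j≡i = j≡i
... | no _ rewrite dec-true (j ≟ j) ≡.refl = ≡.refl

transpose-other : ∀ {n} {i j k : Fin n} → k ≢ i → k ≢ j → PC.transpose i j k ≡ k
transpose-other {i = i} {j} {k} k≢i k≢j rewrite dec-false (k ≟ i) k≢i | dec-false (k ≟ j) k≢j = ≡.refl

transpose-same : ∀ {n} (i k : Fin n) → PC.transpose i i k ≡ k
transpose-same i k with k ≟ i
... | yes k≡i = ≡.sym k≡i
... | no k≢i rewrite dec-false (k ≟ i) k≢i = ≡.refl

<ᵇ-suc : ∀ x k → x ≢ k → (x <ᵇ suc k) ≡ (x <ᵇ k)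
<ᵇ-suc zero    zero    x≢k = ⊥-elim (x≢k ≡.refl)
<ᵇ-suc zero    (suc k) x≢k = ≡.refl
<ᵇ-suc (suc x) zero    x≢k = ≡.refl
<ᵇ-suc (suc x) (suc k) x≢k = <ᵇ-suc x k (x≢k ∘ ≡.cong suc)

n<ᵇn : ∀ x → (x <ᵇ x) ≡ false
n<ᵇn zero    = ≡.refl
n<ᵇn (suc x) = n<ᵇn x

n<ᵇ1+n : ∀ x → (x <ᵇ suc x) ≡ true
n<ᵇ1+n zero    = ≡.refl
n<ᵇ1+n (suc x) = n<ᵇ1+n x

<⇒<ᵇ≡true : ∀ {x n} → x < n → (x <ᵇ n) ≡ true
<⇒<ᵇ≡true {zero}  {suc n} _         = ≡.refl
<⇒<ᵇ≡true {suc x} {suc n} (s≤s x<n) = <⇒<ᵇ≡true x<n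

combine-elim : ∀ {p m n} (P : Fin (m ℕ.* n) → Set p) → (∀ i k → P (combine i k)) → ∀ x → P x
combine-elim {m = m} {n} P P-combine x =
  ≡.subst P (combine-remQuot {m} n x) (P-combine (proj₁ (remQuot {m} n x)) (proj₂ (remQuot {m} n x)))

swapCombine : ∀ m n → Permutation (m ℕ.* n) (n ℕ.* m)
swapCombine m n = permutation (flip {m} {n}) (flip {n} {m}) (flip-flip {m} {n}) (flip-flip {n} {m})
  where
  flip : ∀ {m n} → Fin (m ℕ.* n) → Fin (n ℕ.* m)
  flip {m} {n} x = combine (proj₂ (remQuot {m} n x)) (proj₁ (remQuot {m} n x))
  flip-flip : ∀ {m n} x → flip {m} {n} (flip {n} {m} x) ≡ x
  flip-flip {m} {n} x = ≡.trans
    (≡.cong (λ p → combine (proj₂ p) (proj₁ p)) (remQuot-combine (proj₂ (remQuot {n} m x)) (proj₁ (remQuot {n} m x))))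
    (combine-remQuot {n} m x)

module MonoidSum {a ℓ} (M : Monoid a ℓ) where
  open Monoid M
  open import Algebra.Properties.Monoid.Sum M using (sum; sum-syntax)

  sum-↑ : ∀ m {n} (f : Vector Carrier (m ℕ.+ n)) →
          sum f ≈ (∑[ i < m ] f (i ↑ˡ n)) ∙ (∑[ j < n ] f (m ↑ʳ j))
  sum-↑ zero    f = sym (identityˡ _)
  sum-↑ (suc m) f = trans (∙-congˡ (sum-↑ m (f ∘ suc))) (sym (assoc _ _ _))

  sum-combine : ∀ m {n} (f : Vector Carrier (m ℕ.* n)) →
                sum f ≈ ∑[ i < m ] ∑[ k < n ] f (combine i k)
  sum-combine zero        f = refl
  sum-combine (suc m) {n} f = trans (sum-↑ n f) (∙-congˡ (sum-combine m {n} (λ x → f (n ↑ʳ x))))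

module RingSum {c ℓ} (S : CommutativeRing c ℓ) where
  open CommutativeRing S renaming (Carrier to A) hiding (zero)
  open import Algebra.Properties.Ring ring using (-‿+-comm; -0#≈0#)
  open import Algebra.Properties.Semiring.Sum semiring public
    using (sum; sum-syntax; sum-cong-≋; sum-remove; ∑-distrib-+; ∑-comm; *-distribˡ-sum; *-distribʳ-sum; sum-replicate)
  open import Algebra.Properties.Semiring.Sum semiring using (sum-replicate-zero)
  open import Algebra.Definitions.RawSemiring (Semiring.rawSemiring semiring) public using (product)
  open import Algebra.Properties.Semiring.Exp semiring public using (_^_; ^-homo-*; ^-congʳ)
  open import Algebra.Properties.CommutativeSemiring.Exp commutativeSemiring public using (^-distrib-*)
  open import Algebra.Properties.CommutativeMonoid.Sum *-commutativeMonoid public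
    using () renaming (sum-cong-≋ to product-cong; sum-remove to product-remove; ∑-distrib-+ to product-distrib-*; sum-replicate to product-replicate)
  open MonoidSum +-monoid public using (sum-↑; sum-combine)
  open MonoidSum *-monoid public using () renaming (sum-↑ to product-↑)

  sum-zero : ∀ {n} {f : Vector A n} → (∀ i → f i ≈ 0#) → sum f ≈ 0#
  sum-zero {n} f≈0 = trans (sum-cong-≋ f≈0) (sum-replicate-zero n)

  sum-δ : ∀ {n} (f : Vector A n) j → (∀ i → i ≢ j → f i ≈ 0#) → sum f ≈ f j
  sum-δ {suc n} f j f≈0 = begin
    sum f                             ≈⟨ sum-remove {i = j} f ⟩
    f j + sum (λ k → f (punchIn j k)) ≈⟨ +-congˡ (sum-zero (λ k → f≈0 _ (punchInᵢ≢i j k))) ⟩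
    f j + 0#                          ≈⟨ +-identityʳ _ ⟩
    f j                               ∎
    where open import Relation.Binary.Reasoning.Setoid setoid

  product-ones : ∀ {n} {f : Vector A n} → (∀ i → f i ≈ 1#) → product f ≈ 1#
  product-ones {zero}  f≈1 = refl
  product-ones {suc n} f≈1 = trans (*-cong (f≈1 zero) (product-ones (f≈1 ∘ suc))) (*-identityˡ 1#)

  sum-const : ∀ n a → ∑[ i < n ] a ≈ Over.ofℕ S n * a
  sum-const zero    a = sym (zeroˡ a)
  sum-const (suc n) a = trans (+-cong (sym (*-identityˡ a)) (sum-const n a)) (sym (distribʳ a 1# _))

  -‿distrib-sum : ∀ {n} (f : Vector A n) → - sum f ≈ sum (λ i → - f i)
  -‿distrib-sum {zero}  f = -0#≈0#
  -‿distrib-sum {suc n} f = trans (sym (-‿+-comm _ _)) (+-congˡ (-‿distrib-sum (f ∘ suc)))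

module Polynomial {c ℓ} (R : CommutativeRing c ℓ) where
  open Over R public
  open CommutativeRing R hiding (zero)
  open import Algebra.Properties.Ring ring using (-0#≈0#)
  open import Algebra.Properties.CommutativeSemigroup +-commutativeSemigroup using (interchange; x∙yz≈y∙xz)
  open import Relation.Binary.Reasoning.Setoid setoid

  -- _≈ₚ_ unfolds to a Π-type, from which Agda cannot recover the two
  -- polynomials; wrapping it in a record makes them inferable.
  infix 4 _≋_
  record _≋_ (p q : Poly) : Set ℓ where
    constructor mk≋
    field get : p ≈ₚ q
  open _≋_ public

  coeff-[] : ∀ k → coeff [] k ≡ 0#
  coeff-[] zero    = ≡.refl
  coeff-[] (suc k) = ≡.refl

  coeff-0∷[] : ∀ k → coeff (0# ∷ []) k ≈ 0#
  coeff-0∷[] zero    = refl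
  coeff-0∷[] (suc k) = refl

  coeff-+ₚ : ∀ p q k → coeff (p +ₚ q) k ≈ coeff p k + coeff q k
  coeff-+ₚ []      q       k       = sym (+-identityˡ _)
  coeff-+ₚ (a ∷ p) []      k       = sym (+-identityʳ _)
  coeff-+ₚ (a ∷ p) (b ∷ q) zero    = refl
  coeff-+ₚ (a ∷ p) (b ∷ q) (suc k) = coeff-+ₚ p q k

  coeff-negₚ : ∀ p k → coeff (-ₚ p) k ≈ - coeff p k
  coeff-negₚ []      k       = sym -0#≈0#
  coeff-negₚ (a ∷ p) zero    = refl
  coeff-negₚ (a ∷ p) (suc k) = coeff-negₚ p k

  coeff-scale : ∀ a p k → coeff (scale a p) k ≈ a * coeff p k
  coeff-scale a []      k       = sym (zeroʳ a)
  coeff-scale a (b ∷ p) zero    = refl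
  coeff-scale a (b ∷ p) (suc k) = coeff-scale a p k

  ≋-refl : ∀ {p} → p ≋ p
  ≋-refl = mk≋ (λ k → refl)

  ≋-sym : ∀ {p q} → p ≋ q → q ≋ p
  ≋-sym (mk≋ e) = mk≋ (λ k → sym (e k))

  ≋-trans : ∀ {p q r} → p ≋ q → q ≋ r → p ≋ r
  ≋-trans (mk≋ e) (mk≋ e′) = mk≋ (λ k → trans (e k) (e′ k))

  ∷-cong : ∀ {a b p q} → a ≈ b → p ≋ q → (a ∷ p) ≋ (b ∷ q)
  ∷-cong a≈b (mk≋ e) = mk≋ λ { zero → a≈b ; (suc k) → e k }

  +ₚ-cong : ∀ {p p′ q q′} → p ≋ p′ → q ≋ q′ → p +ₚ q ≋ p′ +ₚ q′
  +ₚ-cong {p} {p′} {q} {q′} (mk≋ e) (mk≋ e′) =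
    mk≋ λ k → trans (coeff-+ₚ p q k) (trans (+-cong (e k) (e′ k)) (sym (coeff-+ₚ p′ q′ k)))

  -ₚ-cong : ∀ {p q} → p ≋ q → -ₚ p ≋ -ₚ q
  -ₚ-cong {p} {q} (mk≋ e) = mk≋ λ k → trans (coeff-negₚ p k) (trans (-‿cong (e k)) (sym (coeff-negₚ q k)))

  +ₚ-assoc : ∀ p q r → (p +ₚ q) +ₚ r ≋ p +ₚ (q +ₚ r)
  +ₚ-assoc p q r = mk≋ λ k → begin
    coeff ((p +ₚ q) +ₚ r) k              ≈⟨ trans (coeff-+ₚ (p +ₚ q) r k) (+-congʳ (coeff-+ₚ p q k)) ⟩
    (coeff p k + coeff q k) + coeff r k  ≈⟨ +-assoc _ _ _ ⟩
    coeff p k + (coeff q k + coeff r k)  ≈⟨ sym (trans (coeff-+ₚ p (q +ₚ r) k) (+-congˡ (coeff-+ₚ q r k))) ⟩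
    coeff (p +ₚ (q +ₚ r)) k              ∎

  +ₚ-comm : ∀ p q → p +ₚ q ≋ q +ₚ p
  +ₚ-comm p q = mk≋ λ k → trans (coeff-+ₚ p q k) (trans (+-comm _ _) (sym (coeff-+ₚ q p k)))

  +ₚ-interchange : ∀ p q r s → (p +ₚ q) +ₚ (r +ₚ s) ≋ (p +ₚ r) +ₚ (q +ₚ s)
  +ₚ-interchange p q r s = mk≋ λ k → begin
    coeff ((p +ₚ q) +ₚ (r +ₚ s)) k                     ≈⟨ trans (coeff-+ₚ (p +ₚ q) (r +ₚ s) k) (+-cong (coeff-+ₚ p q k) (coeff-+ₚ r s k)) ⟩
    (coeff p k + coeff q k) + (coeff r k + coeff s k)  ≈⟨ interchange _ _ _ _ ⟩
    (coeff p k + coeff r k) + (coeff q k + coeff s k)  ≈⟨ sym (trans (coeff-+ₚ (p +ₚ r) (q +ₚ s) k) (+-cong (coeff-+ₚ p r k) (coeff-+ₚ q s k))) ⟩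
    coeff ((p +ₚ r) +ₚ (q +ₚ s)) k                     ∎

  +ₚ-identityʳ : ∀ p → p +ₚ 0ₚ ≋ p
  +ₚ-identityʳ []      = ≋-refl
  +ₚ-identityʳ (a ∷ p) = ≋-refl

  -ₚ-inverseˡ : ∀ p → (-ₚ p) +ₚ p ≋ 0ₚ
  -ₚ-inverseˡ p = mk≋ λ k → begin
    coeff (-ₚ p +ₚ p) k          ≈⟨ trans (coeff-+ₚ (-ₚ p) p k) (+-congʳ (coeff-negₚ p k)) ⟩
    - coeff p k + coeff p k      ≈⟨ -‿inverseˡ _ ⟩
    0#                           ≡⟨ coeff-[] k ⟨
    coeff 0ₚ k                   ∎

  -ₚ-inverseʳ : ∀ p → p +ₚ (-ₚ p) ≋ 0ₚ
  -ₚ-inverseʳ p = ≋-trans (+ₚ-comm p (-ₚ p)) (-ₚ-inverseˡ p)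

  scale-cong : ∀ {a b p q} → a ≈ b → p ≋ q → scale a p ≋ scale b q
  scale-cong {a} {b} {p} {q} a≈b (mk≋ e) =
    mk≋ λ k → trans (coeff-scale a p k) (trans (*-cong a≈b (e k)) (sym (coeff-scale b q k)))

  scale-distribˡ : ∀ a p q → scale a (p +ₚ q) ≋ scale a p +ₚ scale a q
  scale-distribˡ a p q = mk≋ λ k → begin
    coeff (scale a (p +ₚ q)) k             ≈⟨ trans (coeff-scale a (p +ₚ q) k) (*-congˡ (coeff-+ₚ p q k)) ⟩
    a * (coeff p k + coeff q k)            ≈⟨ distribˡ a _ _ ⟩
    a * coeff p k + a * coeff q k          ≈⟨ sym (trans (coeff-+ₚ (scale a p) (scale a q) k) (+-cong (coeff-scale a p k) (coeff-scale a q k))) ⟩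
    coeff (scale a p +ₚ scale a q) k       ∎

  scale-distribʳ : ∀ a b p → scale (a + b) p ≋ scale a p +ₚ scale b p
  scale-distribʳ a b p = mk≋ λ k → begin
    coeff (scale (a + b) p) k              ≈⟨ trans (coeff-scale (a + b) p k) (distribʳ _ a b) ⟩
    a * coeff p k + b * coeff p k          ≈⟨ sym (trans (coeff-+ₚ (scale a p) (scale b p) k) (+-cong (coeff-scale a p k) (coeff-scale b p k))) ⟩
    coeff (scale a p +ₚ scale b p) k       ∎

  scale-zero : ∀ {a} p → a ≈ 0# → scale a p ≋ 0ₚ
  scale-zero {a} p a≈0 =
    mk≋ λ k → trans (coeff-scale a p k) (trans (*-congʳ a≈0) (trans (zeroˡ _) (reflexive (≡.sym (coeff-[] k)))))

  scale-identity : ∀ p → scale 1# p ≋ p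
  scale-identity p = mk≋ λ k → trans (coeff-scale 1# p k) (*-identityˡ _)

  scale-*ₚ : ∀ a p q → scale a (p *ₚ q) ≋ scale a p *ₚ q
  scale-*ₚ a []      q = ≋-refl
  scale-*ₚ a (b ∷ p) q = ≋-trans (scale-distribˡ a (scale b q) (0# ∷ (p *ₚ q)))
    (+ₚ-cong scale-scale (∷-cong (zeroʳ a) (scale-*ₚ a p q)))
    where
    scale-scale : scale a (scale b q) ≋ scale (a * b) q
    scale-scale = mk≋ λ k → trans (coeff-scale a (scale b q) k)
      (trans (*-congˡ (coeff-scale b q k)) (trans (sym (*-assoc _ _ _)) (sym (coeff-scale (a * b) q k))))

  0∷-+ₚ : ∀ p q → (0# ∷ (p +ₚ q)) ≋ (0# ∷ p) +ₚ (0# ∷ q)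
  0∷-+ₚ p q = mk≋ λ { zero → sym (+-identityˡ 0#) ; (suc k) → refl }

  *ₚ-zeroʳ : ∀ p → p *ₚ 0ₚ ≋ 0ₚ
  *ₚ-zeroʳ []      = ≋-refl
  *ₚ-zeroʳ (a ∷ p) = mk≋ λ { zero → refl ; (suc k) → get (*ₚ-zeroʳ p) k }

  ≋0⇒*ₚ≋0 : ∀ p → p ≋ 0ₚ → ∀ q → p *ₚ q ≋ 0ₚ
  ≋0⇒*ₚ≋0 []      _       q = ≋-refl
  ≋0⇒*ₚ≋0 (a ∷ p) (mk≋ e) q = mk≋ λ k → begin
    coeff (scale a q +ₚ (0# ∷ (p *ₚ q))) k          ≈⟨ coeff-+ₚ (scale a q) (0# ∷ (p *ₚ q)) k ⟩
    coeff (scale a q) k + coeff (0# ∷ (p *ₚ q)) k   ≈⟨ +-cong (get (scale-zero q (e zero)) k) (get (∷-cong refl p*q≋0) k) ⟩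
    coeff [] k + coeff (0# ∷ []) k                  ≈⟨ +-cong (reflexive (coeff-[] k)) (coeff-0∷[] k) ⟩
    0# + 0#                                         ≈⟨ +-identityˡ 0# ⟩
    0#                                              ≡⟨ coeff-[] k ⟨
    coeff [] k                                      ∎
    where
    p*q≋0 : p *ₚ q ≋ 0ₚ
    p*q≋0 = ≋0⇒*ₚ≋0 p (mk≋ (λ j → e (suc j))) q

  *ₚ-congʳ : ∀ p p′ q → p ≋ p′ → p *ₚ q ≋ p′ *ₚ q
  *ₚ-congʳ []      p′       q e       = ≋-sym (≋0⇒*ₚ≋0 p′ (≋-sym e) q)
  *ₚ-congʳ (a ∷ p) []       q e       = ≋0⇒*ₚ≋0 (a ∷ p) e q
  *ₚ-congʳ (a ∷ p) (b ∷ p′) q (mk≋ e) =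
    +ₚ-cong (scale-cong (e zero) ≋-refl) (∷-cong refl (*ₚ-congʳ p p′ q (mk≋ (λ k → e (suc k)))))

  *ₚ-congˡ : ∀ p q q′ → q ≋ q′ → p *ₚ q ≋ p *ₚ q′
  *ₚ-congˡ []      q q′ e = ≋-refl
  *ₚ-congˡ (a ∷ p) q q′ e = +ₚ-cong (scale-cong refl e) (∷-cong refl (*ₚ-congˡ p q q′ e))

  *ₚ-cong : ∀ {p p′ q q′} → p ≋ p′ → q ≋ q′ → p *ₚ q ≋ p′ *ₚ q′
  *ₚ-cong {p} {p′} {q} {q′} e e′ = ≋-trans (*ₚ-congʳ p p′ q e) (*ₚ-congˡ p′ q q′ e′)

  *ₚ-distribʳ : ∀ q p p′ → (p +ₚ p′) *ₚ q ≋ p *ₚ q +ₚ p′ *ₚ q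
  *ₚ-distribʳ q []      p′       = ≋-refl
  *ₚ-distribʳ q (a ∷ p) []       = ≋-sym (+ₚ-identityʳ _)
  *ₚ-distribʳ q (a ∷ p) (b ∷ p′) =
    ≋-trans (+ₚ-cong (scale-distribʳ a b q) (≋-trans (∷-cong refl (*ₚ-distribʳ q p p′)) (0∷-+ₚ (p *ₚ q) (p′ *ₚ q))))
            (+ₚ-interchange (scale a q) (scale b q) (0# ∷ (p *ₚ q)) (0# ∷ (p′ *ₚ q)))

  *ₚ-distribˡ : ∀ p q q′ → p *ₚ (q +ₚ q′) ≋ p *ₚ q +ₚ p *ₚ q′
  *ₚ-distribˡ []      q q′ = ≋-refl
  *ₚ-distribˡ (a ∷ p) q q′ =
    ≋-trans (+ₚ-cong (scale-distribˡ a q q′) (≋-trans (∷-cong refl (*ₚ-distribˡ p q q′)) (0∷-+ₚ (p *ₚ q) (p *ₚ q′))))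
            (+ₚ-interchange (scale a q) (scale a q′) (0# ∷ (p *ₚ q)) (0# ∷ (p *ₚ q′)))

  0∷-*ₚ : ∀ p q → (0# ∷ p) *ₚ q ≋ 0# ∷ (p *ₚ q)
  0∷-*ₚ p q = +ₚ-cong (scale-zero q refl) ≋-refl

  *ₚ-assoc : ∀ p q r → (p *ₚ q) *ₚ r ≋ p *ₚ (q *ₚ r)
  *ₚ-assoc []      q r = ≋-refl
  *ₚ-assoc (a ∷ p) q r = ≋-trans (*ₚ-distribʳ r (scale a q) (0# ∷ (p *ₚ q)))
    (+ₚ-cong (≋-sym (scale-*ₚ a q r)) (≋-trans (0∷-*ₚ (p *ₚ q) r) (∷-cong refl (*ₚ-assoc p q r))))

  *ₚ-∷ : ∀ q a p → q *ₚ (a ∷ p) ≋ scale a q +ₚ (0# ∷ (q *ₚ p))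
  *ₚ-∷ []      a p = mk≋ λ { zero → refl ; (suc k) → refl }
  *ₚ-∷ (b ∷ q) a p = mk≋ λ
    { zero    → trans (+-identityʳ _) (trans (*-comm b a) (sym (+-identityʳ _)))
    ; (suc k) → get (≋-trans (+ₚ-cong (≋-refl {scale b p}) (*ₚ-∷ q a p)) swap) k
    }
    where
    swap : scale b p +ₚ (scale a q +ₚ (0# ∷ (q *ₚ p))) ≋ scale a q +ₚ (scale b p +ₚ (0# ∷ (q *ₚ p)))
    swap = mk≋ λ j → begin
      coeff (scale b p +ₚ (scale a q +ₚ (0# ∷ (q *ₚ p)))) j
        ≈⟨ trans (coeff-+ₚ (scale b p) _ j) (+-congˡ (coeff-+ₚ (scale a q) _ j)) ⟩
      coeff (scale b p) j + (coeff (scale a q) j + coeff (0# ∷ (q *ₚ p)) j)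
        ≈⟨ x∙yz≈y∙xz _ _ _ ⟩
      coeff (scale a q) j + (coeff (scale b p) j + coeff (0# ∷ (q *ₚ p)) j)
        ≈⟨ sym (trans (coeff-+ₚ (scale a q) _ j) (+-congˡ (coeff-+ₚ (scale b p) _ j))) ⟩
      coeff (scale a q +ₚ (scale b p +ₚ (0# ∷ (q *ₚ p)))) j ∎

  *ₚ-comm : ∀ p q → p *ₚ q ≋ q *ₚ p
  *ₚ-comm []      q = ≋-sym (*ₚ-zeroʳ q)
  *ₚ-comm (a ∷ p) q = ≋-trans (+ₚ-cong ≋-refl (∷-cong refl (*ₚ-comm p q))) (≋-sym (*ₚ-∷ q a p))

  *ₚ-identityˡ : ∀ p → 1ₚ *ₚ p ≋ p
  *ₚ-identityˡ p = mk≋ λ k → begin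
    coeff (scale 1# p +ₚ (0# ∷ [])) k          ≈⟨ coeff-+ₚ (scale 1# p) (0# ∷ []) k ⟩
    coeff (scale 1# p) k + coeff (0# ∷ []) k   ≈⟨ +-cong (get (scale-identity p) k) (coeff-0∷[] k) ⟩
    coeff p k + 0#                             ≈⟨ +-identityʳ _ ⟩
    coeff p k                                  ∎

  polynomialRing : CommutativeRing c ℓ
  polynomialRing = record
    { Carrier = Poly
    ; _≈_ = _≋_
    ; _+_ = _+ₚ_
    ; _*_ = _*ₚ_
    ; -_ = -ₚ_
    ; 0# = 0ₚ
    ; 1# = 1ₚ
    ; isCommutativeRing = record
      { isRing = record
        { +-isAbelianGroup = record
          { isGroup = record
            { isMonoid = record
              { isSemigroup = record
                { isMagma = record
                  { isEquivalence = record { refl = ≋-refl ; sym = ≋-sym ; trans = ≋-trans }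
                  ; ∙-cong = +ₚ-cong }
                ; assoc = +ₚ-assoc }
              ; identity = (λ p → ≋-refl) , +ₚ-identityʳ }
            ; inverse = -ₚ-inverseˡ , -ₚ-inverseʳ
            ; ⁻¹-cong = -ₚ-cong }
          ; comm = +ₚ-comm }
        ; *-cong = *ₚ-cong
        ; *-assoc = *ₚ-assoc
        ; *-identity = *ₚ-identityˡ , (λ p → ≋-trans (*ₚ-comm p 1ₚ) (*ₚ-identityˡ p))
        ; distrib = *ₚ-distribˡ , *ₚ-distribʳ }
      ; *-comm = *ₚ-comm } }

  DegreeAtMost : Poly → ℕ → Set ℓ
  DegreeAtMost p n = ∀ k → n < k → coeff p k ≈ 0#

  xI-A-entry-degree : ∀ (β : Bool) a → DegreeAtMost ((if β then X else 0ₚ) -ₚ const a) 1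
  xI-A-entry-degree β     a (suc zero)    (s≤s ())
  xI-A-entry-degree true  a (suc (suc k)) _ = reflexive (coeff-[] k)
  xI-A-entry-degree false a (suc (suc k)) _ = reflexive (coeff-[] k)

  open RingMorphisms (CommutativeRing.rawRing R) (CommutativeRing.rawRing polynomialRing) using (IsRingHomomorphism)

  const-isRingHomomorphism : IsRingHomomorphism const
  const-isRingHomomorphism = record
    { isSemiringHomomorphism = record
      { isNearSemiringHomomorphism = record
        { +-isMonoidHomomorphism = record
          { isMagmaHomomorphism = record
            { isRelHomomorphism = record { cong = λ a≈b → ∷-cong a≈b ≋-refl }
            ; homo = λ a b → ≋-refl }
          ; ε-homo = mk≋ λ { zero → refl ; (suc k) → refl } }
        ; *-homo = λ a b → mk≋ λ { zero → sym (+-identityʳ _) ; (suc k) → reflexive (≡.sym (coeff-[] k)) } }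
      ; 1#-homo = ≋-refl }
    ; -‿homo = λ a → ≋-refl }

module Determinant {c ℓ} (S : CommutativeRing c ℓ) where
  open CommutativeRing S renaming (Carrier to A) hiding (zero)
  open import Algebra.Properties.Ring ring
    using (-‿+-comm; -0#≈0#; -‿distribˡ-*; -‿distribʳ-*; -‿involutive; +-inverseʳ-unique)
  open import Algebra.Properties.CommutativeSemigroup *-commutativeSemigroup
    using () renaming (x∙yz≈y∙xz to x*[y*z]≈y*[x*z])
  open RingSum S
  open import Relation.Binary.Reasoning.Setoid setoid

  altSign : ℕ → A → A
  altSign zero    a = a
  altSign (suc k) a = - altSign k a

  altSign-cong : ∀ k {a b} → a ≈ b → altSign k a ≈ altSign k b
  altSign-cong zero    a≈b = a≈b
  altSign-cong (suc k) a≈b = -‿cong (altSign-cong k a≈b)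

  altSign-+ : ∀ k a b → altSign k (a + b) ≈ altSign k a + altSign k b
  altSign-+ zero    a b = refl
  altSign-+ (suc k) a b = trans (-‿cong (altSign-+ k a b)) (sym (-‿+-comm _ _))

  altSign-*ˡ : ∀ k a b → a * altSign k b ≈ altSign k (a * b)
  altSign-*ˡ zero    a b = refl
  altSign-*ˡ (suc k) a b = trans (sym (-‿distribʳ-* _ _)) (-‿cong (altSign-*ˡ k a b))

  altSign-*ʳ : ∀ k a b → altSign k a * b ≈ altSign k (a * b)
  altSign-*ʳ zero    a b = refl
  altSign-*ʳ (suc k) a b = trans (sym (-‿distribˡ-* _ _)) (-‿cong (altSign-*ʳ k a b))

  altSign-zero : ∀ k {a} → a ≈ 0# → altSign k a ≈ 0#
  altSign-zero zero    a≈0 = a≈0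
  altSign-zero (suc k) a≈0 = trans (-‿cong (altSign-zero k a≈0)) -0#≈0#

  altSign-altSign : ∀ j k a → altSign j (altSign k a) ≡ altSign (j ℕ.+ k) a
  altSign-altSign zero    k a = ≡.refl
  altSign-altSign (suc j) k a = ≡.cong -_ (altSign-altSign j k a)

  altSign-≡ : ∀ {j k} a → j ≡ k → altSign j a ≡ altSign k a
  altSign-≡ a ≡.refl = ≡.refl

  altSign-comm : ∀ j k a → altSign j (altSign k a) ≡ altSign k (altSign j a)
  altSign-comm j k a = ≡.trans (altSign-altSign j k a)
    (≡.trans (altSign-≡ a (ℕₚ.+-comm j k)) (≡.sym (altSign-altSign k j a)))

  altSign-involutive : ∀ k a → altSign k (altSign k a) ≈ a
  altSign-involutive zero    a = refl
  altSign-involutive (suc k) a = begin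
    - altSign k (- altSign k a)   ≡⟨ ≡.cong -_ (altSign-comm k 1 (altSign k a)) ⟩
    - - altSign k (altSign k a)   ≈⟨ -‿involutive _ ⟩
    altSign k (altSign k a)       ≈⟨ altSign-involutive k a ⟩
    a                             ∎

  altSign-sum : ∀ k {n} (f : Vector A n) → altSign k (sum f) ≈ ∑[ i < n ] altSign k (f i)
  altSign-sum k {zero}  f = altSign-zero k refl
  altSign-sum k {suc n} f = trans (altSign-+ k _ _) (+-congˡ (altSign-sum k (f ∘ suc)))

  altSign-cancel : ∀ k {a b} → a ≈ b → altSign k a + altSign (suc k) b ≈ 0#
  altSign-cancel k a≈b = trans (+-congˡ (-‿cong (altSign-cong k (sym a≈b)))) (-‿inverseʳ _)

  Matrix : ℕ → Set c
  Matrix n = Fin n → Fin n → A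

  _ᵀ : ∀ {n} → Matrix n → Matrix n
  (M ᵀ) r s = M s r

  minor : ∀ {n} → Fin (suc n) → Fin (suc n) → Matrix (suc n) → Matrix n
  minor i j M r s = M (punchIn i r) (punchIn j s)

  det : ∀ n → Matrix n → A
  det zero    M = 1#
  det (suc n) M = ∑[ j < suc n ] altSign (toℕ j) (M zero j * det n (minor zero j M))

  det-cong : ∀ n {M N : Matrix n} → (∀ r s → M r s ≈ N r s) → det n M ≈ det n N
  det-cong zero    M≈N = refl
  det-cong (suc n) M≈N = sum-cong-≋ λ j →
    altSign-cong (toℕ j) (*-cong (M≈N zero j) (det-cong n (λ r s → M≈N (punchIn zero r) (punchIn j s))))

  private
    altSign-*-sum : ∀ k {n} a (f : Vector A n) → altSign k (a * sum f) ≈ ∑[ i < n ] altSign k (a * f i)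
    altSign-*-sum k a f = trans (altSign-cong k (*-distribˡ-sum a f)) (altSign-sum k (λ i → a * f i))

  det-expandFirstCol : ∀ n (M : Matrix (suc n)) →
    det (suc n) M ≈ ∑[ i < suc n ] altSign (toℕ i) (M i zero * det n (minor i zero M))
  det-expandFirstCol zero    M = refl
  det-expandFirstCol (suc n) M = +-congˡ (begin
    ∑[ j < suc n ] altSign (suc (toℕ j)) (M zero (suc j) * det (suc n) (minor zero (suc j) M))
      ≈⟨ sum-cong-≋ (λ j → altSign-cong (suc (toℕ j))
           (*-congˡ {M zero (suc j)} (det-expandFirstCol n (minor zero (suc j) M)))) ⟩
    ∑[ j < suc n ] altSign (suc (toℕ j)) (M zero (suc j) * ∑[ i < suc n ] colTerm j i)
      ≈⟨ sum-cong-≋ (λ j → altSign-*-sum (suc (toℕ j)) (M zero (suc j)) (colTerm j)) ⟩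
    ∑[ j < suc n ] ∑[ i < suc n ] rowFirst j i
      ≈⟨ ∑-comm rowFirst ⟩
    ∑[ i < suc n ] ∑[ j < suc n ] rowFirst j i
      ≈⟨ sum-cong-≋ (λ i → sum-cong-≋ (λ j → rowFirst≈colFirst i j)) ⟩
    ∑[ i < suc n ] ∑[ j < suc n ] colFirst i j
      ≈⟨ sum-cong-≋ (λ i → altSign-*-sum (suc (toℕ i)) (M (suc i) zero) (rowTerm i)) ⟨
    ∑[ i < suc n ] altSign (suc (toℕ i)) (M (suc i) zero * det (suc n) (minor (suc i) zero M)) ∎)
    where
    K : Fin (suc n) → Fin (suc n) → Matrix n
    K i j r s = M (suc (punchIn i r)) (suc (punchIn j s))
    colTerm rowTerm rowFirst colFirst : Fin (suc n) → Fin (suc n) → A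
    colTerm  j i = altSign (toℕ i) (M (suc i) zero * det n (K i j))
    rowTerm  i j = altSign (toℕ j) (M zero (suc j) * det n (K i j))
    rowFirst j i = altSign (suc (toℕ j)) (M zero (suc j) * colTerm j i)
    colFirst i j = altSign (suc (toℕ i)) (M (suc i) zero * rowTerm i j)
    rowFirst≈colFirst : ∀ i j → rowFirst j i ≈ colFirst i j
    rowFirst≈colFirst i j = begin
      - altSign (toℕ j) (x * altSign (toℕ i) (y * d))    ≈⟨ -‿cong (altSign-cong (toℕ j) (altSign-*ˡ (toℕ i) x (y * d))) ⟩
      - altSign (toℕ j) (altSign (toℕ i) (x * (y * d)))  ≡⟨ ≡.cong -_ (altSign-comm (toℕ j) (toℕ i) _) ⟩
      - altSign (toℕ i) (altSign (toℕ j) (x * (y * d)))  ≈⟨ -‿cong (altSign-cong (toℕ i) (altSign-cong (toℕ j) (x*[y*z]≈y*[x*z] x y d))) ⟩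
      - altSign (toℕ i) (altSign (toℕ j) (y * (x * d)))  ≈⟨ -‿cong (altSign-cong (toℕ i) (altSign-*ˡ (toℕ j) y (x * d))) ⟨
      - altSign (toℕ i) (y * altSign (toℕ j) (x * d))    ∎
      where
      x y d : A
      x = M zero (suc j)
      y = M (suc i) zero
      d = det n (K i j)

  det-ᵀ : ∀ n (M : Matrix n) → det n (M ᵀ) ≈ det n M
  det-ᵀ zero    M = refl
  det-ᵀ (suc n) M = trans
    (sum-cong-≋ (λ j → altSign-cong (toℕ j) (*-congˡ {M j zero} (det-ᵀ n (minor j zero M)))))
    (sym (det-expandFirstCol n M))

  -- Linearity in a column

  updateCol : ∀ {n} → Matrix n → Fin n → Vector A n → Matrix n
  updateCol M k v r s = if ⌊ s ≟ k ⌋ then v r else M r s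

  updateCol-≡ : ∀ {n} (M : Matrix n) k v r → updateCol M k v r k ≡ v r
  updateCol-≡ M k v r = ≡.cong (if_then v r else M r k) (⌊≟⌋-refl k)

  updateCol-≢ : ∀ {n} (M : Matrix n) k v r {s} → s ≢ k → updateCol M k v r s ≡ M r s
  updateCol-≢ M k v r {s} s≢k = ≡.cong (if_then v r else M r s) (⌊≟⌋-≢ s≢k)

  det-linearCol : ∀ n (M M₁ M₂ : Matrix n) (k : Fin n) a b →
    (∀ r s → s ≢ k → M r s ≈ M₁ r s) → (∀ r s → s ≢ k → M r s ≈ M₂ r s) →
    (∀ r → M r k ≈ a * M₁ r k + b * M₂ r k) →
    det n M ≈ a * det n M₁ + b * det n M₂
  det-linearCol (suc n) M M₁ M₂ k a b M≈M₁ M≈M₂ Mk≈ = begin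
    det (suc n) M                                 ≈⟨ sum-cong-≋ term ⟩
    ∑[ j < suc n ] (a * t₁ j + b * t₂ j)          ≈⟨ ∑-distrib-+ (λ j → a * t₁ j) (λ j → b * t₂ j) ⟩
    (∑[ j < suc n ] (a * t₁ j)) + (∑[ j < suc n ] (b * t₂ j))
                                                  ≈⟨ +-cong (*-distribˡ-sum a t₁) (*-distribˡ-sum b t₂) ⟨
    a * det (suc n) M₁ + b * det (suc n) M₂       ∎
    where
    t₁ t₂ : Fin (suc n) → A
    t₁ j = altSign (toℕ j) (M₁ zero j * det n (minor zero j M₁))
    t₂ j = altSign (toℕ j) (M₂ zero j * det n (minor zero j M₂))
    linear : ∀ j x y → altSign (toℕ j) (a * x + b * y) ≈ a * altSign (toℕ j) x + b * altSign (toℕ j) y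
    linear j x y = trans (altSign-+ (toℕ j) _ _) (+-cong (sym (altSign-*ˡ (toℕ j) a x)) (sym (altSign-*ˡ (toℕ j) b y)))
    term : ∀ j → altSign (toℕ j) (M zero j * det n (minor zero j M)) ≈ a * t₁ j + b * t₂ j
    term j with j ≟ k
    ... | yes ≡.refl = begin
      altSign (toℕ j) (M zero j * d)
        ≈⟨ altSign-cong (toℕ j) (*-congʳ (Mk≈ zero)) ⟩
      altSign (toℕ j) ((a * M₁ zero j + b * M₂ zero j) * d)
        ≈⟨ altSign-cong (toℕ j) (trans (distribʳ d _ _) (+-cong (*-assoc a _ d) (*-assoc b _ d))) ⟩
      altSign (toℕ j) (a * (M₁ zero j * d) + b * (M₂ zero j * d))
        ≈⟨ linear j _ _ ⟩
      a * altSign (toℕ j) (M₁ zero j * d) + b * altSign (toℕ j) (M₂ zero j * d)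
        ≈⟨ +-cong (*-congˡ (altSign-cong (toℕ j) (*-congˡ (det-cong n (λ r s → M≈M₁ _ _ (punchInᵢ≢i j s))))))
                  (*-congˡ (altSign-cong (toℕ j) (*-congˡ (det-cong n (λ r s → M≈M₂ _ _ (punchInᵢ≢i j s)))))) ⟩
      a * t₁ j + b * t₂ j ∎
      where d = det n (minor zero j M)
    ... | no j≢k = begin
      altSign (toℕ j) (M zero j * det n (minor zero j M))
        ≈⟨ altSign-cong (toℕ j) (*-congˡ minor-linear) ⟩
      altSign (toℕ j) (M zero j * (a * det n (minor zero j M₁) + b * det n (minor zero j M₂)))
        ≈⟨ altSign-cong (toℕ j) (trans (distribˡ _ _ _) (+-cong (x*[y*z]≈y*[x*z] _ a _) (x*[y*z]≈y*[x*z] _ b _))) ⟩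
      altSign (toℕ j) (a * (M zero j * det n (minor zero j M₁)) + b * (M zero j * det n (minor zero j M₂)))
        ≈⟨ linear j _ _ ⟩
      a * altSign (toℕ j) (M zero j * det n (minor zero j M₁)) + b * altSign (toℕ j) (M zero j * det n (minor zero j M₂))
        ≈⟨ +-cong (*-congˡ (altSign-cong (toℕ j) (*-congʳ (M≈M₁ zero j j≢k))))
                  (*-congˡ (altSign-cong (toℕ j) (*-congʳ (M≈M₂ zero j j≢k)))) ⟩
      a * t₁ j + b * t₂ j ∎
      where
      k′ : Fin n
      k′ = punchOut j≢k
      j↑k′≡k : punchIn j k′ ≡ k
      j↑k′≡k = punchIn-punchOut j≢k
      avoids : ∀ s → s ≢ k′ → punchIn j s ≢ k
      avoids s s≢k′ e = s≢k′ (punchIn-injective j s k′ (≡.trans e (≡.sym j↑k′≡k)))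
      minor-linear : det n (minor zero j M) ≈ a * det n (minor zero j M₁) + b * det n (minor zero j M₂)
      minor-linear = det-linearCol n (minor zero j M) (minor zero j M₁) (minor zero j M₂) k′ a b
        (λ r s s≢k′ → M≈M₁ _ _ (avoids s s≢k′)) (λ r s s≢k′ → M≈M₂ _ _ (avoids s s≢k′))
        (λ r → ≡.subst (λ z → M (suc r) z ≈ a * M₁ (suc r) z + b * M₂ (suc r) z) (≡.sym j↑k′≡k) (Mk≈ (suc r)))

  det-scaleCol : ∀ n (M M₁ : Matrix n) (k : Fin n) a →
    (∀ r s → s ≢ k → M r s ≈ M₁ r s) → (∀ r → M r k ≈ a * M₁ r k) → det n M ≈ a * det n M₁
  det-scaleCol n M M₁ k a M≈M₁ Mk≈ = trans
    (det-linearCol n M M₁ M₁ k a 0# M≈M₁ M≈M₁ (λ r → trans (Mk≈ r) (sym (trans (+-congˡ (zeroˡ _)) (+-identityʳ _)))))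
    (trans (+-congˡ (zeroˡ _)) (+-identityʳ _))

  det-addCol : ∀ n (M M₁ M₂ : Matrix n) (k : Fin n) →
    (∀ r s → s ≢ k → M r s ≈ M₁ r s) → (∀ r s → s ≢ k → M r s ≈ M₂ r s) →
    (∀ r → M r k ≈ M₁ r k + M₂ r k) →
    det n M ≈ det n M₁ + det n M₂
  det-addCol n M M₁ M₂ k M≈M₁ M≈M₂ Mk≈ = trans
    (det-linearCol n M M₁ M₂ k 1# 1# M≈M₁ M≈M₂ (λ r → trans (Mk≈ r) (sym (+-cong (*-identityˡ _) (*-identityˡ _)))))
    (+-cong (*-identityˡ _) (*-identityˡ _))

  det-linearCol-sum : ∀ m n (M N : Matrix n) (k : Fin n) a (C : Vector A m) (V : Fin m → Vector A n) →
    (∀ r s → s ≢ k → N r s ≈ M r s) →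
    (∀ r → N r k ≈ a * M r k + ∑[ t < m ] (C t * V t r)) →
    det n N ≈ a * det n M + ∑[ t < m ] (C t * det n (updateCol M k (V t)))
  det-linearCol-sum zero    n M N k a C V N≈M Nk≈ =
    trans (det-scaleCol n N M k a N≈M (λ r → trans (Nk≈ r) (+-identityʳ _))) (sym (+-identityʳ _))
  det-linearCol-sum (suc m) n M N k a C V N≈M Nk≈ = begin
    det n N                                      ≈⟨ det-linearCol n N N₁ N₂ k 1# (C zero) N≈N₁ N≈N₂ Nk≈′ ⟩
    1# * det n N₁ + C zero * det n N₂            ≈⟨ +-congʳ (trans (*-identityˡ _) (det-linearCol-sum m n M N₁ k a (C ∘ suc) (V ∘ suc) N₁≈M N₁k≈)) ⟩
    (a * det n M + rest) + C zero * det n N₂     ≈⟨ +-assoc _ _ _ ⟩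
    a * det n M + (rest + C zero * det n N₂)     ≈⟨ +-congˡ (+-comm _ _) ⟩
    a * det n M + ∑[ t < suc m ] (C t * det n (updateCol M k (V t))) ∎
    where
    rest : A
    rest = ∑[ t < m ] (C (suc t) * det n (updateCol M k (V (suc t))))
    v₁ : Vector A n
    v₁ r = a * M r k + ∑[ t < m ] (C (suc t) * V (suc t) r)
    N₁ N₂ : Matrix n
    N₁ = updateCol M k v₁
    N₂ = updateCol M k (V zero)
    N≈N₁ : ∀ r s → s ≢ k → N r s ≈ N₁ r s
    N≈N₁ r s s≢k = trans (N≈M r s s≢k) (reflexive (≡.sym (updateCol-≢ M k v₁ r s≢k)))
    N≈N₂ : ∀ r s → s ≢ k → N r s ≈ N₂ r s
    N≈N₂ r s s≢k = trans (N≈M r s s≢k) (reflexive (≡.sym (updateCol-≢ M k (V zero) r s≢k)))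
    Nk≈′ : ∀ r → N r k ≈ 1# * N₁ r k + C zero * N₂ r k
    Nk≈′ r = begin
      N r k                                                   ≈⟨ Nk≈ r ⟩
      a * M r k + (C zero * V zero r + ∑[ t < m ] (C (suc t) * V (suc t) r))
                                                              ≈⟨ +-congˡ (+-comm _ _) ⟩
      a * M r k + (∑[ t < m ] (C (suc t) * V (suc t) r) + C zero * V zero r)
                                                              ≈⟨ +-assoc _ _ _ ⟨
      v₁ r + C zero * V zero r                                ≈⟨ +-cong (*-identityˡ _) (*-congˡ (reflexive (updateCol-≡ M k (V zero) r))) ⟨
      1# * v₁ r + C zero * N₂ r k                             ≡⟨ ≡.cong (λ x → 1# * x + C zero * N₂ r k) (updateCol-≡ M k v₁ r) ⟨
      1# * N₁ r k + C zero * N₂ r k                           ∎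
    N₁≈M : ∀ r s → s ≢ k → N₁ r s ≈ M r s
    N₁≈M r s s≢k = reflexive (updateCol-≢ M k v₁ r s≢k)
    N₁k≈ : ∀ r → N₁ r k ≈ a * M r k + ∑[ t < m ] (C (suc t) * V (suc t) r)
    N₁k≈ r = reflexive (updateCol-≡ M k v₁ r)

  -- Equal columns and column swaps

  -- The induction step removes the first row: the two equal columns stay
  -- adjacent in every minor except the two in which one of them is deleted,
  -- and those two terms cancel.
  det-adjacentEqualCols : ∀ n (M : Matrix (suc n)) (c : Fin n) →
    (∀ r → M r (inject₁ c) ≈ M r (suc c)) → det (suc n) M ≈ 0#
  det-adjacentEqualCols (suc n) M c Mc≈Mc+1 = begin
    det (suc (suc n)) M
      ≈⟨ sum-remove {i = inject₁ c} t ⟩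
    t (inject₁ c) + ∑[ k < suc n ] t (punchIn (inject₁ c) k)
      ≈⟨ +-congˡ (sum-remove {i = c} (λ k → t (punchIn (inject₁ c) k))) ⟩
    t (inject₁ c) + (t (punchIn (inject₁ c) c) + ∑[ k < n ] t (punchIn (inject₁ c) (punchIn c k)))
      ≈⟨ +-congˡ (+-cong (reflexive (≡.cong t (punchIn-inject₁-self c))) (sum-zero others)) ⟩
    t (inject₁ c) + (t (suc c) + 0#)
      ≈⟨ +-congˡ (+-identityʳ _) ⟩
    t (inject₁ c) + t (suc c)
      ≡⟨ ≡.cong (_+ t (suc c)) (altSign-≡ (M zero (inject₁ c) * det (suc n) (minor zero (inject₁ c) M)) (toℕ-inject₁ c)) ⟩
    altSign (toℕ c) (M zero (inject₁ c) * det (suc n) (minor zero (inject₁ c) M)) + t (suc c)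
      ≈⟨ altSign-cancel (toℕ c) (*-cong (Mc≈Mc+1 zero) (det-cong (suc n) same-minors)) ⟩
    0# ∎
    where
    t : Fin (suc (suc n)) → A
    t j = altSign (toℕ j) (M zero j * det (suc n) (minor zero j M))
    same-minors : ∀ r s → minor zero (inject₁ c) M r s ≈ minor zero (suc c) M r s
    same-minors r s with s ≟ c
    ... | yes ≡.refl = begin
      M (suc r) (punchIn (inject₁ s) s)  ≡⟨ ≡.cong (M (suc r)) (punchIn-inject₁-self s) ⟩
      M (suc r) (suc s)                  ≈⟨ Mc≈Mc+1 (suc r) ⟨
      M (suc r) (inject₁ s)              ≡⟨ ≡.cong (M (suc r)) (punchIn-suc-self s) ⟨
      M (suc r) (punchIn (suc s) s)      ∎
    ... | no s≢c = reflexive (≡.cong (M (suc r)) (punchIn-inject₁≡punchIn-suc c s s≢c))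
    others : ∀ k → t (punchIn (inject₁ c) (punchIn c k)) ≈ 0#
    others k = altSign-zero (toℕ j) (trans (*-congˡ {M zero j} (det-adjacentEqualCols n (minor zero j M) c′ equal)) (zeroʳ _))
      where
      j : Fin (suc (suc n))
      j = punchIn (inject₁ c) (punchIn c k)
      j≢c+1 : j ≢ suc c
      j≢c+1 e = punchInᵢ≢i c k (punchIn-injective (inject₁ c) _ _ (≡.trans e (≡.sym (punchIn-inject₁-self c))))
      adjacent : ∃ λ c′ → punchIn j (inject₁ c′) ≡ inject₁ c × punchIn j (suc c′) ≡ suc c
      adjacent = punchIn-adjacent j c (punchInᵢ≢i (inject₁ c) (punchIn c k)) j≢c+1
      c′ : Fin n
      c′ = proj₁ adjacent
      equal : ∀ r → minor zero j M r (inject₁ c′) ≈ minor zero j M r (suc c′)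
      equal r = begin
        M (suc r) (punchIn j (inject₁ c′))  ≡⟨ ≡.cong (M (suc r)) (proj₁ (proj₂ adjacent)) ⟩
        M (suc r) (inject₁ c)               ≈⟨ Mc≈Mc+1 (suc r) ⟩
        M (suc r) (suc c)                   ≡⟨ ≡.cong (M (suc r)) (proj₂ (proj₂ adjacent)) ⟨
        M (suc r) (punchIn j (suc c′))      ∎

  private
    -- For fixed columns a ≠ b, det as a function of the pair of columns
    -- (x , y) placed at (a , b) is biadditive; if it vanishes on the
    -- diagonal, expanding D (u + w) (u + w) shows that it is antisymmetric.
    module TwoColumns {n} (M : Matrix n) {a b : Fin n} (a≢b : a ≢ b) where
      cols : Vector A n → Vector A n → Matrix n
      cols x y = updateCol (updateCol M b y) a x

      col : Fin n → Vector A n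
      col k r = M r k

      D : Vector A n → Vector A n → A
      D x y = det n (cols x y)

      b≢a : b ≢ a
      b≢a = a≢b ∘ ≡.sym

      cols-a : ∀ x y r → cols x y r a ≡ x r
      cols-a x y r = updateCol-≡ (updateCol M b y) a x r

      cols-b : ∀ x y r → cols x y r b ≡ y r
      cols-b x y r = ≡.trans (updateCol-≢ (updateCol M b y) a x r b≢a) (updateCol-≡ M b y r)

      cols-≢b : ∀ x y y′ r s → s ≢ b → cols x y r s ≡ cols x y′ r s
      cols-≢b x y y′ r s s≢b = ≡.cong (λ z → if ⌊ s ≟ a ⌋ then x r else z)
        (≡.trans (updateCol-≢ M b y r s≢b) (≡.sym (updateCol-≢ M b y′ r s≢b)))

      cols-≢a : ∀ x x′ y r s → s ≢ a → cols x y r s ≡ cols x′ y r s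
      cols-≢a x x′ y r s s≢a =
        ≡.trans (updateCol-≢ (updateCol M b y) a x r s≢a) (≡.sym (updateCol-≢ (updateCol M b y) a x′ r s≢a))

      D-+ˡ : ∀ x x′ y → D (λ r → x r + x′ r) y ≈ D x y + D x′ y
      D-+ˡ x x′ y = det-addCol n (cols x+x′ y) (cols x y) (cols x′ y) a
        (λ r s s≢a → reflexive (cols-≢a x+x′ x y r s s≢a)) (λ r s s≢a → reflexive (cols-≢a x+x′ x′ y r s s≢a))
        (λ r → reflexive (≡.trans (cols-a x+x′ y r) (≡.sym (≡.cong₂ _+_ (cols-a x y r) (cols-a x′ y r)))))
        where
        x+x′ : Vector A n
        x+x′ r = x r + x′ r

      D-+ʳ : ∀ x y y′ → D x (λ r → y r + y′ r) ≈ D x y + D x y′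
      D-+ʳ x y y′ = det-addCol n (cols x y+y′) (cols x y) (cols x y′) b
        (λ r s s≢b → reflexive (cols-≢b x y+y′ y r s s≢b)) (λ r s s≢b → reflexive (cols-≢b x y+y′ y′ r s s≢b))
        (λ r → reflexive (≡.trans (cols-b x y+y′ r) (≡.sym (≡.cong₂ _+_ (cols-b x y r) (cols-b x y′ r)))))
        where
        y+y′ : Vector A n
        y+y′ r = y r + y′ r

      antisymmetric : (∀ x → D x x ≈ 0#) → ∀ u w → D u w + D w u ≈ 0#
      antisymmetric D-diag u w = begin
        D u w + D w u                          ≈⟨ +-cong (+-identityˡ _) (+-identityʳ _) ⟨
        (0# + D u w) + (D w u + 0#)            ≈⟨ +-cong (+-congʳ (D-diag u)) (+-congˡ (D-diag w)) ⟨
        (D u u + D u w) + (D w u + D w w)      ≈⟨ +-cong (D-+ʳ u u w) (D-+ʳ w u w) ⟨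
        D u (λ r → u r + w r) + D w (λ r → u r + w r)  ≈⟨ D-+ˡ u w (λ r → u r + w r) ⟨
        D (λ r → u r + w r) (λ r → u r + w r)  ≈⟨ D-diag _ ⟩
        0#                                     ∎

      cols-other : ∀ x y r {s} → s ≢ a → s ≢ b → cols x y r s ≡ M r s
      cols-other x y r s≢a s≢b = ≡.trans (updateCol-≢ (updateCol M b y) a x r s≢a) (updateCol-≢ M b y r s≢b)

      cols-self : ∀ r s → cols (col a) (col b) r s ≡ M r s
      cols-self r s = by-cases (s ≟ a) (s ≟ b)
        where
        by-cases : Dec (s ≡ a) → Dec (s ≡ b) → cols (col a) (col b) r s ≡ M r s
        by-cases (yes ≡.refl) _            = cols-a (col a) (col b) r
        by-cases (no _)       (yes ≡.refl) = cols-b (col a) (col b) r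
        by-cases (no s≢a)     (no s≢b)     = cols-other (col a) (col b) r s≢a s≢b

      cols-swapped : ∀ r s → cols (col b) (col a) r s ≡ M r (PC.transpose a b s)
      cols-swapped r s = by-cases (s ≟ a) (s ≟ b)
        where
        by-cases : Dec (s ≡ a) → Dec (s ≡ b) → cols (col b) (col a) r s ≡ M r (PC.transpose a b s)
        by-cases (yes ≡.refl) _            = ≡.trans (cols-a (col b) (col a) r) (≡.cong (M r) (≡.sym (transpose-matchˡ a b)))
        by-cases (no _)       (yes ≡.refl) = ≡.trans (cols-b (col b) (col a) r) (≡.cong (M r) (≡.sym (transpose-matchʳ a b)))
        by-cases (no s≢a)     (no s≢b)     = ≡.trans (cols-other (col b) (col a) r s≢a s≢b) (≡.cong (M r) (≡.sym (transpose-other s≢a s≢b)))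

    swapCols-of-alternating : ∀ n (a b : Fin n) → a ≢ b →
      (∀ N → (∀ r → N r a ≈ N r b) → det n N ≈ 0#) →
      ∀ M → det n (λ r s → M r (PC.transpose a b s)) ≈ - det n M
    swapCols-of-alternating n a b a≢b alternating M = +-inverseʳ-unique _ _ (begin
      det n M + det n (λ r s → M r (PC.transpose a b s))
        ≈⟨ +-cong (det-cong n (λ r s → reflexive (≡.sym (cols-self r s)))) (det-cong n (λ r s → reflexive (≡.sym (cols-swapped r s)))) ⟩
      D (col a) (col b) + D (col b) (col a)
        ≈⟨ antisymmetric (λ x → alternating (cols x x) (λ r → reflexive (≡.trans (cols-a x x r) (≡.sym (cols-b x x r))))) (col a) (col b) ⟩
      0# ∎)
      where open TwoColumns M a≢b

    det-equalCols-apart : ∀ k n (M : Matrix n) (a b : Fin n) → toℕ b ≡ suc (k ℕ.+ toℕ a) →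
      (∀ r → M r a ≈ M r b) → det n M ≈ 0#
    det-equalCols-apart k       n       M a zero    () Ma≈Mb
    det-equalCols-apart zero    (suc n) M a (suc c) b≡ Ma≈Mb =
      det-adjacentEqualCols n M c (λ r → trans (reflexive (≡.cong (M r) (≡.sym a≡c))) (Ma≈Mb r))
      where
      a≡c : a ≡ inject₁ c
      a≡c = toℕ-injective (≡.trans (≡.sym (ℕₚ.suc-injective b≡)) (≡.sym (toℕ-inject₁ c)))
    det-equalCols-apart (suc k) (suc n) M a (suc c) b≡ Ma≈Mb = begin
      det (suc n) M    ≈⟨ -‿involutive _ ⟨
      - - det (suc n) M ≈⟨ -‿cong (swapCols-of-alternating (suc n) b′ (suc c) b′≢b (λ N → det-adjacentEqualCols n N c) M) ⟨
      - det (suc n) M′ ≈⟨ -‿cong (det-equalCols-apart k (suc n) M′ a b′ b′≡ Ma≈M′b′) ⟩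
      - 0#             ≈⟨ -0#≈0# ⟩
      0#               ∎
      where
      b′ : Fin (suc n)
      b′ = inject₁ c
      b′≢b : b′ ≢ suc c
      b′≢b e = ℕₚ.<⇒≢ (ℕₚ.n<1+n (toℕ c)) (≡.trans (≡.sym (toℕ-inject₁ c)) (≡.cong toℕ e))
      b′≡ : toℕ b′ ≡ suc (k ℕ.+ toℕ a)
      b′≡ = ≡.trans (toℕ-inject₁ c) (ℕₚ.suc-injective b≡)
      M′ : Matrix (suc n)
      M′ r s = M r (PC.transpose b′ (suc c) s)
      a≢b′ : a ≢ b′
      a≢b′ e = ℕₚ.m≢1+n+m (toℕ a) (≡.trans (≡.cong toℕ e) b′≡)
      a≢b : a ≢ suc c
      a≢b e = ℕₚ.m≢1+n+m (toℕ a) (≡.trans (≡.cong toℕ e) b≡)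
      Ma≈M′b′ : ∀ r → M′ r a ≈ M′ r b′
      Ma≈M′b′ r = begin
        M r (PC.transpose b′ (suc c) a)   ≡⟨ ≡.cong (M r) (transpose-other a≢b′ a≢b) ⟩
        M r a                             ≈⟨ Ma≈Mb r ⟩
        M r (suc c)                       ≡⟨ ≡.cong (M r) (transpose-matchˡ b′ (suc c)) ⟨
        M r (PC.transpose b′ (suc c) b′)  ∎

  det-equalCols : ∀ n (M : Matrix n) (a b : Fin n) → a ≢ b → (∀ r → M r a ≈ M r b) → det n M ≈ 0#
  det-equalCols n M a b a≢b Ma≈Mb with ℕₚ.<-cmp (toℕ a) (toℕ b)
  ... | tri< a<b _ _ = det-equalCols-apart (toℕ b ℕ.∸ suc (toℕ a)) n M a b
          (≡.sym (≡.trans (≡.cong suc (ℕₚ.+-comm _ (toℕ a))) (ℕₚ.m+[n∸m]≡n a<b))) Ma≈Mb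
  ... | tri≈ _ a≡b _ = ⊥-elim (a≢b (toℕ-injective a≡b))
  ... | tri> _ _ b<a = det-equalCols-apart (toℕ a ℕ.∸ suc (toℕ b)) n M b a
          (≡.sym (≡.trans (≡.cong suc (ℕₚ.+-comm _ (toℕ b))) (ℕₚ.m+[n∸m]≡n b<a))) (λ r → sym (Ma≈Mb r))

  det-swapCols : ∀ n (a b : Fin n) → a ≢ b → ∀ M → det n (λ r s → M r (PC.transpose a b s)) ≈ - det n M
  det-swapCols n a b a≢b = swapCols-of-alternating n a b a≢b (λ N → det-equalCols n N a b a≢b)

  moveToFront : ∀ {n} → Fin (suc n) → Fin (suc n) → Fin (suc n)
  moveToFront l zero    = l
  moveToFront l (suc r) = punchIn l r

  private
    moveToFront-zero : ∀ {n} (s : Fin (suc n)) → moveToFront zero s ≡ s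
    moveToFront-zero zero    = ≡.refl
    moveToFront-zero (suc s) = ≡.refl

    moveToFront-suc : ∀ {m} (l : Fin (suc m)) s →
      moveToFront (suc l) s ≡ PC.transpose (inject₁ l) (suc l) (moveToFront (inject₁ l) s)
    moveToFront-suc l zero    = ≡.sym (transpose-matchˡ (inject₁ l) (suc l))
    moveToFront-suc l (suc r) with r ≟ l
    ... | yes ≡.refl = ≡.trans (punchIn-suc-self r)
      (≡.sym (≡.trans (≡.cong (PC.transpose (inject₁ r) (suc r)) (punchIn-inject₁-self r)) (transpose-matchʳ (inject₁ r) (suc r))))
    ... | no r≢l = ≡.sym (≡.trans (≡.cong (PC.transpose (inject₁ l) (suc l)) same)
      (transpose-other (λ e → punchInᵢ≢i (inject₁ l) r (≡.trans same e)) (punchInᵢ≢i (suc l) r)))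
      where
      same : punchIn (inject₁ l) r ≡ punchIn (suc l) r
      same = punchIn-inject₁≡punchIn-suc l r r≢l

    det-moveColToFront′ : ∀ k n (M : Matrix (suc n)) (l : Fin (suc n)) → toℕ l ≡ k →
      det (suc n) (λ r s → M r (moveToFront l s)) ≈ altSign k (det (suc n) M)
    det-moveColToFront′ zero    n       M zero    _ = det-cong (suc n) (λ r s → reflexive (≡.cong (M r) (moveToFront-zero s)))
    det-moveColToFront′ (suc k) (suc n) M (suc l) e = begin
      det (suc (suc n)) (λ r s → M r (moveToFront (suc l) s))
        ≈⟨ det-cong (suc (suc n)) (λ r s → reflexive (≡.cong (M r) (moveToFront-suc l s))) ⟩
      det (suc (suc n)) (λ r s → M′ r (moveToFront (inject₁ l) s))
        ≈⟨ det-moveColToFront′ k (suc n) M′ (inject₁ l) (≡.trans (toℕ-inject₁ l) (ℕₚ.suc-injective e)) ⟩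
      altSign k (det (suc (suc n)) M′)
        ≈⟨ altSign-cong k (det-swapCols (suc (suc n)) (inject₁ l) (suc l) l≢l+1 M) ⟩
      altSign k (- det (suc (suc n)) M)
        ≡⟨ altSign-comm k 1 _ ⟩
      altSign (suc k) (det (suc (suc n)) M) ∎
      where
      M′ : Matrix (suc (suc n))
      M′ r s = M r (PC.transpose (inject₁ l) (suc l) s)
      l≢l+1 : inject₁ l ≢ suc l
      l≢l+1 e′ = ℕₚ.<⇒≢ (ℕₚ.n<1+n (toℕ l)) (≡.trans (≡.sym (toℕ-inject₁ l)) (≡.cong toℕ e′))

  det-moveColToFront : ∀ n (M : Matrix (suc n)) l →
    det (suc n) (λ r s → M r (moveToFront l s)) ≈ altSign (toℕ l) (det (suc n) M)
  det-moveColToFront n M l = det-moveColToFront′ (toℕ l) n M l ≡.refl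

  det-expandCol : ∀ n (M : Matrix (suc n)) l →
    det (suc n) M ≈ ∑[ q < suc n ] altSign (toℕ q ℕ.+ toℕ l) (M q l * det n (minor q l M))
  det-expandCol n M l = begin
    det (suc n) M
      ≈⟨ altSign-involutive (toℕ l) _ ⟨
    altSign (toℕ l) (altSign (toℕ l) (det (suc n) M))
      ≈⟨ altSign-cong (toℕ l) (det-moveColToFront n M l) ⟨
    altSign (toℕ l) (det (suc n) (λ r s → M r (moveToFront l s)))
      ≈⟨ altSign-cong (toℕ l) (det-expandFirstCol n (λ r s → M r (moveToFront l s))) ⟩
    altSign (toℕ l) (∑[ q < suc n ] altSign (toℕ q) (M q l * det n (minor q l M)))
      ≈⟨ altSign-sum (toℕ l) (λ q → altSign (toℕ q) (M q l * det n (minor q l M))) ⟩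
    ∑[ q < suc n ] altSign (toℕ l) (altSign (toℕ q) (M q l * det n (minor q l M)))
      ≈⟨ sum-cong-≋ (λ q → reflexive (≡.trans (altSign-altSign (toℕ l) (toℕ q) _) (altSign-≡ (M q l * det n (minor q l M)) (ℕₚ.+-comm (toℕ l) (toℕ q))))) ⟩
    ∑[ q < suc n ] altSign (toℕ q ℕ.+ toℕ l) (M q l * det n (minor q l M)) ∎

  adjugate : ∀ n → Matrix (suc n) → Matrix (suc n)
  adjugate n M i j = altSign (toℕ i ℕ.+ toℕ j) (det n (minor j i M))

  private
    adjugate-term : ∀ n (M : Matrix (suc n)) r l q →
      adjugate n M r q * M q l ≈ altSign (toℕ q ℕ.+ toℕ r) (M q l * det n (minor q r M))
    adjugate-term n M r l q = begin
      altSign (toℕ r ℕ.+ toℕ q) (det n (minor q r M)) * M q l  ≈⟨ *-comm _ _ ⟩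
      M q l * altSign (toℕ r ℕ.+ toℕ q) (det n (minor q r M))  ≈⟨ altSign-*ˡ (toℕ r ℕ.+ toℕ q) _ _ ⟩
      altSign (toℕ r ℕ.+ toℕ q) (M q l * det n (minor q r M))  ≡⟨ altSign-≡ (M q l * det n (minor q r M)) (ℕₚ.+-comm (toℕ r) (toℕ q)) ⟩
      altSign (toℕ q ℕ.+ toℕ r) (M q l * det n (minor q r M))  ∎

  adjugate-*-diagonal : ∀ n (M : Matrix (suc n)) r → ∑[ q < suc n ] (adjugate n M r q * M q r) ≈ det (suc n) M
  adjugate-*-diagonal n M r = trans (sum-cong-≋ (adjugate-term n M r r)) (sym (det-expandCol n M r))

  -- Off the diagonal one expands a matrix whose columns r and l agree.
  adjugate-*-offDiagonal : ∀ n (M : Matrix (suc n)) r l → r ≢ l → ∑[ q < suc n ] (adjugate n M r q * M q l) ≈ 0#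
  adjugate-*-offDiagonal n M r l r≢l = begin
    ∑[ q < suc n ] (adjugate n M r q * M q l)
      ≈⟨ sum-cong-≋ (adjugate-term n M r l) ⟩
    ∑[ q < suc n ] altSign (toℕ q ℕ.+ toℕ r) (M q l * det n (minor q r M))
      ≈⟨ sum-cong-≋ (λ q → altSign-cong (toℕ q ℕ.+ toℕ r) (*-cong (reflexive (≡.sym (updateCol-≡ M r v q)))
           (det-cong n (λ a b → reflexive (≡.sym (updateCol-≢ M r v (punchIn q a) (punchInᵢ≢i r b))))))) ⟩
    ∑[ q < suc n ] altSign (toℕ q ℕ.+ toℕ r) (M′ q r * det n (minor q r M′))
      ≈⟨ det-expandCol n M′ r ⟨
    det (suc n) M′
      ≈⟨ det-equalCols (suc n) M′ r l r≢l (λ q → reflexive (≡.trans (updateCol-≡ M r v q) (≡.sym (updateCol-≢ M r v q (r≢l ∘ ≡.sym))))) ⟩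
    0# ∎
    where
    v : Vector A (suc n)
    v q = M q l
    M′ = updateCol M r v

  det-diagonal : ∀ n (M : Matrix n) (d : Vector A n) →
    (∀ r → M r r ≈ d r) → (∀ r s → r ≢ s → M r s ≈ 0#) → det n M ≈ product d
  det-diagonal zero    M d Mrr≈ Mrs≈0 = refl
  det-diagonal (suc n) M d Mrr≈ Mrs≈0 = begin
    det (suc n) M
      ≈⟨ sum-δ (λ j → altSign (toℕ j) (M zero j * det n (minor zero j M))) zero
           (λ j j≢0 → altSign-zero (toℕ j) (trans (*-congʳ {det n (minor zero j M)} (Mrs≈0 zero j (j≢0 ∘ ≡.sym))) (zeroˡ _))) ⟩
    M zero zero * det n (minor zero zero M)
      ≈⟨ *-cong (Mrr≈ zero) (det-diagonal n (minor zero zero M) (d ∘ suc) (Mrr≈ ∘ suc) (λ r s r≢s → Mrs≈0 (suc r) (suc s) (r≢s ∘ suc-injective))) ⟩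
    product d ∎

  private
    punchIn-↑ˡ : ∀ {m} n (j : Fin (suc m)) (c : Fin m) → punchIn (j ↑ˡ n) (c ↑ˡ n) ≡ punchIn j c ↑ˡ n
    punchIn-↑ˡ n zero    c = ≡.refl
    punchIn-↑ˡ {suc m} n (suc j) zero    = ≡.refl
    punchIn-↑ˡ {suc m} n (suc j) (suc c) = ≡.cong suc (punchIn-↑ˡ n j c)

    punchIn-↑ʳ : ∀ {m} n (j : Fin (suc m)) (c : Fin n) → punchIn (j ↑ˡ n) (m ↑ʳ c) ≡ suc m ↑ʳ c
    punchIn-↑ʳ n zero    c = ≡.refl
    punchIn-↑ʳ {suc m} n (suc j) c = ≡.cong suc (punchIn-↑ʳ n j c)

  det-blockLowerTriangular : ∀ m n (M : Matrix (m ℕ.+ n)) (P : Matrix m) (D : Matrix n) →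
    (∀ r c → M (r ↑ˡ n) (m ↑ʳ c) ≈ 0#) → (∀ r c → M (r ↑ˡ n) (c ↑ˡ n) ≈ P r c) →
    (∀ r c → M (m ↑ʳ r) (m ↑ʳ c) ≈ D r c) → det (m ℕ.+ n) M ≈ det m P * det n D
  det-blockLowerTriangular zero    n M P D M↗≈0 M↖≈P M↘≈D = trans (det-cong n M↘≈D) (sym (*-identityˡ _))
  det-blockLowerTriangular (suc m) n M P D M↗≈0 M↖≈P M↘≈D = begin
    det (suc m ℕ.+ n) M
      ≈⟨ sum-↑ (suc m) t ⟩
    (∑[ j < suc m ] t (j ↑ˡ n)) + (∑[ c < n ] t (suc m ↑ʳ c))
      ≈⟨ +-cong (sum-cong-≋ left) (sum-zero (λ c → altSign-zero (toℕ (suc m ↑ʳ c)) (trans (*-congʳ (M↗≈0 zero c)) (zeroˡ _)))) ⟩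
    (∑[ j < suc m ] (altSign (toℕ j) (P zero j * det m (minor zero j P)) * det n D)) + 0#
      ≈⟨ +-identityʳ _ ⟩
    ∑[ j < suc m ] (altSign (toℕ j) (P zero j * det m (minor zero j P)) * det n D)
      ≈⟨ *-distribʳ-sum (det n D) (λ j → altSign (toℕ j) (P zero j * det m (minor zero j P))) ⟨
    det (suc m) P * det n D ∎
    where
    t : Fin (suc m ℕ.+ n) → A
    t j = altSign (toℕ j) (M zero j * det (m ℕ.+ n) (minor zero j M))
    left : ∀ j → t (j ↑ˡ n) ≈ altSign (toℕ j) (P zero j * det m (minor zero j P)) * det n D
    left j = begin
      altSign (toℕ (j ↑ˡ n)) (M zero (j ↑ˡ n) * det (m ℕ.+ n) (minor zero (j ↑ˡ n) M))
        ≡⟨ altSign-≡ (M zero (j ↑ˡ n) * det (m ℕ.+ n) (minor zero (j ↑ˡ n) M)) (toℕ-↑ˡ j n) ⟩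
      altSign (toℕ j) (M zero (j ↑ˡ n) * det (m ℕ.+ n) (minor zero (j ↑ˡ n) M))
        ≈⟨ altSign-cong (toℕ j) (*-cong (M↖≈P zero j) minor-det) ⟩
      altSign (toℕ j) (P zero j * (det m (minor zero j P) * det n D))
        ≈⟨ altSign-cong (toℕ j) (*-assoc _ _ _) ⟨
      altSign (toℕ j) (P zero j * det m (minor zero j P) * det n D)
        ≈⟨ altSign-*ʳ (toℕ j) _ _ ⟨
      altSign (toℕ j) (P zero j * det m (minor zero j P)) * det n D ∎
      where
      minor-det : det (m ℕ.+ n) (minor zero (j ↑ˡ n) M) ≈ det m (minor zero j P) * det n D
      minor-det = det-blockLowerTriangular m n (minor zero (j ↑ˡ n) M) (minor zero j P) D
        (λ r c → trans (reflexive (≡.cong (M (suc (r ↑ˡ n))) (punchIn-↑ʳ n j c))) (M↗≈0 (suc r) c))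
        (λ r c → trans (reflexive (≡.cong (M (suc (r ↑ˡ n))) (punchIn-↑ˡ n j c))) (M↖≈P (suc r) (punchIn j c)))
        (λ r c → trans (reflexive (≡.cong (M (suc (m ↑ʳ r))) (punchIn-↑ʳ n j c))) (M↘≈D r c))

  -- Elementary column and row operations

  private
    product-update : ∀ {n} (f g : Vector A n) j → (∀ x → x ≢ j → f x ≈ g x) → g j * product f ≈ f j * product g
    product-update {suc n} f g j f≈g = begin
      g j * product f                                ≈⟨ *-congˡ (product-remove {i = j} f) ⟩
      g j * (f j * product (λ x → f (punchIn j x)))  ≈⟨ x*[y*z]≈y*[x*z] _ _ _ ⟩
      f j * (g j * product (λ x → f (punchIn j x)))  ≈⟨ *-congˡ (*-congˡ (product-cong (λ x → f≈g (punchIn j x) (punchInᵢ≢i j x)))) ⟩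
      f j * (g j * product (λ x → g (punchIn j x)))  ≈⟨ *-congˡ (product-remove {i = j} g) ⟨
      f j * product g                                ∎

  -- The columns in K are replaced one at a time, in increasing order; each step
  -- only adds multiples of columns outside K, which never change.
  det-columnOperations : ∀ n (M N : Matrix n) (K : Fin n → Bool) (s : Vector A n) (C : Matrix n) →
    (∀ j t → K t ≡ true → C j t ≈ 0#) →
    (∀ r j → K j ≡ false → N r j ≈ M r j) →
    (∀ r j → K j ≡ true → N r j ≈ s j * M r j + ∑[ t < n ] (C j t * M r t)) →
    det n N ≈ product (λ j → if K j then s j else 1#) * det n M
  det-columnOperations n M N K s C C≈0 N≈M N≈op = begin
    det n N                       ≈⟨ det-cong n (λ r j → sym (after-all r j)) ⟩
    det n (after n)               ≈⟨ after-k n ℕₚ.≤-refl ⟩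
    product (scale n) * det n M   ≈⟨ *-congʳ (product-cong (λ j → reflexive (≡.cong (if_then s j else 1#) (done-all j)))) ⟩
    product (λ j → if K j then s j else 1#) * det n M ∎
    where
    done : ℕ → Fin n → Bool
    done k j = K j ∧ (toℕ j <ᵇ k)
    after : ℕ → Matrix n
    after k r j = if done k j then N r j else M r j
    scale : ℕ → Vector A n
    scale k j = if done k j then s j else 1#
    done-all : ∀ j → done n j ≡ K j
    done-all j = ≡.trans (≡.cong (K j ∧_) (<⇒<ᵇ≡true (toℕ<n j))) (∧-identityʳ (K j))
    after-all : ∀ r j → after n r j ≈ N r j
    after-all r j = by-cases (K j) ≡.refl
      where
      by-cases : ∀ b → K j ≡ b → after n r j ≈ N r j
      by-cases true  Kj = reflexive (≡.cong (if_then N r j else M r j) (≡.trans (done-all j) Kj))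
      by-cases false Kj = trans (reflexive (≡.cong (if_then N r j else M r j) (≡.trans (done-all j) Kj))) (sym (N≈M r j Kj))
    after-k : ∀ k → k ≤ n → det n (after k) ≈ product (scale k) * det n M
    after-k zero _ = begin
      det n (after zero)          ≈⟨ det-cong n (λ r j → reflexive (≡.cong (if_then N r j else M r j) (∧-zeroʳ (K j)))) ⟩
      det n M                     ≈⟨ *-identityˡ _ ⟨
      1# * det n M                ≈⟨ *-congʳ (sym (product-ones (λ j → reflexive (≡.cong (if_then s j else 1#) (∧-zeroʳ (K j)))))) ⟩
      product (scale zero) * det n M ∎
    after-k (suc k) k<n = step (K j₀) ≡.refl
      where
      j₀ : Fin n
      j₀ = fromℕ< k<n
      ih : det n (after k) ≈ product (scale k) * det n M
      ih = after-k k (ℕₚ.<⇒≤ k<n)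
      unchanged : ∀ j → j ≢ j₀ → done (suc k) j ≡ done k j
      unchanged j j≢j₀ = ≡.cong (K j ∧_) (<ᵇ-suc (toℕ j) k (λ e → j≢j₀ (toℕ-injective (≡.trans e (≡.sym (toℕ-fromℕ< k<n))))))
      not-yet : done k j₀ ≡ false
      not-yet = ≡.trans (≡.cong (λ x → K j₀ ∧ (x <ᵇ k)) (toℕ-fromℕ< k<n)) (≡.trans (≡.cong (K j₀ ∧_) (n<ᵇn k)) (∧-zeroʳ (K j₀)))
      now : done (suc k) j₀ ≡ K j₀
      now = ≡.trans (≡.cong (λ x → K j₀ ∧ (x <ᵇ suc k)) (toℕ-fromℕ< k<n)) (≡.trans (≡.cong (K j₀ ∧_) (n<ᵇ1+n k)) (∧-identityʳ (K j₀)))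
      after-unchanged : ∀ r j → j ≢ j₀ → after (suc k) r j ≈ after k r j
      after-unchanged r j j≢j₀ = reflexive (≡.cong (if_then N r j else M r j) (unchanged j j≢j₀))
      step : ∀ b → K j₀ ≡ b → det n (after (suc k)) ≈ product (scale (suc k)) * det n M
      step false Kj₀ = begin
        det n (after (suc k))        ≈⟨ det-cong n same ⟩
        det n (after k)              ≈⟨ ih ⟩
        product (scale k) * det n M  ≈⟨ *-congʳ (product-cong same-scale) ⟩
        product (scale (suc k)) * det n M ∎
        where
        same : ∀ r j → after (suc k) r j ≈ after k r j
        same r j with j ≟ j₀
        ... | no j≢j₀ = after-unchanged r j j≢j₀
        ... | yes ≡.refl = reflexive (≡.trans (≡.cong (if_then N r j else M r j) (≡.trans now Kj₀))
                                              (≡.sym (≡.cong (if_then N r j else M r j) not-yet)))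
        same-scale : ∀ j → scale k j ≈ scale (suc k) j
        same-scale j with j ≟ j₀
        ... | no j≢j₀ = reflexive (≡.cong (if_then s j else 1#) (≡.sym (unchanged j j≢j₀)))
        ... | yes ≡.refl = reflexive (≡.trans (≡.cong (if_then s j else 1#) not-yet)
                                              (≡.sym (≡.cong (if_then s j else 1#) (≡.trans now Kj₀))))
      step true Kj₀ = begin
        det n (after (suc k))
          ≈⟨ det-linearCol-sum n n (after k) (after (suc k)) j₀ (s j₀) (C j₀) (λ t r → M r t) after-unchanged column-j₀ ⟩
        s j₀ * det n (after k) + ∑[ t < n ] (C j₀ t * det n (updateCol (after k) j₀ (λ r → M r t)))
          ≈⟨ +-congˡ (sum-zero vanishes) ⟩
        s j₀ * det n (after k) + 0#
          ≈⟨ +-identityʳ _ ⟩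
        s j₀ * det n (after k)
          ≈⟨ *-congˡ ih ⟩
        s j₀ * (product (scale k) * det n M)
          ≈⟨ *-assoc _ _ _ ⟨
        s j₀ * product (scale k) * det n M
          ≈⟨ *-congʳ scale-step ⟩
        product (scale (suc k)) * det n M ∎
        where
        column-j₀ : ∀ r → after (suc k) r j₀ ≈ s j₀ * after k r j₀ + ∑[ t < n ] (C j₀ t * M r t)
        column-j₀ r = begin
          after (suc k) r j₀
            ≡⟨ ≡.cong (if_then N r j₀ else M r j₀) (≡.trans now Kj₀) ⟩
          N r j₀
            ≈⟨ N≈op r j₀ Kj₀ ⟩
          s j₀ * M r j₀ + ∑[ t < n ] (C j₀ t * M r t)
            ≡⟨ ≡.cong (λ x → s j₀ * x + ∑[ t < n ] (C j₀ t * M r t)) (≡.cong (if_then N r j₀ else M r j₀) not-yet) ⟨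
          s j₀ * after k r j₀ + ∑[ t < n ] (C j₀ t * M r t) ∎
        vanishes : ∀ t → C j₀ t * det n (updateCol (after k) j₀ (λ r → M r t)) ≈ 0#
        vanishes t with K t in Kt
        ... | true  = trans (*-congʳ (C≈0 j₀ t Kt)) (zeroˡ _)
        ... | false = trans (*-congˡ (det-equalCols n _ j₀ t j₀≢t equal)) (zeroʳ _)
          where
          j₀≢t : j₀ ≢ t
          j₀≢t ≡.refl with () ← ≡.trans (≡.sym Kj₀) Kt
          equal : ∀ r → updateCol (after k) j₀ (λ r → M r t) r j₀ ≈ updateCol (after k) j₀ (λ r → M r t) r t
          equal r = reflexive (≡.trans (updateCol-≡ (after k) j₀ (λ r → M r t) r)
            (≡.sym (≡.trans (updateCol-≢ (after k) j₀ (λ r → M r t) r (j₀≢t ∘ ≡.sym))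
                            (≡.cong (if_then N r t else M r t) (≡.cong (_∧ (toℕ t <ᵇ k)) Kt)))))
        scale-step : s j₀ * product (scale k) ≈ product (scale (suc k))
        scale-step = begin
          s j₀ * product (scale k)
            ≡⟨ ≡.cong (λ b → (if b then s j₀ else 1#) * product (scale k)) (≡.trans now Kj₀) ⟨
          scale (suc k) j₀ * product (scale k)
            ≈⟨ product-update (scale k) (scale (suc k)) j₀ (λ x x≢j₀ → reflexive (≡.cong (if_then s x else 1#) (≡.sym (unchanged x x≢j₀)))) ⟩
          scale k j₀ * product (scale (suc k))
            ≡⟨ ≡.cong (λ b → (if b then s j₀ else 1#) * product (scale (suc k))) not-yet ⟩
          1# * product (scale (suc k))
            ≈⟨ *-identityˡ _ ⟩
          product (scale (suc k)) ∎

  det-rowOperations : ∀ n (M N : Matrix n) (K : Fin n → Bool) (s : Vector A n) (C : Matrix n) →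
    (∀ j t → K t ≡ true → C j t ≈ 0#) →
    (∀ j r → K j ≡ false → N j r ≈ M j r) →
    (∀ j r → K j ≡ true → N j r ≈ s j * M j r + ∑[ t < n ] (C j t * M t r)) →
    det n N ≈ product (λ j → if K j then s j else 1#) * det n M
  det-rowOperations n M N K s C C≈0 N≈M N≈op = begin
    det n N                                              ≈⟨ det-ᵀ n N ⟨
    det n (N ᵀ)                                          ≈⟨ det-columnOperations n (M ᵀ) (N ᵀ) K s C C≈0 (λ r j → N≈M j r) (λ r j → N≈op j r) ⟩
    product (λ j → if K j then s j else 1#) * det n (M ᵀ) ≈⟨ *-congˡ (det-ᵀ n M) ⟩
    product (λ j → if K j then s j else 1#) * det n M    ∎

  private
    det-transposeRowsCols : ∀ n (i j : Fin n) (M : Matrix n) →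
      det n (λ r s → M (PC.transpose i j r) (PC.transpose i j s)) ≈ det n M
    det-transposeRowsCols n i j M with i ≟ j
    ... | yes ≡.refl = det-cong n (λ r s → reflexive (≡.cong₂ M (transpose-same i r) (transpose-same i s)))
    ... | no i≢j = begin
      det n (λ r s → M (τ r) (τ s))  ≈⟨ det-swapCols n i j i≢j (λ r s → M (τ r) s) ⟩
      - det n (λ r s → M (τ r) s)    ≈⟨ -‿cong (det-ᵀ n (λ r s → M (τ r) s)) ⟨
      - det n (λ r s → M (τ s) r)    ≈⟨ -‿cong (det-swapCols n i j i≢j (M ᵀ)) ⟩
      - - det n (M ᵀ)                ≈⟨ -‿involutive _ ⟩
      det n (M ᵀ)                    ≈⟨ det-ᵀ n M ⟩
      det n M                        ∎
      where τ = PC.transpose i j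

  det-permute : ∀ {n} (π : Permutation′ n) (M : Matrix n) → det n (λ r s → M (π ⟨$⟩ʳ r) (π ⟨$⟩ʳ s)) ≈ det n M
  det-permute {n} π M = trans
    (det-cong n (λ r s → reflexive (≡.sym (≡.cong₂ M (eval-decompose π r) (eval-decompose π s)))))
    (by-transpositions (decompose π))
    where
    by-transpositions : ∀ τs → det n (λ r s → M (eval τs ⟨$⟩ʳ r) (eval τs ⟨$⟩ʳ s)) ≈ det n M
    by-transpositions []             = refl
    by-transpositions ((i , j) ∷ τs) = trans
      (det-transposeRowsCols n i j (λ r s → M (eval τs ⟨$⟩ʳ r) (eval τs ⟨$⟩ʳ s)))
      (by-transpositions τs)

  det-reindex : ∀ {m n} (π : Permutation m n) (M : Matrix n) → det m (λ r s → M (π ⟨$⟩ʳ r) (π ⟨$⟩ʳ s)) ≈ det n M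
  det-reindex π M with ≡.refl ← ↔⇒≡ π = det-permute π M

-- Evaluation of polynomials of degree ≤ n at X = u / v, multiplied by v ^ n
-- so that no division is needed, transported along a ring homomorphism h.
module Homogenisation {c ℓ} (R S : CommutativeRing c ℓ) (h : CommutativeRing.Carrier R → CommutativeRing.Carrier S)
  (h-isRingHomomorphism : RingMorphisms.IsRingHomomorphism (CommutativeRing.rawRing R) (CommutativeRing.rawRing S) h)
  (u v : CommutativeRing.Carrier S) where

  private
    module R = CommutativeRing R
    module P = Determinant (Polynomial.polynomialRing R)
    module Pₛ = RingSum (Polynomial.polynomialRing R)
  open CommutativeRing S renaming (Carrier to A) hiding (zero)
  open RingMorphisms.IsRingHomomorphism h-isRingHomomorphism
    using (+-homo; *-homo; 0#-homo; 1#-homo; -‿homo) renaming (⟦⟧-cong to h-cong)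
  open Polynomial R using (Poly; coeff; DegreeAtMost; _+ₚ_; _*ₚ_; _≋_; mk≋; get; coeff-+ₚ; coeff-negₚ; coeff-[]; coeff-0∷[]; coeff-scale; *ₚ-congʳ)
  open import Algebra.Properties.Ring ring using (-‿+-comm; -‿distribˡ-*; -‿distribʳ-*)
  open import Algebra.Properties.CommutativeSemigroup *-commutativeSemigroup
    using () renaming (x∙yz≈y∙xz to x*[y*z]≈y*[x*z])
  open import Algebra.Properties.CommutativeSemigroup +-commutativeSemigroup
    using () renaming (x∙yz≈y∙xz to x+[y+z]≈y+[x+z]; interchange to +-interchange)
  open RingSum S
  open Determinant S
  open import Relation.Binary.Reasoning.Setoid setoid

  homog : ℕ → (ℕ → R.Carrier) → A
  homog zero    g = h (g 0)
  homog (suc n) g = h (g 0) * v ^ suc n + u * homog n (g ∘ suc)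

  homog-cong : ∀ n {f g} → (∀ k → f k R.≈ g k) → homog n f ≈ homog n g
  homog-cong zero    f≈g = h-cong (f≈g 0)
  homog-cong (suc n) f≈g = +-cong (*-congʳ (h-cong (f≈g 0))) (*-congˡ (homog-cong n (f≈g ∘ suc)))

  private
    h-zero : ∀ {a} → a R.≈ R.0# → h a ≈ 0#
    h-zero a≈0 = trans (h-cong a≈0) 0#-homo

  homog-zero : ∀ n {f} → (∀ k → f k R.≈ R.0#) → homog n f ≈ 0#
  homog-zero zero    f≈0 = h-zero (f≈0 0)
  homog-zero (suc n) {f} f≈0 = begin
    h (f 0) * v ^ suc n + u * homog n (f ∘ suc)
      ≈⟨ +-cong (trans (*-congʳ (h-zero (f≈0 0))) (zeroˡ _)) (trans (*-congˡ (homog-zero n (f≈0 ∘ suc))) (zeroʳ u)) ⟩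
    0# + 0#
      ≈⟨ +-identityˡ 0# ⟩
    0# ∎

  homog-+ : ∀ n f g → homog n (λ k → f k R.+ g k) ≈ homog n f + homog n g
  homog-+ zero    f g = +-homo _ _
  homog-+ (suc n) f g = begin
    h (f 0 R.+ g 0) * v ^ suc n + u * homog n (λ k → f (suc k) R.+ g (suc k))
      ≈⟨ +-cong (trans (*-congʳ (+-homo _ _)) (distribʳ _ _ _)) (trans (*-congˡ (homog-+ n (f ∘ suc) (g ∘ suc))) (distribˡ u _ _)) ⟩
    (h (f 0) * v ^ suc n + h (g 0) * v ^ suc n) + (u * homog n (f ∘ suc) + u * homog n (g ∘ suc))
      ≈⟨ +-interchange _ _ _ _ ⟩
    (h (f 0) * v ^ suc n + u * homog n (f ∘ suc)) + (h (g 0) * v ^ suc n + u * homog n (g ∘ suc)) ∎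

  homog-neg : ∀ n f → homog n (λ k → R.- f k) ≈ - homog n f
  homog-neg zero    f = -‿homo _
  homog-neg (suc n) f = begin
    h (R.- f 0) * v ^ suc n + u * homog n (λ k → R.- f (suc k))
      ≈⟨ +-cong (trans (*-congʳ (-‿homo _)) (sym (-‿distribˡ-* _ _))) (trans (*-congˡ (homog-neg n (f ∘ suc))) (sym (-‿distribʳ-* _ _))) ⟩
    - (h (f 0) * v ^ suc n) + - (u * homog n (f ∘ suc))
      ≈⟨ -‿+-comm _ _ ⟩
    - (h (f 0) * v ^ suc n + u * homog n (f ∘ suc)) ∎

  private
    constantSeq : R.Carrier → ℕ → R.Carrier
    constantSeq a zero    = a
    constantSeq a (suc k) = R.0#

    homog-constantSeq : ∀ n a → homog n (constantSeq a) ≈ h a * v ^ n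
    homog-constantSeq zero    a = sym (*-identityʳ _)
    homog-constantSeq (suc n) a = trans (+-congˡ (trans (*-congˡ (homog-zero n (λ _ → R.refl))) (zeroʳ u))) (+-identityʳ _)

  -- Coefficients of (a + b X) f.
  linearTimes : R.Carrier → R.Carrier → (ℕ → R.Carrier) → ℕ → R.Carrier
  linearTimes a b f zero    = a R.* f 0
  linearTimes a b f (suc k) = a R.* f (suc k) R.+ b R.* f k

  private
    rearrange : ∀ x y f₀ V P → x * f₀ * (v * V) + u * ((x * v + y * u) * P + y * f₀ * V)
                              ≈ (x * v + y * u) * (f₀ * V + u * P)
    rearrange x y f₀ V P = begin
      x * f₀ * (v * V) + u * (L * P + y * f₀ * V)              ≈⟨ +-congˡ (distribˡ u _ _) ⟩
      x * f₀ * (v * V) + (u * (L * P) + u * (y * f₀ * V))      ≈⟨ x+[y+z]≈y+[x+z] _ _ _ ⟩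
      u * (L * P) + (x * f₀ * (v * V) + u * (y * f₀ * V))      ≈⟨ +-cong (x*[y*z]≈y*[x*z] u L P) (+-cong xf₀vV yf₀uV) ⟩
      L * (u * P) + (x * v * (f₀ * V) + y * u * (f₀ * V))      ≈⟨ +-congˡ (distribʳ _ _ _) ⟨
      L * (u * P) + L * (f₀ * V)                               ≈⟨ +-comm _ _ ⟩
      L * (f₀ * V) + L * (u * P)                               ≈⟨ distribˡ L _ _ ⟨
      L * (f₀ * V + u * P)                                     ∎
      where
      L : A
      L = x * v + y * u
      xf₀vV : x * f₀ * (v * V) ≈ x * v * (f₀ * V)
      xf₀vV = trans (*-assoc _ _ _) (trans (*-congˡ (x*[y*z]≈y*[x*z] f₀ v V)) (sym (*-assoc _ _ _)))
      yf₀uV : u * (y * f₀ * V) ≈ y * u * (f₀ * V)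
      yf₀uV = trans (*-congˡ (*-assoc _ _ _)) (trans (x*[y*z]≈y*[x*z] u y _) (sym (*-assoc _ _ _)))

  homog-linearTimes : ∀ n a b f → f (suc n) R.≈ R.0# →
    homog (suc n) (linearTimes a b f) ≈ (h a * v + h b * u) * homog n f
  homog-linearTimes zero a b f f₁≈0 = begin
    h (a R.* f 0) * v ^ 1 + u * h (a R.* f 1 R.+ b R.* f 0)
      ≈⟨ +-cong (*-cong (*-homo a (f 0)) (*-identityʳ v))
                (*-congˡ (trans (+-homo _ _) (trans (+-congʳ (h-zero (R.trans (R.*-congˡ f₁≈0) (R.zeroʳ a)))) (trans (+-identityˡ _) (*-homo b (f 0)))))) ⟩
    h a * h (f 0) * v + u * (h b * h (f 0))
      ≈⟨ +-cong (trans (*-assoc _ _ _) (trans (*-congˡ (*-comm _ _)) (sym (*-assoc _ _ _)))) (trans (x*[y*z]≈y*[x*z] u _ _) (sym (*-assoc _ _ _))) ⟩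
    h a * v * h (f 0) + h b * u * h (f 0)
      ≈⟨ distribʳ _ _ _ ⟨
    (h a * v + h b * u) * h (f 0) ∎
  homog-linearTimes (suc n) a b f fₙ₊₂≈0 = begin
    h (a R.* f 0) * v ^ suc (suc n) + u * homog (suc n) (linearTimes a b f ∘ suc)
      ≈⟨ +-congˡ (*-congˡ (trans (homog-cong (suc n) split) (homog-+ (suc n) (linearTimes a b (f ∘ suc)) (constantSeq (b R.* f 0))))) ⟩
    h (a R.* f 0) * v ^ suc (suc n) + u * (homog (suc n) (linearTimes a b (f ∘ suc)) + homog (suc n) (constantSeq (b R.* f 0)))
      ≈⟨ +-cong (*-congʳ (*-homo a (f 0))) (*-congˡ (+-cong (homog-linearTimes n a b (f ∘ suc) fₙ₊₂≈0)
                                                              (trans (homog-constantSeq (suc n) _) (*-congʳ (*-homo b (f 0)))))) ⟩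
    h a * h (f 0) * (v * v ^ suc n) + u * ((h a * v + h b * u) * homog n (f ∘ suc) + h b * h (f 0) * v ^ suc n)
      ≈⟨ rearrange (h a) (h b) (h (f 0)) (v ^ suc n) (homog n (f ∘ suc)) ⟩
    (h a * v + h b * u) * (h (f 0) * v ^ suc n + u * homog n (f ∘ suc)) ∎
    where
    split : ∀ k → linearTimes a b f (suc k) R.≈ linearTimes a b (f ∘ suc) k R.+ constantSeq (b R.* f 0) k
    split zero    = R.refl
    split (suc k) = R.sym (R.+-identityʳ _)

  homogenise : ℕ → Poly → A
  homogenise n p = homog n (coeff p)

  -- The value of a polynomial of degree ≤ 1 at X = u / v, times v.
  linear : Poly → A
  linear p = h (coeff p 0) * v + h (coeff p 1) * u

  private
    coeff-linear-*ₚ : ∀ p q → DegreeAtMost p 1 → ∀ k → coeff (p *ₚ q) k R.≈ linearTimes (coeff p 0) (coeff p 1) (coeff q) k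
    coeff-linear-*ₚ p q deg≤1 k = R.trans (get (*ₚ-congʳ p (a ∷ b ∷ []) q p≋a+bX) k) (coeff-a+bX k)
      where
      open R using (_+_; _*_)
      a = coeff p 0
      b = coeff p 1
      p≋a+bX : p ≋ (a ∷ b ∷ [])
      p≋a+bX = mk≋ λ { zero → R.refl ; (suc zero) → R.refl
                     ; (suc (suc j)) → R.trans (deg≤1 (suc (suc j)) (s≤s (s≤s z≤n))) (R.reflexive (≡.sym (coeff-[] j))) }
      coeff-a+bX : ∀ k → coeff ((a ∷ b ∷ []) *ₚ q) k R.≈ linearTimes a b (coeff q) k
      coeff-a+bX zero    = R.trans (coeff-+ₚ (Over.scale R a q) _ 0) (R.trans (R.+-congʳ (coeff-scale a q 0)) (R.+-identityʳ _))
      coeff-a+bX (suc k) = R.trans (coeff-+ₚ (Over.scale R a q) _ (suc k)) (R.+-cong (coeff-scale a q (suc k))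
        (R.trans (coeff-+ₚ (Over.scale R b q) (R.0# ∷ []) k) (R.trans (R.+-cong (coeff-scale b q k) (coeff-0∷[] k)) (R.+-identityʳ _))))

    degree-linear-*ₚ : ∀ p q n → DegreeAtMost p 1 → DegreeAtMost q n → DegreeAtMost (p *ₚ q) (suc n)
    degree-linear-*ₚ p q n p≤1 q≤n (suc k) (s≤s n<k) = R.trans (coeff-linear-*ₚ p q p≤1 (suc k))
      (R.trans (R.+-cong (R.trans (R.*-congˡ (q≤n (suc k) (ℕₚ.m<n⇒m<1+n n<k))) (R.zeroʳ _)) (R.trans (R.*-congˡ (q≤n k n<k)) (R.zeroʳ _)))
               (R.+-identityˡ _))

    homogenise-linear-*ₚ : ∀ n p q → DegreeAtMost p 1 → DegreeAtMost q n →
      homogenise (suc n) (p *ₚ q) ≈ linear p * homogenise n q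
    homogenise-linear-*ₚ n p q p≤1 q≤n = trans (homog-cong (suc n) (coeff-linear-*ₚ p q p≤1))
      (homog-linearTimes n (coeff p 0) (coeff p 1) (coeff q) (q≤n (suc n) (ℕₚ.n<1+n n)))

    degree-+ₚ : ∀ p q n → DegreeAtMost p n → DegreeAtMost q n → DegreeAtMost (p +ₚ q) n
    degree-+ₚ p q n p≤n q≤n k n<k = R.trans (coeff-+ₚ p q k) (R.trans (R.+-cong (p≤n k n<k) (q≤n k n<k)) (R.+-identityˡ _))

    degree-altSign : ∀ n k p → DegreeAtMost p n → DegreeAtMost (P.altSign k p) n
    degree-altSign n zero    p p≤n = p≤n
    degree-altSign n (suc k) p p≤n j n<j =
      R.trans (coeff-negₚ (P.altSign k p) j) (R.trans (R.-‿cong (degree-altSign n k p p≤n j n<j)) -0#≈0#)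
      where open import Algebra.Properties.Ring R.ring using (-0#≈0#)

    degree-sum : ∀ n m (f : Fin m → Poly) → (∀ i → DegreeAtMost (f i) n) → DegreeAtMost (Pₛ.sum f) n
    degree-sum n zero    f f≤n k n<k = R.reflexive (coeff-[] k)
    degree-sum n (suc m) f f≤n = degree-+ₚ (f zero) _ n (f≤n zero) (degree-sum n m (f ∘ suc) (f≤n ∘ suc))

    homogenise-+ₚ : ∀ n p q → homogenise n (p +ₚ q) ≈ homogenise n p + homogenise n q
    homogenise-+ₚ n p q = trans (homog-cong n (coeff-+ₚ p q)) (homog-+ n (coeff p) (coeff q))

    homogenise-altSign : ∀ n k p → homogenise n (P.altSign k p) ≈ altSign k (homogenise n p)
    homogenise-altSign n zero    p = refl
    homogenise-altSign n (suc k) p = trans (homog-cong n (coeff-negₚ (P.altSign k p))) (trans (homog-neg n _) (-‿cong (homogenise-altSign n k p)))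

    homogenise-sum : ∀ n m (f : Fin m → Poly) → homogenise n (Pₛ.sum f) ≈ ∑[ i < m ] homogenise n (f i)
    homogenise-sum n zero    f = homog-zero n (λ k → R.reflexive (coeff-[] k))
    homogenise-sum n (suc m) f = trans (homogenise-+ₚ n (f zero) _) (+-congˡ (homogenise-sum n m (f ∘ suc)))

    homogenise-1ₚ : DegreeAtMost (Polynomial.1ₚ R) 0 × homogenise 0 (Polynomial.1ₚ R) ≈ 1#
    homogenise-1ₚ = (λ { (suc k) _ → R.reflexive (coeff-[] k) }) , 1#-homo

  homogenise-det : ∀ n (L : P.Matrix n) → (∀ i j → DegreeAtMost (L i j) 1) →
    DegreeAtMost (P.det n L) n × homogenise n (P.det n L) ≈ det n (λ i j → linear (L i j))
  homogenise-det zero    L L≤1 = homogenise-1ₚ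
  homogenise-det (suc n) L L≤1 = degree , value
    where
    term : Fin (suc n) → Poly
    term j = P.altSign (toℕ j) (L zero j *ₚ P.det n (P.minor zero j L))
    ih : ∀ j → DegreeAtMost (P.det n (P.minor zero j L)) n × homogenise n (P.det n (P.minor zero j L)) ≈ det n (λ r s → linear (P.minor zero j L r s))
    ih j = homogenise-det n (P.minor zero j L) (λ r s → L≤1 _ _)
    degree : DegreeAtMost (P.det (suc n) L) (suc n)
    degree = degree-sum (suc n) (suc n) term
      (λ j → degree-altSign (suc n) (toℕ j) (L zero j *ₚ P.det n (P.minor zero j L))
                (degree-linear-*ₚ (L zero j) (P.det n (P.minor zero j L)) n (L≤1 zero j) (proj₁ (ih j))))
    value : homogenise (suc n) (P.det (suc n) L) ≈ det (suc n) (λ i j → linear (L i j))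
    value = trans (homogenise-sum (suc n) (suc n) term) (sum-cong-≋ λ j →
      trans (homogenise-altSign (suc n) (toℕ j) (L zero j *ₚ P.det n (P.minor zero j L))) (altSign-cong (toℕ j)
        (trans (homogenise-linear-*ₚ n (L zero j) (P.det n (P.minor zero j L)) (L≤1 zero j) (proj₁ (ih j))) (*-congˡ (proj₂ (ih j))))))

  homogenise-product : ∀ m (ps : Fin m → Poly) → (∀ i → DegreeAtMost (ps i) 1) →
    DegreeAtMost (Pₛ.product ps) m × homogenise m (Pₛ.product ps) ≈ product (λ i → linear (ps i))
  homogenise-product zero    ps ps≤1 = homogenise-1ₚ
  homogenise-product (suc m) ps ps≤1 =
    degree-linear-*ₚ (ps zero) (Pₛ.product (ps ∘ suc)) m (ps≤1 zero) (proj₁ ih) ,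
    trans (homogenise-linear-*ₚ m (ps zero) (Pₛ.product (ps ∘ suc)) (ps≤1 zero) (proj₁ ih)) (*-congˡ (proj₂ ih))
    where
    ih : DegreeAtMost (Pₛ.product (ps ∘ suc)) m × homogenise m (Pₛ.product (ps ∘ suc)) ≈ product (λ i → linear (ps (suc i)))
    ih = homogenise-product m (ps ∘ suc) (ps≤1 ∘ suc)

module MonicCancellation {c ℓ} (R : CommutativeRing c ℓ) where
  open CommutativeRing R renaming (Carrier to A) hiding (zero)
  open Polynomial R
  open RingSum R using (sum-syntax; sum-δ; sum-zero)
  open import Relation.Binary.Reasoning.Setoid setoid
  private
    module P = CommutativeRing polynomialRing

  coeff-*ₚ : ∀ p q n → coeff (p *ₚ q) n ≈ ∑[ i < suc n ] (coeff p (toℕ i) * coeff q (n ℕ.∸ toℕ i))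
  coeff-*ₚ []      q n       = trans (reflexive (coeff-[] n)) (sym (sum-zero {suc n} (λ i →
    trans (*-congʳ {coeff q (n ℕ.∸ toℕ i)} (reflexive (coeff-[] (toℕ i)))) (zeroˡ _))))
  coeff-*ₚ (a ∷ p) q zero    = trans (coeff-+ₚ (scale a q) _ 0) (+-congʳ (coeff-scale a q 0))
  coeff-*ₚ (a ∷ p) q (suc n) = trans (coeff-+ₚ (scale a q) _ (suc n)) (+-cong (coeff-scale a q (suc n)) (coeff-*ₚ p q n))

  coeff-≥length : ∀ p j → length p ≤ j → coeff p j ≈ 0#
  coeff-≥length []      j       _          = reflexive (coeff-[] j)
  coeff-≥length (a ∷ p) (suc j) (s≤s len≤j) = coeff-≥length p j len≤j

  -- Coefficient j of d vanishes by induction on length d ∸ j: it equals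
  -- coefficient D + j of m * d, whose other summands involve coefficients
  -- of m above D or coefficients of d above j.
  monic-*ₚ≋0⇒≋0 : ∀ m D → MonicOfDegree m D → ∀ d → m *ₚ d ≋ 0ₚ → d ≋ 0ₚ
  monic-*ₚ≋0⇒≋0 m D (mD≈1 , m>D≈0) d (mk≋ md≈0) =
    mk≋ λ j → trans (vanishes (length d) j (ℕₚ.m≤n+m (length d) j)) (reflexive (≡.sym (coeff-[] j)))
    where
    vanishes : ∀ t j → length d ≤ j ℕ.+ t → coeff d j ≈ 0#
    vanishes zero    j len≤j   = coeff-≥length d j (≡.subst (length d ≤_) (ℕₚ.+-identityʳ j) len≤j)
    vanishes (suc t) j len≤j+t = begin
      coeff d j                                    ≈⟨ *-identityˡ _ ⟨
      1# * coeff d j                               ≈⟨ *-congʳ mD≈1 ⟨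
      coeff m D * coeff d j                        ≡⟨ ≡.cong (λ y → coeff m D * coeff d y) (ℕₚ.m+n∸m≡n D j) ⟨
      coeff m D * coeff d (D ℕ.+ j ℕ.∸ D)          ≡⟨ ≡.cong (λ x → coeff m x * coeff d (D ℕ.+ j ℕ.∸ x)) (toℕ-fromℕ< D<) ⟨
      term i₀                                      ≈⟨ sum-δ term i₀ others ⟨
      ∑[ i < suc (D ℕ.+ j) ] term i                ≈⟨ coeff-*ₚ m d (D ℕ.+ j) ⟨
      coeff (m *ₚ d) (D ℕ.+ j)                     ≈⟨ md≈0 (D ℕ.+ j) ⟩
      coeff 0ₚ (D ℕ.+ j)                           ≡⟨ coeff-[] (D ℕ.+ j) ⟩
      0#                                           ∎
      where
      term : Fin (suc (D ℕ.+ j)) → A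
      term i = coeff m (toℕ i) * coeff d (D ℕ.+ j ℕ.∸ toℕ i)
      D< : D < suc (D ℕ.+ j)
      D< = s≤s (ℕₚ.m≤m+n D j)
      i₀ : Fin (suc (D ℕ.+ j))
      i₀ = fromℕ< D<
      others : ∀ i → i ≢ i₀ → term i ≈ 0#
      others i i≢i₀ with ℕₚ.<-cmp (toℕ i) D
      ... | tri≈ _ i≡D _ = ⊥-elim (i≢i₀ (toℕ-injective (≡.trans i≡D (≡.sym (toℕ-fromℕ< D<)))))
      ... | tri> _ _ D<i = trans (*-congʳ (m>D≈0 _ D<i)) (zeroˡ _)
      ... | tri< i<D _ _ = trans (*-congˡ (vanishes t (D ℕ.+ j ℕ.∸ toℕ i) len≤)) (zeroʳ _)
        where
        j<D+j-i : suc j ≤ D ℕ.+ j ℕ.∸ toℕ i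
        j<D+j-i = ≡.subst (suc j ≤_) (≡.sym (ℕₚ.+-∸-comm j (ℕₚ.<⇒≤ i<D))) (ℕₚ.+-monoˡ-≤ j (ℕₚ.m<n⇒0<n∸m i<D))
        len≤ : length d ≤ (D ℕ.+ j ℕ.∸ toℕ i) ℕ.+ t
        len≤ = ℕₚ.≤-trans len≤j+t (ℕₚ.≤-trans (ℕₚ.≤-reflexive (ℕₚ.+-suc j t)) (ℕₚ.+-monoˡ-≤ t j<D+j-i))

  monic-*ₚ-cancelˡ : ∀ m D → MonicOfDegree m D → ∀ a b → m *ₚ a ≋ m *ₚ b → a ≋ b
  monic-*ₚ-cancelˡ m D monic a b ma≋mb = P.trans (P.sym a-b+b≋a) (P.trans (P.+-congʳ a-b≋0) (P.+-identityˡ b))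
    where
    open import Algebra.Properties.Ring P.ring using (-‿distribʳ-*)
    a-b≋0 : a -ₚ b ≋ 0ₚ
    a-b≋0 = monic-*ₚ≋0⇒≋0 m D monic (a -ₚ b)
      (P.trans (P.distribˡ m a (-ₚ b)) (P.trans (P.+-cong ma≋mb (P.sym (-‿distribʳ-* m b))) (P.-‿inverseʳ (m *ₚ b))))
    a-b+b≋a : (a -ₚ b) +ₚ b ≋ a
    a-b+b≋a = P.trans (P.+-assoc a (-ₚ b) b) (P.trans (P.+-congˡ (P.-‿inverseˡ b)) (P.+-identityʳ a))

module Kronecker {c ℓ} (S : CommutativeRing c ℓ) where
  open CommutativeRing S renaming (Carrier to A) hiding (zero)
  open RingSum S
  open Determinant S
  open import Algebra.Properties.Ring ring using (-‿involutive; -‿+-comm; -‿distribʳ-*; -1*x≈-x)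
  open import Algebra.Properties.CommutativeSemigroup +-commutativeSemigroup
    using () renaming (x∙yz≈y∙xz to x+[y+z]≈y+[x+z])
  open import Relation.Binary.Reasoning.Setoid setoid

  onlyIf : Bool → A → A
  onlyIf b a = if b then a else 0#

  det-blockDiagonal : ∀ m n (B : Matrix n) (D : Matrix (m ℕ.* n)) →
    (∀ (i : Fin m) (k : Fin n) j l → D (combine i k) (combine j l) ≈ onlyIf ⌊ i ≟ j ⌋ (B k l)) →
    det (m ℕ.* n) D ≈ det n B ^ m
  det-blockDiagonal zero    n B D D≈ = refl
  det-blockDiagonal (suc m) n B D D≈ =
    trans (det-blockLowerTriangular n (m ℕ.* n) D B D′ upper-right (λ k l → D≈ zero k zero l) (λ _ _ → refl))
          (*-congˡ (det-blockDiagonal m n B D′ D′≈))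
    where
    D′ : Matrix (m ℕ.* n)
    D′ r s = D (n ↑ʳ r) (n ↑ʳ s)
    upper-right : ∀ k c → D (k ↑ˡ m ℕ.* n) (n ↑ʳ c) ≈ 0#
    upper-right k = combine-elim (λ c → D (k ↑ˡ m ℕ.* n) (n ↑ʳ c) ≈ 0#) (λ j l → D≈ zero k (suc j) l)
    D′≈ : ∀ (i : Fin m) (k : Fin n) j l → D′ (combine i k) (combine j l) ≈ onlyIf ⌊ i ≟ j ⌋ (B k l)
    D′≈ i k j l = trans (D≈ (suc i) k (suc j) l) (reflexive (≡.cong (λ b → onlyIf b (B k l)) (⌊≟⌋-injective suc suc-injective i j)))

  private
    x-z-[0-z]≈x : ∀ x z → (x - z) - (0# - z) ≈ x
    x-z-[0-z]≈x x z = begin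
      (x - z) - (0# - z)  ≈⟨ +-congˡ (-‿cong (+-identityˡ (- z))) ⟩
      (x - z) - (- z)     ≈⟨ +-congˡ (-‿involutive z) ⟩
      (x - z) + z         ≈⟨ +-assoc x (- z) z ⟩
      x + (- z + z)       ≈⟨ +-congˡ (-‿inverseˡ z) ⟩
      x + 0#              ≈⟨ +-identityʳ x ⟩
      x                   ∎

    [0-z]-[x-z]+x≈0 : ∀ x z → ((0# - z) - (x - z)) + x ≈ 0#
    [0-z]-[x-z]+x≈0 x z = begin
      ((0# - z) - (x - z)) + x   ≈⟨ +-congʳ (+-cong (+-identityˡ (- z)) (sym (-‿+-comm x (- z)))) ⟩
      (- z + (- x + - - z)) + x  ≈⟨ +-congʳ (+-congˡ (+-congˡ (-‿involutive z))) ⟩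
      (- z + (- x + z)) + x      ≈⟨ +-congʳ (x+[y+z]≈y+[x+z] (- z) (- x) z) ⟩
      (- x + (- z + z)) + x      ≈⟨ +-congʳ (+-congˡ (-‿inverseˡ z)) ⟩
      (- x + 0#) + x             ≈⟨ +-congʳ (+-identityʳ (- x)) ⟩
      - x + x                    ≈⟨ -‿inverseˡ x ⟩
      0#                         ∎

    x-z+n[0-z]≈x-[1+n]z : ∀ n x z → (x - z) + Over.ofℕ S n * (0# - z) ≈ x - Over.ofℕ S (suc n) * z
    x-z+n[0-z]≈x-[1+n]z n x z = begin
      (x - z) + nᵣ * (0# - z)      ≈⟨ +-congˡ (*-congˡ (+-identityˡ (- z))) ⟩
      (x - z) + nᵣ * (- z)         ≈⟨ +-congˡ (-‿distribʳ-* nᵣ z) ⟨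
      (x - z) + - (nᵣ * z)         ≈⟨ +-assoc x (- z) _ ⟩
      x + (- z + - (nᵣ * z))       ≈⟨ +-congˡ (-‿+-comm z _) ⟩
      x - (z + nᵣ * z)             ≈⟨ +-congˡ (-‿cong (+-congʳ (*-identityˡ z))) ⟨
      x - (1# * z + nᵣ * z)        ≈⟨ +-congˡ (-‿cong (distribʳ z 1# nᵣ)) ⟨
      x - Over.ofℕ S (suc n) * z   ∎
      where nᵣ = Over.ofℕ S n

  -- y I − J ⊗ C with the blocks of J ⊗ C indexed by the outer factor: subtracting
  -- the first column of every block row from the others, then adding all rows of
  -- every block column to its first row, makes the matrix block lower triangular
  -- with diagonal blocks y I − n₂ C and y I.
  private
    module BlockOnes (n₁ n₂′ : ℕ) (y : A) (C : Matrix n₁) (Q : Matrix (suc n₂′ ℕ.* n₁))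
      (Q≈ : ∀ (k : Fin (suc n₂′)) (i : Fin n₁) l j → Q (combine k i) (combine l j) ≈ onlyIf (⌊ i ≟ j ⌋ ∧ ⌊ k ≟ l ⌋) y - C i j) where

      rest NN : ℕ
      rest = n₂′ ℕ.* n₁
      NN = suc n₂′ ℕ.* n₁

      pair : Fin (suc n₂′) → Fin n₁ → Fin NN
      pair = combine

      first later : Fin NN → Bool
      first x = [ (λ _ → true) , (λ _ → false) ]′ (splitAt n₁ x)
      later = not ∘ first

      position : Fin NN → Fin n₁
      position x = proj₂ (remQuot {suc n₂′} n₁ x)

      first-zero : ∀ i → first (pair zero i) ≡ true
      first-zero i = ≡.cong [ (λ _ → true) , (λ _ → false) ]′ (splitAt-↑ˡ n₁ i rest)

      first-suc : ∀ k i → first (pair (suc k) i) ≡ false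
      first-suc k i = ≡.cong [ (λ _ → true) , (λ _ → false) ]′ (splitAt-↑ʳ n₁ rest (combine k i))

      position-combine : ∀ k i → position (pair k i) ≡ i
      position-combine k i = ≡.cong proj₂ (remQuot-combine k i)

      G : Matrix n₁
      G i j = onlyIf ⌊ i ≟ j ⌋ y - Over.ofℕ S (suc n₂′) * C i j

      E-first-first : ∀ i j → Q (pair zero i) (pair zero j) ≈ onlyIf ⌊ i ≟ j ⌋ y - C i j
      E-first-first i j = trans (Q≈ zero i zero j) (reflexive (≡.cong (λ b → onlyIf b y - C i j) (∧-identityʳ _)))

      E-later-first : ∀ k i j → Q (pair (suc k) i) (pair zero j) ≈ 0# - C i j
      E-later-first k i j = trans (Q≈ (suc k) i zero j) (reflexive (≡.cong (λ b → onlyIf b y - C i j) (∧-zeroʳ _)))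

      E-first-later : ∀ l i j → Q (pair zero i) (pair (suc l) j) ≈ 0# - C i j
      E-first-later l i j = trans (Q≈ zero i (suc l) j) (reflexive (≡.cong (λ b → onlyIf b y - C i j) (∧-zeroʳ _)))

      E-later-later : ∀ k l i j → Q (pair (suc k) i) (pair (suc l) j) ≈ onlyIf (⌊ i ≟ j ⌋ ∧ ⌊ k ≟ l ⌋) y - C i j
      E-later-later k l i j = trans (Q≈ (suc k) i (suc l) j)
        (reflexive (≡.cong (λ b → onlyIf (⌊ i ≟ j ⌋ ∧ b) y - C i j) (⌊≟⌋-injective suc suc-injective k l)))

      colCoeff : Matrix NN
      colCoeff c t = if later t then 0# else onlyIf ⌊ position t ≟ position c ⌋ (- 1#)

      Q₁ : Matrix NN
      Q₁ r c = if later c then 1# * Q r c + ∑[ t < NN ] (colCoeff c t * Q r t) else Q r c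

      rowCoeff : Matrix NN
      rowCoeff r t = if first t then 0# else onlyIf ⌊ position t ≟ position r ⌋ 1#

      Q₂ : Matrix NN
      Q₂ r c = if first r then 1# * Q₁ r c + ∑[ t < NN ] (rowCoeff r t * Q₁ t c) else Q₁ r c

      ones : ∀ (b : Bool) → (if b then 1# else 1#) ≈ 1#
      ones true  = refl
      ones false = refl

      det-Q₁ : det NN Q₁ ≈ det NN Q
      det-Q₁ = trans
        (det-columnOperations NN Q Q₁ later (λ _ → 1#) colCoeff
          (λ j t later-t → reflexive (if-true later-t))
          (λ r j later-j → reflexive (if-false later-j))
          (λ r j later-j → reflexive (if-true later-j)))
        (trans (*-congʳ (product-ones (ones ∘ later))) (*-identityˡ _))

      det-Q₂ : det NN Q₂ ≈ det NN Q₁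
      det-Q₂ = trans
        (det-rowOperations NN Q₁ Q₂ first (λ _ → 1#) rowCoeff
          (λ j t first-t → reflexive (if-true first-t))
          (λ j r first-j → reflexive (if-false first-j))
          (λ j r first-j → reflexive (if-true first-j)))
        (trans (*-congʳ (product-ones (ones ∘ first))) (*-identityˡ _))

      later-zero : ∀ i → later (pair zero i) ≡ false
      later-zero i = ≡.cong not (first-zero i)

      later-↑ʳ : ∀ t → later (n₁ ↑ʳ t) ≡ true
      later-↑ʳ t = ≡.cong (not ∘ [ (λ _ → true) , (λ _ → false) ]′) (splitAt-↑ʳ n₁ rest t)

      onlyIf-⌊≟⌋ : ∀ {m} (i j : Fin m) a → i ≢ j → onlyIf ⌊ i ≟ j ⌋ a ≡ 0#
      onlyIf-⌊≟⌋ i j a i≢j = ≡.cong (λ b → onlyIf b a) (⌊≟⌋-≢ i≢j)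

      subtract-first : ∀ r l j → ∑[ t < NN ] (colCoeff (pair (suc l) j) t * Q r t) ≈ - Q r (pair zero j)
      subtract-first r l j = begin
        ∑[ t < NN ] (colCoeff (pair (suc l) j) t * Q r t)
          ≈⟨ sum-↑ n₁ (λ t → colCoeff (pair (suc l) j) t * Q r t) ⟩
        (∑[ i < n₁ ] (colCoeff (pair (suc l) j) (pair zero i) * Q r (pair zero i))) + (∑[ t < rest ] (colCoeff (pair (suc l) j) (n₁ ↑ʳ t) * Q r (n₁ ↑ʳ t)))
          ≈⟨ +-cong (sum-δ _ j (λ i i≢j → trans (*-congʳ (reflexive (coefficient i))) (trans (*-congʳ (reflexive (onlyIf-⌊≟⌋ i j _ i≢j))) (zeroˡ _))))
                    (sum-zero (λ t → trans (*-congʳ (reflexive (if-true (later-↑ʳ t)))) (zeroˡ _))) ⟩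
        colCoeff (pair (suc l) j) (pair zero j) * Q r (pair zero j) + 0#
          ≈⟨ +-identityʳ _ ⟩
        colCoeff (pair (suc l) j) (pair zero j) * Q r (pair zero j)
          ≡⟨ ≡.cong (_* Q r (pair zero j)) (≡.trans (coefficient j) (≡.cong (λ b → onlyIf b (- 1#)) (⌊≟⌋-refl j))) ⟩
        - 1# * Q r (pair zero j)
          ≈⟨ -1*x≈-x _ ⟩
        - Q r (pair zero j) ∎
        where
        coefficient : ∀ i → colCoeff (pair (suc l) j) (pair zero i) ≡ onlyIf ⌊ i ≟ j ⌋ (- 1#)
        coefficient i = ≡.trans (if-false (later-zero i))
          (≡.cong₂ (λ x z → onlyIf ⌊ x ≟ z ⌋ (- 1#)) (position-combine zero i) (position-combine (suc l) j))

      add-later : ∀ i c → ∑[ t < NN ] (rowCoeff (pair zero i) t * Q₁ t c) ≈ ∑[ k < n₂′ ] Q₁ (pair (suc k) i) c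
      add-later i c = begin
        ∑[ t < NN ] (rowCoeff (pair zero i) t * Q₁ t c)
          ≈⟨ sum-↑ n₁ (λ t → rowCoeff (pair zero i) t * Q₁ t c) ⟩
        (∑[ i′ < n₁ ] (rowCoeff (pair zero i) (pair zero i′) * Q₁ (pair zero i′) c)) + (∑[ t < rest ] (rowCoeff (pair zero i) (n₁ ↑ʳ t) * Q₁ (n₁ ↑ʳ t) c))
          ≈⟨ +-cong (sum-zero (λ i′ → trans (*-congʳ (reflexive (if-true (first-zero i′)))) (zeroˡ _)))
                    (sum-combine n₂′ (λ t → rowCoeff (pair zero i) (n₁ ↑ʳ t) * Q₁ (n₁ ↑ʳ t) c)) ⟩
        0# + ∑[ k < n₂′ ] ∑[ i′ < n₁ ] (rowCoeff (pair zero i) (pair (suc k) i′) * Q₁ (pair (suc k) i′) c)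
          ≈⟨ +-identityˡ _ ⟩
        ∑[ k < n₂′ ] ∑[ i′ < n₁ ] (rowCoeff (pair zero i) (pair (suc k) i′) * Q₁ (pair (suc k) i′) c)
          ≈⟨ sum-cong-≋ (λ k → trans (sum-δ _ i (λ i′ i′≢i → trans (*-congʳ (reflexive (≡.trans (coefficient k i′) (onlyIf-⌊≟⌋ i′ i 1# i′≢i)))) (zeroˡ _)))
                                      (trans (*-congʳ (reflexive (≡.trans (coefficient k i) (≡.cong (λ b → onlyIf b 1#) (⌊≟⌋-refl i))))) (*-identityˡ _))) ⟩
        ∑[ k < n₂′ ] Q₁ (pair (suc k) i) c ∎
        where
        coefficient : ∀ k i′ → rowCoeff (pair zero i) (pair (suc k) i′) ≡ onlyIf ⌊ i′ ≟ i ⌋ 1#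
        coefficient k i′ = ≡.trans (if-false (first-suc k i′))
          (≡.cong₂ (λ x z → onlyIf ⌊ x ≟ z ⌋ 1#) (position-combine (suc k) i′) (position-combine zero i))

      Q₁-first : ∀ r j → Q₁ r (pair zero j) ≈ Q r (pair zero j)
      Q₁-first r j = reflexive (if-false (later-zero j))

      Q₁-later : ∀ r l j → Q₁ r (pair (suc l) j) ≈ Q r (pair (suc l) j) - Q r (pair zero j)
      Q₁-later r l j = trans (reflexive (if-true (≡.cong not (first-suc l j)))) (+-cong (*-identityˡ _) (subtract-first r l j))

      Q₂-first : ∀ i c → Q₂ (pair zero i) c ≈ Q₁ (pair zero i) c + ∑[ k < n₂′ ] Q₁ (pair (suc k) i) c
      Q₂-first i c = trans (reflexive (if-true (first-zero i))) (+-cong (*-identityˡ _) (add-later i c))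

      Q₂-later : ∀ k i c → Q₂ (pair (suc k) i) c ≈ Q₁ (pair (suc k) i) c
      Q₂-later k i c = reflexive (if-false (first-suc k i))

      upper-left : ∀ i j → Q₂ (i ↑ˡ rest) (j ↑ˡ rest) ≈ G i j
      upper-left i j = begin
        Q₂ (pair zero i) (pair zero j)
          ≈⟨ Q₂-first i (pair zero j) ⟩
        Q₁ (pair zero i) (pair zero j) + ∑[ k < n₂′ ] Q₁ (pair (suc k) i) (pair zero j)
          ≈⟨ +-cong (trans (Q₁-first _ j) (E-first-first i j)) (sum-cong-≋ (λ k → trans (Q₁-first _ j) (E-later-first k i j))) ⟩
        (onlyIf ⌊ i ≟ j ⌋ y - C i j) + ∑[ k < n₂′ ] (0# - C i j)
          ≈⟨ +-congˡ (sum-const n₂′ _) ⟩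
        (onlyIf ⌊ i ≟ j ⌋ y - C i j) + Over.ofℕ S n₂′ * (0# - C i j)
          ≈⟨ x-z+n[0-z]≈x-[1+n]z n₂′ _ _ ⟩
        G i j ∎

      upper-right : ∀ i c → Q₂ (i ↑ˡ rest) (n₁ ↑ʳ c) ≈ 0#
      upper-right i = combine-elim (λ c → Q₂ (i ↑ˡ rest) (n₁ ↑ʳ c) ≈ 0#) λ l j → begin
        Q₂ (pair zero i) (pair (suc l) j)
          ≈⟨ Q₂-first i (pair (suc l) j) ⟩
        Q₁ (pair zero i) (pair (suc l) j) + ∑[ k < n₂′ ] Q₁ (pair (suc k) i) (pair (suc l) j)
          ≈⟨ +-cong (trans (Q₁-later _ l j) (+-cong (E-first-later l i j) (-‿cong (E-first-first i j))))
                    (sum-cong-≋ (λ k → trans (Q₁-later _ l j) (trans (+-cong (E-later-later k l i j) (-‿cong (E-later-first k i j))) (x-z-[0-z]≈x _ _)))) ⟩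
        ((0# - C i j) - (onlyIf ⌊ i ≟ j ⌋ y - C i j)) + ∑[ k < n₂′ ] onlyIf (⌊ i ≟ j ⌋ ∧ ⌊ k ≟ l ⌋) y
          ≈⟨ +-congˡ (sum-δ _ l (λ k k≢l → reflexive (≡.trans (≡.cong (λ b → onlyIf (⌊ i ≟ j ⌋ ∧ b) y) (⌊≟⌋-≢ k≢l)) (≡.cong (λ b → onlyIf b y) (∧-zeroʳ _))))) ⟩
        ((0# - C i j) - (onlyIf ⌊ i ≟ j ⌋ y - C i j)) + onlyIf (⌊ i ≟ j ⌋ ∧ ⌊ l ≟ l ⌋) y
          ≡⟨ ≡.cong (λ b → ((0# - C i j) - (onlyIf ⌊ i ≟ j ⌋ y - C i j)) + onlyIf b y) (≡.trans (≡.cong (⌊ i ≟ j ⌋ ∧_) (⌊≟⌋-refl l)) (∧-identityʳ _)) ⟩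
        ((0# - C i j) - (onlyIf ⌊ i ≟ j ⌋ y - C i j)) + onlyIf ⌊ i ≟ j ⌋ y
          ≈⟨ [0-z]-[x-z]+x≈0 _ _ ⟩
        0# ∎

      yI : Matrix rest
      yI r c = onlyIf ⌊ r ≟ c ⌋ y

      lower-right : ∀ r c → Q₂ (n₁ ↑ʳ r) (n₁ ↑ʳ c) ≈ yI r c
      lower-right = combine-elim (λ r → ∀ c → Q₂ (n₁ ↑ʳ r) (n₁ ↑ʳ c) ≈ yI r c) λ k i →
                    combine-elim (λ c → Q₂ (n₁ ↑ʳ combine k i) (n₁ ↑ʳ c) ≈ yI (combine k i) c) λ l j → begin
        Q₂ (pair (suc k) i) (pair (suc l) j)
          ≈⟨ trans (Q₂-later k i _) (Q₁-later _ l j) ⟩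
        Q (pair (suc k) i) (pair (suc l) j) - Q (pair (suc k) i) (pair zero j)
          ≈⟨ +-cong (E-later-later k l i j) (-‿cong (E-later-first k i j)) ⟩
        (onlyIf (⌊ i ≟ j ⌋ ∧ ⌊ k ≟ l ⌋) y - C i j) - (0# - C i j)
          ≈⟨ x-z-[0-z]≈x _ _ ⟩
        onlyIf (⌊ i ≟ j ⌋ ∧ ⌊ k ≟ l ⌋) y
          ≡⟨ ≡.cong (λ b → onlyIf b y) (≡.trans (∧-comm ⌊ i ≟ j ⌋ ⌊ k ≟ l ⌋) (≡.sym (⌊≟⌋-combine k l i j))) ⟩
        yI (combine k i) (combine l j) ∎

      det-Q : det NN Q ≈ det n₁ G * y ^ rest
      det-Q = begin
        det NN Q
          ≈⟨ trans det-Q₂ det-Q₁ ⟨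
        det NN Q₂
          ≈⟨ det-blockLowerTriangular n₁ rest Q₂ G yI upper-right upper-left lower-right ⟩
        det n₁ G * det rest yI
          ≈⟨ *-congˡ det-yI ⟩
        det n₁ G * y ^ rest ∎
        where
        det-yI : det rest yI ≈ y ^ rest
        det-yI = trans (det-diagonal rest yI (λ _ → y) (λ r → reflexive (≡.cong (λ b → onlyIf b y) (⌊≟⌋-refl r)))
                                      (λ r s r≢s → reflexive (onlyIf-⌊≟⌋ r s y r≢s)))
                       (product-replicate rest)

  det-yI-C⊗J : ∀ n₁ n₂′ y (C : Matrix n₁) (P : Matrix (n₁ ℕ.* suc n₂′)) →
    (∀ (i : Fin n₁) (k : Fin (suc n₂′)) j l → P (combine i k) (combine j l) ≈ onlyIf (⌊ i ≟ j ⌋ ∧ ⌊ k ≟ l ⌋) y - C i j) →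
    det (n₁ ℕ.* suc n₂′) P ≈ det n₁ (λ i j → onlyIf ⌊ i ≟ j ⌋ y - Over.ofℕ S (suc n₂′) * C i j) * y ^ (n₂′ ℕ.* n₁)
  det-yI-C⊗J n₁ n₂′ y C P P≈ = trans (sym (det-reindex π P)) (BlockOnes.det-Q n₁ n₂′ y C _ Q≈)
    where
    π : Permutation (suc n₂′ ℕ.* n₁) (n₁ ℕ.* suc n₂′)
    π = swapCombine (suc n₂′) n₁
    Q≈ : ∀ k i l j → P (π ⟨$⟩ʳ combine k i) (π ⟨$⟩ʳ combine l j) ≈ onlyIf (⌊ i ≟ j ⌋ ∧ ⌊ k ≟ l ⌋) y - C i j
    Q≈ k i l j = trans
      (reflexive (≡.cong₂ (λ p q → P (combine (proj₂ p) (proj₁ p)) (combine (proj₂ q) (proj₁ q)))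
                          (remQuot-combine k i) (remQuot-combine l j)))
      (P≈ i k j l)

module ProductMatrix {c ℓ} (R : CommutativeRing c ℓ) {n₁ n₂′ : ℕ} (Σ₁ : SignedGraph n₁) (Σ₂ : SignedGraph (suc n₂′)) where
  private
    module R = CommutativeRing R
    module O = Over R
  open Polynomial R using (Poly; X; _-ₚ_; 0ₚ; mk≋; DegreeAtMost; polynomialRing; const-isRingHomomorphism; xI-A-entry-degree; get)
    renaming (const to ⟨_⟩)
  open CommutativeRing polynomialRing hiding (zero)
  open RingMorphisms.IsRingHomomorphism const-isRingHomomorphism using (+-homo; *-homo; -‿homo; 0#-homo)
    renaming (⟦⟧-cong to ⟨⟩-cong)
  open RingSum polynomialRing
  open Determinant polynomialRing
  open Kronecker polynomialRing using (onlyIf)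
  open import Algebra.Properties.Ring ring using (-‿distribˡ-*; -‿distribʳ-*; -0#≈0#; -‿+-comm; x[y-z]≈xy-xz)
  open import Algebra.Properties.CommutativeSemigroup *-commutativeSemigroup
    using () renaming (x∙yz≈y∙xz to x*[y*z]≈y*[x*z]; interchange to *-interchange)
  open import Algebra.Properties.CommutativeSemigroup +-commutativeSemigroup
    using () renaming (x∙yz≈y∙xz to x+[y+z]≈y+[x+z])
  open import Relation.Binary.Reasoning.Setoid setoid

  n₂ N : ℕ
  n₂ = suc n₂′
  N  = n₁ ℕ.* n₂

  a b : Fin n₁ → Fin n₂ → Fin (N ℕ.+ N)
  a i k = combine i k ↑ˡ N
  b i k = N ↑ʳ combine i k

  A⊛ : Fin (N ℕ.+ N) → Fin (N ℕ.+ N) → R.Carrier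
  A⊛ = O.adjMat (Σ₁ ⊛ Σ₂)

  A₁ : Fin n₁ → Fin n₁ → R.Carrier
  A₁ = O.adjMat (μSigned Σ₁)

  A₂ : Fin n₂ → Fin n₂ → R.Carrier
  A₂ = O.adjMat (μSigned Σ₂)

  μ₁ : Fin n₁ → Poly
  μ₁ i = ⟨ O.ofSign (mark Σ₁ i) ⟩

  μ₂ : Fin n₂ → Poly
  μ₂ k = ⟨ O.ofSign (mark Σ₂ k) ⟩

  M : Matrix (N ℕ.+ N)
  M = O.xI-A (N ℕ.+ N) A⊛

  B : Matrix n₂
  B = O.xI-A n₂ A₂

  private
    A⊛-aa : ∀ i k j l → A⊛ (a i k) (a j l) ≡ A₁ i j
    A⊛-aa i k j l rewrite splitAt-↑ˡ N (combine i k) N | splitAt-↑ˡ N (combine j l) N =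
      ≡.cong₂ A₁ (≡.cong proj₁ (remQuot-combine i k)) (≡.cong proj₁ (remQuot-combine j l))

    A⊛-ab : ∀ i k j l → A⊛ (a i k) (b j l) ≡ (if ⌊ i ≟ j ⌋ then O.ofSign (mark Σ₁ i Sign.* mark Σ₂ l) else R.0#)
    A⊛-ab i k j l rewrite splitAt-↑ˡ N (combine i k) N | splitAt-↑ʳ N N (combine j l) =
      ≡.cong₂ (λ x y → if ⌊ proj₁ x ≟ proj₁ y ⌋ then O.ofSign (mark Σ₁ (proj₁ x) Sign.* mark Σ₂ (proj₂ y)) else R.0#)
              (remQuot-combine i k) (remQuot-combine j l)

    A⊛-ba : ∀ i k j l → A⊛ (b i k) (a j l) ≡ (if ⌊ j ≟ i ⌋ then O.ofSign (mark Σ₂ k Sign.* mark Σ₁ j) else R.0#)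
    A⊛-ba i k j l rewrite splitAt-↑ʳ N N (combine i k) | splitAt-↑ˡ N (combine j l) N =
      ≡.cong₂ (λ x y → if ⌊ proj₁ y ≟ proj₁ x ⌋ then O.ofSign (mark Σ₂ (proj₂ x) Sign.* mark Σ₁ (proj₁ y)) else R.0#)
              (remQuot-combine i k) (remQuot-combine j l)

    A⊛-bb : ∀ i k j l → A⊛ (b i k) (b j l) ≡ (if ⌊ i ≟ j ⌋ ∧ adj Σ₂ k l then O.ofSign (mark Σ₂ k Sign.* mark Σ₂ l) else R.0#)
    A⊛-bb i k j l rewrite splitAt-↑ʳ N N (combine i k) | splitAt-↑ʳ N N (combine j l) =
      ≡.cong₂ (λ x y → if ⌊ proj₁ x ≟ proj₁ y ⌋ ∧ adj Σ₂ (proj₂ x) (proj₂ y) then O.ofSign (mark Σ₂ (proj₂ x) Sign.* mark Σ₂ (proj₂ y)) else R.0#)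
              (remQuot-combine i k) (remQuot-combine j l)

    ⌊a≟a⌋ : ∀ i k j l → ⌊ a i k ≟ a j l ⌋ ≡ ⌊ i ≟ j ⌋ ∧ ⌊ k ≟ l ⌋
    ⌊a≟a⌋ i k j l = ≡.trans (⌊≟⌋-injective (_↑ˡ N) (↑ˡ-injective N _ _) (combine i k) (combine j l)) (⌊≟⌋-combine i j k l)

    ⌊b≟b⌋ : ∀ i k j l → ⌊ b i k ≟ b j l ⌋ ≡ ⌊ i ≟ j ⌋ ∧ ⌊ k ≟ l ⌋
    ⌊b≟b⌋ i k j l = ≡.trans (⌊≟⌋-injective (N ↑ʳ_) (↑ʳ-injective N _ _) (combine i k) (combine j l)) (⌊≟⌋-combine i j k l)

    a≢b : ∀ x y → x ↑ˡ N ≢ N ↑ʳ y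
    a≢b x y e with () ← ≡.trans (≡.sym (splitAt-↑ˡ N x N)) (≡.trans (≡.cong (splitAt N) e) (splitAt-↑ʳ N N y))

    ofSign-* : ∀ s t → O.ofSign (s Sign.* t) R.≈ O.ofSign s R.* O.ofSign t
    ofSign-* Sign.+ t      = R.sym (R.*-identityˡ _)
    ofSign-* Sign.- Sign.+ = R.sym (R.*-identityʳ _)
    ofSign-* Sign.- Sign.- = R.sym (R.trans (-1*x≈-x′ (R.- R.1#)) (-‿involutive′ R.1#))
      where open import Algebra.Properties.Ring R.ring using () renaming (-1*x≈-x to -1*x≈-x′; -‿involutive to -‿involutive′)

    0-⟨if⟩ : ∀ β x → 0ₚ -ₚ ⟨ if β then x else R.0# ⟩ ≈ onlyIf β (- ⟨ x ⟩)
    0-⟨if⟩ true  x = +-identityˡ _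
    0-⟨if⟩ false x = mk≋ λ { zero → -0#≈0#′ ; (suc k) → R.refl }
      where open import Algebra.Properties.Ring R.ring using () renaming (-0#≈0# to -0#≈0#′)

    onlyIf-cong : ∀ β {x y} → x ≈ y → onlyIf β x ≈ onlyIf β y
    onlyIf-cong true  x≈y = x≈y
    onlyIf-cong false x≈y = refl

    ⟨ofSign-*⟩ : ∀ s t → - ⟨ O.ofSign (s Sign.* t) ⟩ ≈ - (⟨ O.ofSign s ⟩ * ⟨ O.ofSign t ⟩)
    ⟨ofSign-*⟩ s t = -‿cong (trans (⟨⟩-cong (ofSign-* s t)) (*-homo _ _))

  M-aa : ∀ i k j l → M (a i k) (a j l) ≡ onlyIf (⌊ i ≟ j ⌋ ∧ ⌊ k ≟ l ⌋) X -ₚ ⟨ A₁ i j ⟩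
  M-aa i k j l = ≡.cong₂ (λ β z → onlyIf β X -ₚ ⟨ z ⟩) (⌊a≟a⌋ i k j l) (A⊛-aa i k j l)

  M-ab : ∀ i k j l → M (a i k) (b j l) ≈ onlyIf ⌊ i ≟ j ⌋ (- (μ₁ i * μ₂ l))
  M-ab i k j l = begin
    M (a i k) (b j l)
      ≡⟨ ≡.cong₂ (λ β z → onlyIf β X -ₚ ⟨ z ⟩) (⌊≟⌋-≢ (a≢b (combine i k) (combine j l))) (A⊛-ab i k j l) ⟩
    0ₚ -ₚ ⟨ if ⌊ i ≟ j ⌋ then O.ofSign (mark Σ₁ i Sign.* mark Σ₂ l) else R.0# ⟩
      ≈⟨ 0-⟨if⟩ ⌊ i ≟ j ⌋ _ ⟩
    onlyIf ⌊ i ≟ j ⌋ (- ⟨ O.ofSign (mark Σ₁ i Sign.* mark Σ₂ l) ⟩)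
      ≈⟨ onlyIf-cong ⌊ i ≟ j ⌋ (⟨ofSign-*⟩ (mark Σ₁ i) (mark Σ₂ l)) ⟩
    onlyIf ⌊ i ≟ j ⌋ (- (μ₁ i * μ₂ l)) ∎

  M-ba : ∀ i k j l → M (b i k) (a j l) ≈ onlyIf ⌊ j ≟ i ⌋ (- (μ₂ k * μ₁ j))
  M-ba i k j l = begin
    M (b i k) (a j l)
      ≡⟨ ≡.cong₂ (λ β z → onlyIf β X -ₚ ⟨ z ⟩) (⌊≟⌋-≢ (a≢b (combine j l) (combine i k) ∘ ≡.sym)) (A⊛-ba i k j l) ⟩
    0ₚ -ₚ ⟨ if ⌊ j ≟ i ⌋ then O.ofSign (mark Σ₂ k Sign.* mark Σ₁ j) else R.0# ⟩
      ≈⟨ 0-⟨if⟩ ⌊ j ≟ i ⌋ _ ⟩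
    onlyIf ⌊ j ≟ i ⌋ (- ⟨ O.ofSign (mark Σ₂ k Sign.* mark Σ₁ j) ⟩)
      ≈⟨ onlyIf-cong ⌊ j ≟ i ⌋ (⟨ofSign-*⟩ (mark Σ₂ k) (mark Σ₁ j)) ⟩
    onlyIf ⌊ j ≟ i ⌋ (- (μ₂ k * μ₁ j)) ∎

  M-bb : ∀ i k j l → M (b i k) (b j l) ≈ onlyIf ⌊ i ≟ j ⌋ (B k l)
  M-bb i k j l = by-cases ⌊ i ≟ j ⌋ (≡.cong₂ (λ β z → onlyIf β X -ₚ ⟨ z ⟩) (⌊b≟b⌋ i k j l) (A⊛-bb i k j l))
    where
    by-cases : ∀ β → M (b i k) (b j l) ≡ onlyIf (β ∧ ⌊ k ≟ l ⌋) X -ₚ ⟨ if β ∧ adj Σ₂ k l then O.ofSign (mark Σ₂ k Sign.* mark Σ₂ l) else R.0# ⟩ →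
               M (b i k) (b j l) ≈ onlyIf β (B k l)
    by-cases true  M≡ = reflexive M≡
    by-cases false M≡ = trans (reflexive M≡) (0-⟨if⟩ false R.0#)

  f : Poly
  f = det n₂ B

  w : Fin n₂ → Poly
  w q = ∑[ r < n₂ ] (μ₂ r * adjugate n₂′ B r q)

  p : Poly
  p = ∑[ q < n₂ ] (w q * μ₂ q)

  w-B : ∀ l → ∑[ q < n₂ ] (w q * B q l) ≈ f * μ₂ l
  w-B l = begin
    ∑[ q < n₂ ] (w q * B q l)
      ≈⟨ sum-cong-≋ (λ q → trans (*-distribʳ-sum (B q l) (λ r → μ₂ r * adjugate n₂′ B r q))
                                 (sum-cong-≋ (λ r → *-assoc (μ₂ r) (adjugate n₂′ B r q) (B q l)))) ⟩
    ∑[ q < n₂ ] ∑[ r < n₂ ] (μ₂ r * (adjugate n₂′ B r q * B q l))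
      ≈⟨ ∑-comm (λ q r → μ₂ r * (adjugate n₂′ B r q * B q l)) ⟩
    ∑[ r < n₂ ] ∑[ q < n₂ ] (μ₂ r * (adjugate n₂′ B r q * B q l))
      ≈⟨ sum-cong-≋ (λ r → *-distribˡ-sum (μ₂ r) (λ q → adjugate n₂′ B r q * B q l)) ⟨
    ∑[ r < n₂ ] (μ₂ r * ∑[ q < n₂ ] (adjugate n₂′ B r q * B q l))
      ≈⟨ sum-δ _ l (λ r r≢l → trans (*-congˡ {μ₂ r} (adjugate-*-offDiagonal n₂′ B r l r≢l)) (zeroʳ (μ₂ r))) ⟩
    μ₂ l * ∑[ q < n₂ ] (adjugate n₂′ B l q * B q l)
      ≈⟨ *-congˡ {μ₂ l} (adjugate-*-diagonal n₂′ B l) ⟩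
    μ₂ l * f
      ≈⟨ *-comm _ _ ⟩
    f * μ₂ l ∎

  -- Every row a i k is multiplied by f and receives μ₁ i times the
  -- combination w of the rows b i q; by w-B this clears the block a–b.
  private
    isA : Fin (N ℕ.+ N) → Bool
    isA x = [ (λ _ → true) , (λ _ → false) ]′ (splitAt N x)

    coords : Fin (N ℕ.+ N) → Fin n₁ × Fin n₂
    coords x = remQuot {n₁} n₂ ([ (λ r → r) , (λ r → r) ]′ (splitAt N x))

    isA-a : ∀ r → isA (r ↑ˡ N) ≡ true
    isA-a r = ≡.cong [ (λ _ → true) , (λ _ → false) ]′ (splitAt-↑ˡ N r N)

    isA-b : ∀ r → isA (N ↑ʳ r) ≡ false
    isA-b r = ≡.cong [ (λ _ → true) , (λ _ → false) ]′ (splitAt-↑ʳ N N r)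

    coords-a : ∀ i k → coords (a i k) ≡ (i , k)
    coords-a i k = ≡.trans (≡.cong (remQuot n₂ ∘ [ (λ r → r) , (λ r → r) ]′) (splitAt-↑ˡ N (combine i k) N)) (remQuot-combine i k)

    coords-b : ∀ i k → coords (b i k) ≡ (i , k)
    coords-b i k = ≡.trans (≡.cong (remQuot n₂ ∘ [ (λ r → r) , (λ r → r) ]′) (splitAt-↑ʳ N N (combine i k))) (remQuot-combine i k)

    rowCoeff : Matrix (N ℕ.+ N)
    rowCoeff x t = if isA t then 0# else onlyIf ⌊ proj₁ (coords x) ≟ proj₁ (coords t) ⌋ (μ₁ (proj₁ (coords x)) * w (proj₂ (coords t)))

  Mᵣ : Matrix (N ℕ.+ N)
  Mᵣ x y = if isA x then f * M x y + ∑[ t < N ℕ.+ N ] (rowCoeff x t * M t y) else M x y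

  det-Mᵣ : det (N ℕ.+ N) Mᵣ ≈ f ^ N * det (N ℕ.+ N) M
  det-Mᵣ = trans
    (det-rowOperations (N ℕ.+ N) M Mᵣ isA (λ _ → f) rowCoeff
      (λ j t isA-t → reflexive (if-true isA-t)) (λ j r isA-j → reflexive (if-false isA-j)) (λ j r isA-j → reflexive (if-true isA-j)))
    (*-congʳ (begin
      product (λ j → if isA j then f else 1#)
        ≈⟨ product-↑ N (λ j → if isA j then f else 1#) ⟩
      product (λ r → if isA (r ↑ˡ N) then f else 1#) * product (λ r → if isA (N ↑ʳ r) then f else 1#)
        ≈⟨ *-cong (trans (product-cong (λ r → reflexive (if-true (isA-a r)))) (product-replicate N))
                  (product-ones (λ r → reflexive (if-false (isA-b r)))) ⟩
      f ^ N * 1#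
        ≈⟨ *-identityʳ _ ⟩
      f ^ N ∎))

  private
    combination : ∀ i k y → ∑[ t < N ℕ.+ N ] (rowCoeff (a i k) t * M t y) ≈ ∑[ q < n₂ ] (μ₁ i * w q * M (b i q) y)
    combination i k y = begin
      ∑[ t < N ℕ.+ N ] (rowCoeff (a i k) t * M t y)
        ≈⟨ sum-↑ N (λ t → rowCoeff (a i k) t * M t y) ⟩
      (∑[ r < N ] (rowCoeff (a i k) (r ↑ˡ N) * M (r ↑ˡ N) y)) + (∑[ r < N ] (rowCoeff (a i k) (N ↑ʳ r) * M (N ↑ʳ r) y))
        ≈⟨ +-cong (sum-zero (λ r → trans (*-congʳ {M (r ↑ˡ N) y} (reflexive (if-true (isA-a r)))) (zeroˡ (M (r ↑ˡ N) y))))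
                  (sum-combine n₁ (λ r → rowCoeff (a i k) (N ↑ʳ r) * M (N ↑ʳ r) y)) ⟩
      0# + ∑[ i′ < n₁ ] ∑[ q < n₂ ] (rowCoeff (a i k) (b i′ q) * M (b i′ q) y)
        ≈⟨ +-identityˡ _ ⟩
      ∑[ i′ < n₁ ] ∑[ q < n₂ ] (rowCoeff (a i k) (b i′ q) * M (b i′ q) y)
        ≈⟨ sum-δ _ i other-blocks ⟩
      ∑[ q < n₂ ] (rowCoeff (a i k) (b i q) * M (b i q) y)
        ≈⟨ sum-cong-≋ (λ q → *-congʳ {M (b i q) y} (reflexive (≡.trans (coefficient i q) (≡.cong (λ β → onlyIf β (μ₁ i * w q)) (⌊≟⌋-refl i))))) ⟩
      ∑[ q < n₂ ] (μ₁ i * w q * M (b i q) y) ∎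
      where
      coefficient : ∀ i′ q → rowCoeff (a i k) (b i′ q) ≡ onlyIf ⌊ i ≟ i′ ⌋ (μ₁ i * w q)
      coefficient i′ q = ≡.trans (if-false (isA-b (combine i′ q)))
        (≡.cong₂ (λ x t → onlyIf ⌊ proj₁ x ≟ proj₁ t ⌋ (μ₁ (proj₁ x) * w (proj₂ t))) (coords-a i k) (coords-b i′ q))
      other-blocks : ∀ i′ → i′ ≢ i → ∑[ q < n₂ ] (rowCoeff (a i k) (b i′ q) * M (b i′ q) y) ≈ 0#
      other-blocks i′ i′≢i = sum-zero λ q → trans
        (*-congʳ {M (b i′ q) y} (reflexive (≡.trans (coefficient i′ q) (≡.cong (λ β → onlyIf β (μ₁ i * w q)) (⌊≟⌋-≢ (i′≢i ∘ ≡.sym))))))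
        (zeroˡ (M (b i′ q) y))

    Mᵣ-a : ∀ i k y → Mᵣ (a i k) y ≈ f * M (a i k) y + ∑[ q < n₂ ] (μ₁ i * w q * M (b i q) y)
    Mᵣ-a i k y = trans (reflexive (if-true (isA-a (combine i k)))) (+-congˡ (combination i k y))

    μ₁² : ∀ i → μ₁ i * μ₁ i ≈ 1#
    μ₁² i = trans (sym (*-homo _ _)) (⟨⟩-cong (R.trans (R.sym (ofSign-* (mark Σ₁ i) (mark Σ₁ i))) (R.reflexive (≡.cong O.ofSign (s*s≡+ (mark Σ₁ i))))))
      where
      s*s≡+ : ∀ s → s Sign.* s ≡ Sign.+
      s*s≡+ Sign.+ = ≡.refl
      s*s≡+ Sign.- = ≡.refl

  Mᵣ-ab : ∀ i k j l → Mᵣ (a i k) (b j l) ≈ 0#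
  Mᵣ-ab i k j l with i ≟ j
  ... | yes ≡.refl = begin
    Mᵣ (a i k) (b i l)
      ≈⟨ Mᵣ-a i k (b i l) ⟩
    f * M (a i k) (b i l) + ∑[ q < n₂ ] (μ₁ i * w q * M (b i q) (b i l))
      ≈⟨ +-cong (*-congˡ {f} (trans (M-ab i k i l) (reflexive (if-true (⌊≟⌋-refl i)))))
                (sum-cong-≋ (λ q → trans (*-congˡ {μ₁ i * w q} (trans (M-bb i q i l) (reflexive (if-true (⌊≟⌋-refl i))))) (*-assoc (μ₁ i) (w q) (B q l)))) ⟩
    f * - (μ₁ i * μ₂ l) + ∑[ q < n₂ ] (μ₁ i * (w q * B q l))
      ≈⟨ +-cong (-‿distribʳ-* f _) (*-distribˡ-sum (μ₁ i) (λ q → w q * B q l)) ⟨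
    - (f * (μ₁ i * μ₂ l)) + μ₁ i * ∑[ q < n₂ ] (w q * B q l)
      ≈⟨ +-congˡ (trans (*-congˡ {μ₁ i} (w-B l)) (x*[y*z]≈y*[x*z] (μ₁ i) f (μ₂ l))) ⟩
    - (f * (μ₁ i * μ₂ l)) + f * (μ₁ i * μ₂ l)
      ≈⟨ -‿inverseˡ (f * (μ₁ i * μ₂ l)) ⟩
    0# ∎
  ... | no i≢j = begin
    Mᵣ (a i k) (b j l)
      ≈⟨ Mᵣ-a i k (b j l) ⟩
    f * M (a i k) (b j l) + ∑[ q < n₂ ] (μ₁ i * w q * M (b i q) (b j l))
      ≈⟨ +-cong (*-congˡ {f} (trans (M-ab i k j l) (reflexive (if-false (⌊≟⌋-≢ i≢j)))))
                (sum-zero (λ q → trans (*-congˡ {μ₁ i * w q} (trans (M-bb i q j l) (reflexive (if-false (⌊≟⌋-≢ i≢j))))) (zeroʳ (μ₁ i * w q)))) ⟩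
    f * 0# + 0#
      ≈⟨ +-identityʳ _ ⟩
    f * 0#
      ≈⟨ zeroʳ f ⟩
    0# ∎

  C : Matrix n₁
  C i j = f * ⟨ A₁ i j ⟩ + onlyIf ⌊ i ≟ j ⌋ p

  Mᵣ-aa : ∀ i k j l → Mᵣ (a i k) (a j l) ≈ onlyIf (⌊ i ≟ j ⌋ ∧ ⌊ k ≟ l ⌋) (f * X) - C i j
  Mᵣ-aa i k j l = begin
    Mᵣ (a i k) (a j l)
      ≈⟨ Mᵣ-a i k (a j l) ⟩
    f * M (a i k) (a j l) + ∑[ q < n₂ ] (μ₁ i * w q * M (b i q) (a j l))
      ≈⟨ +-cong (*-congˡ {f} (reflexive (M-aa i k j l))) through-b ⟩
    f * (onlyIf (⌊ i ≟ j ⌋ ∧ ⌊ k ≟ l ⌋) X - ⟨ A₁ i j ⟩) + - onlyIf ⌊ i ≟ j ⌋ p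
      ≈⟨ +-congʳ (trans (distribˡ f (onlyIf (⌊ i ≟ j ⌋ ∧ ⌊ k ≟ l ⌋) X) (- ⟨ A₁ i j ⟩))
                        (+-cong (f*onlyIf (⌊ i ≟ j ⌋ ∧ ⌊ k ≟ l ⌋)) (sym (-‿distribʳ-* f ⟨ A₁ i j ⟩)))) ⟩
    (onlyIf (⌊ i ≟ j ⌋ ∧ ⌊ k ≟ l ⌋) (f * X) - f * ⟨ A₁ i j ⟩) - onlyIf ⌊ i ≟ j ⌋ p
      ≈⟨ +-assoc (onlyIf (⌊ i ≟ j ⌋ ∧ ⌊ k ≟ l ⌋) (f * X)) (- (f * ⟨ A₁ i j ⟩)) (- onlyIf ⌊ i ≟ j ⌋ p) ⟩
    onlyIf (⌊ i ≟ j ⌋ ∧ ⌊ k ≟ l ⌋) (f * X) + (- (f * ⟨ A₁ i j ⟩) - onlyIf ⌊ i ≟ j ⌋ p)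
      ≈⟨ +-congˡ (-‿+-comm (f * ⟨ A₁ i j ⟩) (onlyIf ⌊ i ≟ j ⌋ p)) ⟩
    onlyIf (⌊ i ≟ j ⌋ ∧ ⌊ k ≟ l ⌋) (f * X) - C i j ∎
    where
    f*onlyIf : ∀ β → f * onlyIf β X ≈ onlyIf β (f * X)
    f*onlyIf true  = refl
    f*onlyIf false = zeroʳ f
    through-b : ∑[ q < n₂ ] (μ₁ i * w q * M (b i q) (a j l)) ≈ - onlyIf ⌊ i ≟ j ⌋ p
    through-b with i ≟ j
    ... | yes ≡.refl = begin
      ∑[ q < n₂ ] (μ₁ i * w q * M (b i q) (a i l))
        ≈⟨ sum-cong-≋ (λ q → *-congˡ {μ₁ i * w q} (trans (M-ba i q i l) (reflexive (if-true (⌊≟⌋-refl i))))) ⟩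
      ∑[ q < n₂ ] (μ₁ i * w q * - (μ₂ q * μ₁ i))
        ≈⟨ sum-cong-≋ (λ q → trans (sym (-‿distribʳ-* (μ₁ i * w q) (μ₂ q * μ₁ i))) (-‿cong (μ₁-cancel q))) ⟩
      ∑[ q < n₂ ] (- (w q * μ₂ q))
        ≈⟨ -‿distrib-sum (λ q → w q * μ₂ q) ⟨
      - p ∎
      where
      μ₁-cancel : ∀ q → μ₁ i * w q * (μ₂ q * μ₁ i) ≈ w q * μ₂ q
      μ₁-cancel q = begin
        μ₁ i * w q * (μ₂ q * μ₁ i)   ≈⟨ *-congˡ {μ₁ i * w q} (*-comm (μ₂ q) (μ₁ i)) ⟩
        μ₁ i * w q * (μ₁ i * μ₂ q)   ≈⟨ *-interchange (μ₁ i) (w q) (μ₁ i) (μ₂ q) ⟩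
        μ₁ i * μ₁ i * (w q * μ₂ q)   ≈⟨ *-congʳ (μ₁² i) ⟩
        1# * (w q * μ₂ q)            ≈⟨ *-identityˡ (w q * μ₂ q) ⟩
        w q * μ₂ q                   ∎
    ... | no i≢j = begin
      ∑[ q < n₂ ] (μ₁ i * w q * M (b i q) (a j l))
        ≈⟨ sum-zero (λ q → trans (*-congˡ {μ₁ i * w q} (trans (M-ba i q j l) (reflexive (if-false (⌊≟⌋-≢ (i≢j ∘ ≡.sym)))))) (zeroʳ (μ₁ i * w q))) ⟩
      0#
        ≈⟨ -0#≈0# ⟨
      - 0# ∎

  Mᵣ-bb : ∀ i k j l → Mᵣ (b i k) (b j l) ≈ onlyIf ⌊ i ≟ j ⌋ (B k l)
  Mᵣ-bb i k j l = trans (reflexive (if-false (isA-b (combine i k)))) (M-bb i k j l)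

  G : Matrix n₁
  G i j = onlyIf ⌊ i ≟ j ⌋ (f * X) - Over.ofℕ polynomialRing n₂ * C i j

  f^N*det-M : f ^ N * det (N ℕ.+ N) M ≈ det n₁ G * (f * X) ^ (n₂′ ℕ.* n₁) * f ^ n₁
  f^N*det-M = begin
    f ^ N * det (N ℕ.+ N) M
      ≈⟨ det-Mᵣ ⟨
    det (N ℕ.+ N) Mᵣ
      ≈⟨ det-blockLowerTriangular N N Mᵣ Mᵣ↖ Mᵣ↘ upper-right (λ _ _ → refl) (λ _ _ → refl) ⟩
    det N Mᵣ↖ * det N Mᵣ↘
      ≈⟨ *-cong (det-yI-C⊗J n₁ n₂′ (f * X) C Mᵣ↖ Mᵣ-aa) (det-blockDiagonal n₁ n₂ B Mᵣ↘ Mᵣ-bb) ⟩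
    det n₁ G * (f * X) ^ (n₂′ ℕ.* n₁) * f ^ n₁ ∎
    where
    open Kronecker polynomialRing using (det-yI-C⊗J; det-blockDiagonal)
    Mᵣ↖ Mᵣ↘ : Matrix N
    Mᵣ↖ r s = Mᵣ (r ↑ˡ N) (s ↑ˡ N)
    Mᵣ↘ r s = Mᵣ (N ↑ʳ r) (N ↑ʳ s)
    upper-right : ∀ r s → Mᵣ (r ↑ˡ N) (N ↑ʳ s) ≈ 0#
    upper-right = combine-elim (λ r → ∀ s → Mᵣ (r ↑ˡ N) (N ↑ʳ s) ≈ 0#) λ i k →
                  combine-elim (λ s → Mᵣ (a i k) (N ↑ʳ s) ≈ 0#) (Mᵣ-ab i k)

  -- Defs computes with its own ∑ₚ, ∏ₚ, ^ₚ and det, which agree with the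
  -- generic ones only up to ≈ₚ.

  private
    ∑ₚ≈sum : ∀ n (g : Fin n → Poly) → O.∑ₚ n g ≈ sum g
    ∑ₚ≈sum zero    g = refl
    ∑ₚ≈sum (suc n) g = +-congˡ {g zero} (∑ₚ≈sum n (g ∘ suc))

    ∏ₚ≈product : ∀ n (g : Fin n → Poly) → O.∏ₚ n g ≈ product g
    ∏ₚ≈product zero    g = refl
    ∏ₚ≈product (suc n) g = *-congˡ {g zero} (∏ₚ≈product n (g ∘ suc))

    ^ₚ≈^ : ∀ q n → q O.^ₚ n ≈ q ^ n
    ^ₚ≈^ q zero    = refl
    ^ₚ≈^ q (suc n) = *-congˡ {q} (^ₚ≈^ q n)

    altSignₚ≈altSign : ∀ k q → O.altSign k q ≈ altSign k q
    altSignₚ≈altSign zero    q = refl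
    altSignₚ≈altSign (suc k) q = -‿cong (altSignₚ≈altSign k q)

    detₚ≈det : ∀ n (L : Matrix n) → O.det n L ≈ det n L
    detₚ≈det zero    L = refl
    detₚ≈det (suc n) L = trans (∑ₚ≈sum (suc n) (λ j → O.altSign (toℕ j) (L zero j * O.det n (minor zero j L)))) (sum-cong-≋ λ j →
      trans (altSignₚ≈altSign (toℕ j) (L zero j * O.det n (minor zero j L))) (altSign-cong (toℕ j) (*-congˡ {L zero j} (detₚ≈det n (minor zero j L)))))

    ofℕ≈ofℕ : ∀ n → ⟨ O.ofℕ n ⟩ ≈ Over.ofℕ polynomialRing n
    ofℕ≈ofℕ zero    = 0#-homo
    ofℕ≈ofℕ (suc n) = trans (+-homo R.1# (O.ofℕ n)) (+-congˡ {1#} (ofℕ≈ofℕ n))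

  charPoly₂≈f : O.charPoly n₂ A₂ ≈ f
  charPoly₂≈f = detₚ≈det n₂ B

  coronalNum≈p : O.coronalNum n₂ A₂ (O.markVec Σ₂) ≈ p
  coronalNum≈p = begin
    O.coronalNum n₂ A₂ (O.markVec Σ₂)
      ≈⟨ trans (∑ₚ≈sum n₂ (λ i → O.∑ₚ n₂ (term i))) (sum-cong-≋ (λ i → ∑ₚ≈sum n₂ (term i))) ⟩
    ∑[ i < n₂ ] ∑[ j < n₂ ] (μ₂ i * O.adjugate n₂ B i j * μ₂ j)
      ≈⟨ sum-cong-≋ (λ i → sum-cong-≋ (λ j → *-congʳ {μ₂ j} (*-congˡ {μ₂ i} (trans (altSignₚ≈altSign (toℕ i ℕ.+ toℕ j) (O.det n₂′ (O.minor j i B)))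
           (altSign-cong (toℕ i ℕ.+ toℕ j) (detₚ≈det n₂′ (minor j i B))))))) ⟩
    ∑[ i < n₂ ] ∑[ j < n₂ ] (μ₂ i * adjugate n₂′ B i j * μ₂ j)
      ≈⟨ ∑-comm (λ i j → μ₂ i * adjugate n₂′ B i j * μ₂ j) ⟩
    ∑[ j < n₂ ] ∑[ i < n₂ ] (μ₂ i * adjugate n₂′ B i j * μ₂ j)
      ≈⟨ sum-cong-≋ (λ j → *-distribʳ-sum (μ₂ j) (λ i → μ₂ i * adjugate n₂′ B i j)) ⟨
    p ∎
    where
    term : Fin n₂ → Fin n₂ → Poly
    term i j = μ₂ i * O.adjugate n₂ B i j * μ₂ j

  -- The top coefficient of f is its homogenisation at (u , v) = (1 , 0), the
  -- determinant of the matrix of coefficients of x in x I − A₂, which is I.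
  f-monic : O.MonicOfDegree f n₂
  f-monic = top , proj₁ homogenised
    where
    open import Algebra.Morphism.Construct.Identity using (isRingHomomorphism)
    module HR = Homogenisation R R (λ a → a) (isRingHomomorphism R.rawRing R.refl) R.1# R.0#
    module DR = Determinant R
    homogenised : DegreeAtMost f n₂ × HR.homogenise n₂ f R.≈ DR.det n₂ (λ i j → HR.linear (B i j))
    homogenised = HR.homogenise-det n₂ B (λ i j → xI-A-entry-degree ⌊ i ≟ j ⌋ (A₂ i j))
    homog-top : ∀ n g → HR.homog n g R.≈ g n
    homog-top zero    g = R.refl
    homog-top (suc n) g = R.trans (R.+-cong (R.trans (R.*-congˡ (R.zeroˡ _)) (R.zeroʳ _)) (R.*-identityˡ _))
                                  (R.trans (R.+-identityˡ _) (homog-top n (g ∘ suc)))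
    linear-B : ∀ β a → HR.linear (onlyIf β X -ₚ ⟨ a ⟩) R.≈ (if β then R.1# else R.0#)
    linear-B true  a = R.trans (R.+-cong (R.zeroʳ _) (R.*-identityʳ _)) (R.+-identityˡ _)
    linear-B false a = R.trans (R.+-cong (R.zeroʳ _) (R.zeroˡ _)) (R.+-identityˡ _)
    top : O.coeff f n₂ R.≈ R.1#
    top = R.trans (R.sym (homog-top n₂ (O.coeff f))) (R.trans (proj₂ homogenised)
            (R.trans (DR.det-diagonal n₂ _ (λ _ → R.1#)
                       (λ r → R.trans (linear-B ⌊ r ≟ r ⌋ (A₂ r r)) (R.reflexive (if-true (⌊≟⌋-refl r))))
                       (λ r s r≢s → R.trans (linear-B ⌊ r ≟ s ⌋ (A₂ r s)) (R.reflexive (if-false (⌊≟⌋-≢ r≢s)))))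
                     (RingSum.product-ones R {n₂} (λ _ → R.refl))))

  f^k-cancel : ∀ k {q r} → f ^ k * q ≈ f ^ k * r → q ≈ r
  f^k-cancel zero    {q} {r} 1q≈1r = trans (sym (*-identityˡ q)) (trans 1q≈1r (*-identityˡ r))
  f^k-cancel (suc k) {q} {r} ffq≈ffr = f^k-cancel k (MonicCancellation.monic-*ₚ-cancelˡ R f n₂ f-monic _ _
    (trans (sym (*-assoc f (f ^ k) q)) (trans ffq≈ffr (*-assoc f (f ^ k) r))))

  module _ (λ′ : Fin n₁ → R.Carrier) (char₁ : O.charPoly n₁ A₁ O.≈ₚ O.∏ₚ n₁ (λ i → X -ₚ ⟨ λ′ i ⟩))
           (R′ F′ P′ : Poly) (f≈R′F′ : f ≈ R′ * F′) (p≈R′P′ : p ≈ R′ * P′) where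

    private
      n₂ᵖ : Poly
      n₂ᵖ = Over.ofℕ polynomialRing n₂

      u v : Poly
      u = f * X - n₂ᵖ * p
      v = n₂ᵖ * f

      -- Evaluating at X = u / v turns x I − A₁ into G and x − λ into the
      -- factor of det G belonging to λ.
      module H = Homogenisation R polynomialRing ⟨_⟩ const-isRingHomomorphism u v

      -‿a*v≈-[n*[f*a]] : ∀ a → - ⟨ a ⟩ * v ≈ - (n₂ᵖ * (f * ⟨ a ⟩))
      -‿a*v≈-[n*[f*a]] a = trans (sym (-‿distribˡ-* ⟨ a ⟩ v))
        (-‿cong (trans (x*[y*z]≈y*[x*z] ⟨ a ⟩ n₂ᵖ f) (*-congˡ {n₂ᵖ} (*-comm ⟨ a ⟩ f))))

      L₁ : Matrix n₁
      L₁ = O.xI-A n₁ A₁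

      linear-entry : ∀ β a → H.linear (onlyIf β X -ₚ ⟨ a ⟩) ≈ onlyIf β (f * X) - n₂ᵖ * (f * ⟨ a ⟩ + onlyIf β p)
      linear-entry true a = begin
        ⟨ R.0# R.+ R.- a ⟩ * v + 1# * u
          ≈⟨ +-cong (*-congʳ {v} (trans (⟨⟩-cong (R.+-identityˡ _)) (-‿homo a))) (*-identityˡ u) ⟩
        - ⟨ a ⟩ * v + u
          ≈⟨ +-congʳ {u} (-‿a*v≈-[n*[f*a]] a) ⟩
        - (n₂ᵖ * (f * ⟨ a ⟩)) + (f * X - n₂ᵖ * p)
          ≈⟨ x+[y+z]≈y+[x+z] (- (n₂ᵖ * (f * ⟨ a ⟩))) (f * X) (- (n₂ᵖ * p)) ⟩
        f * X + (- (n₂ᵖ * (f * ⟨ a ⟩)) - n₂ᵖ * p)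
          ≈⟨ +-congˡ {f * X} (trans (-‿+-comm (n₂ᵖ * (f * ⟨ a ⟩)) (n₂ᵖ * p)) (-‿cong (sym (distribˡ n₂ᵖ (f * ⟨ a ⟩) p)))) ⟩
        f * X - n₂ᵖ * (f * ⟨ a ⟩ + p) ∎
      linear-entry false a = begin
        ⟨ R.- a ⟩ * v + ⟨ R.0# ⟩ * u           ≈⟨ +-cong (*-congʳ {v} (-‿homo a)) (trans (*-congʳ {u} 0#-homo) (zeroˡ u)) ⟩
        - ⟨ a ⟩ * v + 0#                       ≈⟨ +-identityʳ (- ⟨ a ⟩ * v) ⟩
        - ⟨ a ⟩ * v                            ≈⟨ -‿a*v≈-[n*[f*a]] a ⟩
        - (n₂ᵖ * (f * ⟨ a ⟩))                  ≈⟨ -‿cong (*-congˡ {n₂ᵖ} (+-identityʳ (f * ⟨ a ⟩))) ⟨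
        - (n₂ᵖ * (f * ⟨ a ⟩ + 0#))             ≈⟨ +-identityˡ (- (n₂ᵖ * (f * ⟨ a ⟩ + 0#))) ⟨
        0# - n₂ᵖ * (f * ⟨ a ⟩ + 0#)            ∎

    det-G : det n₁ G ≈ product (λ i → f * X - n₂ᵖ * (f * ⟨ λ′ i ⟩ + p))
    det-G = begin
      det n₁ G
        ≈⟨ det-cong n₁ (λ i j → sym (linear-entry ⌊ i ≟ j ⌋ (A₁ i j))) ⟩
      det n₁ (λ i j → H.linear (L₁ i j))
        ≈⟨ proj₂ (H.homogenise-det n₁ L₁ (λ i j → xI-A-entry-degree ⌊ i ≟ j ⌋ (A₁ i j))) ⟨
      H.homogenise n₁ (det n₁ L₁)
        ≈⟨ H.homog-cong n₁ (get (trans (sym (detₚ≈det n₁ L₁)) (trans (mk≋ char₁) (∏ₚ≈product n₁ (λ i → X -ₚ ⟨ λ′ i ⟩))))) ⟩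
      H.homogenise n₁ (product (λ i → X -ₚ ⟨ λ′ i ⟩))
        ≈⟨ proj₂ (H.homogenise-product n₁ (λ i → X -ₚ ⟨ λ′ i ⟩) (λ i → xI-A-entry-degree true (λ′ i))) ⟩
      product (λ i → H.linear (X -ₚ ⟨ λ′ i ⟩))
        ≈⟨ product-cong (λ i → linear-entry true (λ′ i)) ⟩
      product (λ i → f * X - n₂ᵖ * (f * ⟨ λ′ i ⟩ + p)) ∎

    T : Fin n₁ → Poly
    T i = X * F′ - ⟨ O.ofℕ n₂ ⟩ * (⟨ λ′ i ⟩ * F′ + P′)

    factor : ∀ i → f * X - n₂ᵖ * (f * ⟨ λ′ i ⟩ + p) ≈ R′ * T i
    factor i = begin
      f * X - n₂ᵖ * (f * ⟨ λ′ i ⟩ + p)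
        ≈⟨ +-cong fX≈ (-‿cong (*-cong (sym (ofℕ≈ofℕ n₂)) fλ+p≈)) ⟩
      R′ * (X * F′) - ⟨ O.ofℕ n₂ ⟩ * (R′ * (⟨ λ′ i ⟩ * F′ + P′))
        ≈⟨ +-congˡ (-‿cong (x*[y*z]≈y*[x*z] ⟨ O.ofℕ n₂ ⟩ R′ (⟨ λ′ i ⟩ * F′ + P′))) ⟩
      R′ * (X * F′) - R′ * (⟨ O.ofℕ n₂ ⟩ * (⟨ λ′ i ⟩ * F′ + P′))
        ≈⟨ x[y-z]≈xy-xz R′ (X * F′) (⟨ O.ofℕ n₂ ⟩ * (⟨ λ′ i ⟩ * F′ + P′)) ⟨
      R′ * T i ∎
      where
      fX≈ : f * X ≈ R′ * (X * F′)
      fX≈ = trans (*-congʳ f≈R′F′) (trans (*-assoc R′ F′ X) (*-congˡ {R′} (*-comm F′ X)))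
      fλ+p≈ : f * ⟨ λ′ i ⟩ + p ≈ R′ * (⟨ λ′ i ⟩ * F′ + P′)
      fλ+p≈ = begin
        f * ⟨ λ′ i ⟩ + p                      ≈⟨ +-cong (*-congʳ f≈R′F′) p≈R′P′ ⟩
        R′ * F′ * ⟨ λ′ i ⟩ + R′ * P′          ≈⟨ +-congʳ (trans (*-assoc R′ F′ ⟨ λ′ i ⟩) (*-congˡ {R′} (*-comm F′ ⟨ λ′ i ⟩))) ⟩
        R′ * (⟨ λ′ i ⟩ * F′) + R′ * P′        ≈⟨ distribˡ R′ (⟨ λ′ i ⟩ * F′) P′ ⟨
        R′ * (⟨ λ′ i ⟩ * F′ + P′)             ∎

    charPoly-⊛ : O.charPoly (N ℕ.+ N) A⊛ ≈ X O.^ₚ (n₁ ℕ.* n₂′) O.*ₚ R′ O.^ₚ n₁ O.*ₚ O.∏ₚ n₁ T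
    charPoly-⊛ = begin
      O.charPoly (N ℕ.+ N) A⊛                   ≈⟨ detₚ≈det (N ℕ.+ N) M ⟩
      det (N ℕ.+ N) M                           ≈⟨ f^k-cancel N f^N*-both ⟩
      X ^ (n₁ ℕ.* n₂′) * R′ ^ n₁ * product T     ≈⟨ *-cong (*-cong (^ₚ≈^ X (n₁ ℕ.* n₂′)) (^ₚ≈^ R′ n₁)) (∏ₚ≈product n₁ T) ⟨
      X O.^ₚ (n₁ ℕ.* n₂′) O.*ₚ R′ O.^ₚ n₁ O.*ₚ O.∏ₚ n₁ T ∎
      where
      open import Algebra.Solver.CommutativeMonoid *-commutativeMonoid using (solve; _⊕_; _⊜_)
      k : ℕ
      k = n₂′ ℕ.* n₁
      N≡n₁+k : N ≡ n₁ ℕ.+ k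
      N≡n₁+k = ≡.trans (ℕₚ.*-suc n₁ n₂′) (≡.cong (n₁ ℕ.+_) (ℕₚ.*-comm n₁ n₂′))
      det-G≈ : det n₁ G ≈ R′ ^ n₁ * product T
      det-G≈ = trans det-G (trans (product-cong factor)
        (trans (product-distrib-* (λ _ → R′) T) (*-congʳ (product-replicate n₁))))
      f^N*-both : f ^ N * det (N ℕ.+ N) M ≈ f ^ N * (X ^ (n₁ ℕ.* n₂′) * R′ ^ n₁ * product T)
      f^N*-both = begin
        f ^ N * det (N ℕ.+ N) M
          ≈⟨ f^N*det-M ⟩
        det n₁ G * (f * X) ^ k * f ^ n₁
          ≈⟨ *-congʳ (*-cong det-G≈ (^-distrib-* f X k)) ⟩
        R′ ^ n₁ * product T * (f ^ k * X ^ k) * f ^ n₁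
          ≈⟨ solve 5 (λ r t a x b → ((r ⊕ t) ⊕ (a ⊕ x)) ⊕ b ⊜ (b ⊕ a) ⊕ ((x ⊕ r) ⊕ t)) refl (R′ ^ n₁) (product T) (f ^ k) (X ^ k) (f ^ n₁) ⟩
        f ^ n₁ * f ^ k * (X ^ k * R′ ^ n₁ * product T)
          ≈⟨ *-cong (trans (sym (^-homo-* f n₁ k)) (^-congʳ f (≡.sym N≡n₁+k))) (*-congʳ (*-congʳ (^-congʳ X (ℕₚ.*-comm n₂′ n₁)))) ⟩
        f ^ N * (X ^ (n₁ ℕ.* n₂′) * R′ ^ n₁ * product T) ∎

open import Data.Nat using (_+_; _*_; _∸_)

theorem2 : ∀ {c ℓ : Level} (R : CommutativeRing c ℓ) → let open Over R in
    ∀ {n₁ n₂ : ℕ} (Σ₁ : SignedGraph n₁) (Σ₂ : SignedGraph n₂) →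
    IsSignedGraph Σ₁ → IsSignedGraph Σ₂ → 1 ≤ n₁ → 1 ≤ n₂ →
    (λ' : Fin n₁ → CommutativeRing.Carrier R) →
    charPoly n₁ (adjMat (μSigned Σ₁)) ≈ₚ ∏ₚ n₁ (λ i → X -ₚ const (λ' i)) →
    (R' F' P' : Poly) →
    ReducedCoronal (coronalNum n₂ (adjMat (μSigned Σ₂)) (markVec Σ₂))
                   (charPoly n₂ (adjMat (μSigned Σ₂))) R' F' P' →
    charPoly (n₁ * n₂ + n₁ * n₂) (adjMat (Σ₁ ⊛ Σ₂))
      ≈ₚ X ^ₚ (n₁ * (n₂ ∸ 1)) *ₚ R' ^ₚ n₁ *ₚ
         ∏ₚ n₁ (λ i → X *ₚ F' -ₚ const (ofℕ n₂) *ₚ (const (λ' i) *ₚ F' +ₚ P'))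
theorem2 R Σ₁ Σ₂ _ _ _ (s≤s z≤n) λ' char₁ R' F' P' reduced =
  get (charPoly-⊛ λ' char₁ R' F' P'
    (≋-trans (≋-sym charPoly₂≈f) (mk≋ (Over.ReducedCoronal.f≈R'F' reduced)))
    (≋-trans (≋-sym coronalNum≈p) (mk≋ (Over.ReducedCoronal.p≈R'P' reduced))))
  where
  open Polynomial R using (mk≋; get; ≋-sym; ≋-trans)
  open ProductMatrix R Σ₁ Σ₂ using (charPoly-⊛; charPoly₂≈f; coronalNum≈p)
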